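{- Let $\ell\geq 3$ be prime, let $q$ be a prime with $q\equiv 1\pmod{\ell^2}$, and let $C_\ell$ be the nonsingular curve with affine model $y^\ell=x(x^\ell-1)$. Then $$\#C_\ell(\mathbb{F}_q)=q+1+\operatorname{Tr}_{\mathbb{Q}(\zeta)/\mathbb{Q}}\big(J_q(\ell(\ell-1),1)\big)=q+1+\sum_{s\in(\mathbb{Z}/\ell^2\mathbb{Z})^*}J_q\big(s\ell(\ell-1),s\big).$$
   Context: $\#C_\ell(\mathbb{F}_q)$ is the number of $\mathbb{F}_q$-rational points of the nonsingular projective curve. Let $\zeta$ be a primitive $\ell^2$-th root of unity and let $\chi:\mathbb{F}_q^*\to\mathbb{Q}(\zeta)^*$ be the multiplicative character of order $\ell^2$ determined by $\chi(x)\equiv x^{(q-1)/\ell^2}\pmod{q}$ (reduction modulo a fixed prime above $q$). Nontrivial powers $\chi^a$ are extended to $\mathbb{F}_q$ by $\chi^a(0)=0$, and the trivial character by $\chi^0(0)=1$. For $a,b\in\mathbb{Z}/\ell^2\mathbb{Z}$ the Jacobi sum is $J_q(a,b)=\sum_{x\in\mathbb{F}_q}\chi^a(x)\chi^b(1-x)$, and $\operatorname{Tr}_{\mathbb{Q}(\zeta)/\mathbb{Q}}(J_q(a,b))=\sum_{s\in(\mathbb{Z}/\ell^2\mathbb{Z})^*}J_q(sa,sb)$. -}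

module Defs where

open import Data.Bool using (Bool; true; false; if_then_else_)
open import Data.Nat as ℕ using (ℕ; zero; suc; _+_; _*_; _∸_; _^_; _<_)
open import Data.Nat.DivMod using (_%_; _/_)
open import Data.Nat.Coprimality using (Coprime; coprime?)
open import Data.Integer as ℤ using (ℤ; +_)
open import Data.List using (List; []; _∷_; map; upTo; concatMap; foldr; length; filter; _++_)
open import Data.Maybe using (Maybe; just; nothing)
open import Relation.Nullary using (¬_)
open import Relation.Nullary.Decidable using (⌊_⌋)
open import Relation.Binary.PropositionalEquality using (_≡_; _≢_)

-- Total versions of mod / div (agree with _%_ , _/_ for nonzero modulus)

_mod_ : ℕ → ℕ → ℕ
a mod zero    = a
a mod (suc m) = a % suc m

_div_ : ℕ → ℕ → ℕ
a div zero    = zero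
a div (suc m) = a / suc m

-- Elements of F_q are represented by 0,…,q-1.
-- Affine points: pairs (x,y) with y^ℓ ≡ x(x^ℓ - 1) (mod q)
-- (x^ℓ - 1 is written x^ℓ + (q - 1)).  The smooth model has exactly one
-- point over the point at infinity, which is added.

isAffinePoint : (ℓ q x y : ℕ) → Bool
isAffinePoint ℓ q x y = ⌊ (y ^ ℓ) mod q ℕ.≟ (x * (x ^ ℓ + (q ∸ 1))) mod q ⌋

affineCount : (ℓ q : ℕ) → ℕ
affineCount ℓ q =
  length (filter (λ p → true Data.Bool.≟ p)
    (concatMap (λ x → map (λ y → isAffinePoint ℓ q x y) (upTo q)) (upTo q)))
  where import Data.Bool

pointCount : (ℓ q : ℕ) → ℕ
pointCount ℓ q = affineCount ℓ q + 1

HasOrder : (q u n : ℕ) → Set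
HasOrder q u n =
  ((u ^ n) mod q ≡ 1 mod q) × (∀ k → 0 < k → k < n → (u ^ k) mod q ≢ 1 mod q)
  where open import Data.Product using (_×_)

-- The character χ of order ℓ², with values in μ_{ℓ²} ⊂ Q(ζ).
-- The fixed prime 𝔮 above q corresponds to u ∈ F_q of order ℓ², the
-- reduction of ζ mod 𝔮.  For x ≠ 0, χ(x) = ζ^k where k < ℓ² is the
-- (unique) exponent with x^((q-1)/ℓ²) ≡ u^k (mod q).
-- A value of a character power is either 0 (nothing) or ζ^e (just e).

firstBelow : ℕ → (ℕ → Bool) → ℕ
firstBelow zero    p = zero
firstBelow (suc n) p = if p zero then zero else suc (firstBelow n (λ k → p (suc k)))

indχ : (ℓ q u x : ℕ) → ℕ
indχ ℓ q u x =
  firstBelow (ℓ * ℓ)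
    (λ k → ⌊ (x ^ ((q ∸ 1) div (ℓ * ℓ))) mod q ℕ.≟ (u ^ k) mod q ⌋)

-- χ^a(x) for x ∈ {0,…,q-1}; χ^a(0) = 0 for a ≢ 0, χ^0(0) = 1.
chiPow : (ℓ q u a x : ℕ) → Maybe ℕ
chiPow ℓ q u a zero with (a mod (ℓ * ℓ)) ℕ.≟ 0
... | Relation.Nullary.yes _ = just zero
... | Relation.Nullary.no  _ = nothing
chiPow ℓ q u a (suc x) = just ((a * indχ ℓ q u (suc x)) mod (ℓ * ℓ))

mulχ : (ℓ : ℕ) → Maybe ℕ → Maybe ℕ → Maybe ℕ
mulχ ℓ (just e) (just f) = just ((e + f) mod (ℓ * ℓ))
mulχ ℓ _        _        = nothing

-- Jacobi sum J_q(a,b) = Σ_{x ∈ F_q} χ^a(x) χ^b(1-x), as the list of the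
-- exponents e of its nonzero terms ζ^e (so J = Σ_{e ∈ list} ζ^e).
jacobi : (ℓ q u a b : ℕ) → List ℕ
jacobi ℓ q u a b = collect (upTo q)
  where
  collect : List ℕ → List ℕ
  collect [] = []
  collect (x ∷ xs) with mulχ ℓ (chiPow ℓ q u a x) (chiPow ℓ q u b ((suc q ∸ x) mod q))
  ... | just e  = e ∷ collect xs
  ... | nothing = collect xs

traceJacobi : (ℓ q u a b : ℕ) → List ℕ
traceJacobi ℓ q u a b =
  concatMap (λ s → jacobi ℓ q u (s * a) (s * b))
    (filter (λ s → coprime? s (ℓ * ℓ)) (upTo (ℓ * ℓ)))

-- Z[ζ] = Z[X]/(Φ_{ℓ²}(X)), with Φ_{ℓ²}(X) = Σ_{j<ℓ} X^{jℓ} for ℓ prime.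
-- Polynomials are coefficient lists (lowest degree first).

Poly : Set
Poly = List ℤ

coeff : Poly → ℕ → ℤ
coeff []       _       = + 0
coeff (c ∷ cs) zero    = c
coeff (c ∷ cs) (suc i) = coeff cs i

sumℤ : List ℤ → ℤ
sumℤ = foldr ℤ._+_ (+ 0)

mulCoeff : Poly → Poly → ℕ → ℤ
mulCoeff f g i = sumℤ (map (λ j → coeff f j ℤ.* coeff g (i ∸ j)) (upTo (suc i)))

cyclotomicPrimeSq : ℕ → Poly
cyclotomicPrimeSq ℓ =
  map (λ i → if ⌊ i mod ℓ ℕ.≟ 0 ⌋ then + 1 else + 0) (upTo (ℓ * (ℓ ∸ 1) + 1))

sumMonomials : List ℕ → ℕ → ℤ
sumMonomials es i = + length (filter (λ e → e ℕ.≟ i) es)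

constPoly : ℤ → ℕ → ℤ
constPoly n zero    = n
constPoly n (suc _) = + 0

-- "Σ_{e ∈ es} ζ^e = n in Z[ζ] ⊂ Q(ζ)" (ζ primitive ℓ²-th root of unity):
-- Φ_{ℓ²} divides Σ X^e - n in Z[X].
CycEqInt : (ℓ : ℕ) → List ℕ → ℤ → Set
CycEqInt ℓ es n =
  Σ Poly (λ h → ∀ i → sumMonomials es i ℤ.- constPoly n i ≡ mulCoeff (cyclotomicPrimeSq ℓ) h i)
  where open import Data.Product using (Σ)

module Submission where

open import Data.Nat using (ℕ; suc; _*_; _%_; NonZero)
open import Data.Nat.Primality using (Prime)
open import Relation.Binary.PropositionalEquality using (_≡_)
open import Defs using (HasOrder)

-- Let m = (q-1)/ℓ² and let index x be the exponent with x^m ≈ u^(index x), so that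
-- χ(x) = ζ^(index x); put T(x) = index (x^(ℓ(ℓ-1)) (1-x)). The term of J(sℓ(ℓ-1), s) at x ∉ {0, 1}
-- is ζ^(s T(x)), so counting the units s modulo ℓ² with s T(x) ≡ i shows that ζ^i occurs
-- ℓ(ℓ-1)A [i = 0] + ℓB [i a nonzero multiple of ℓ] + C [i a unit] times in the trace, where A, B, C
-- count the x ≥ 2 with T(x) = 0, with T(x) a nonzero multiple of ℓ, and with T(x) a unit. Since
-- Φ_{ℓ²} = Σ_{j<ℓ} X^(jℓ), this exponent polynomial minus the constant ℓ(ℓ-1)A - ℓB is Φ_{ℓ²} times
-- ℓB + C(X + ⋯ + X^(ℓ-1)).
-- On the curve side, y^ℓ = c has 1, ℓ or 0 solutions according as c is 0, a nonzero ℓ-th power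
-- (c^(mℓ) ≈ 1) or neither, and the index is equidistributed. The substitution v = 1 - x^(-ℓ)
-- maps the x for which x(x^ℓ - 1) is a nonzero ℓ-th power ℓ-to-one onto the v ≥ 2 with T(v) = 0,
-- so the curve has ℓ + 2 + ℓ²A points; and A + B + 1 = mℓ because T(v) is a multiple of ℓ
-- exactly when (1-v)^(mℓ) ≈ 1. Hence #C - q - 1 = ℓ(ℓ-1)A - ℓB.

module FiniteSum where

  open import Level using (Level)
  open import Data.Nat
  open import Data.Nat.Properties
  open import Data.Bool using (if_then_else_)
  open import Data.Product using (Σ; _×_; _,_; proj₁; proj₂)
  open import Data.Sum using (_⊎_; inj₁; inj₂)
  open import Data.Empty using (⊥-elim)
  open import Relation.Nullary using (Dec; yes; no; does; ¬_)
  open import Relation.Nullary.Decidable using (_×-dec_; _⊎-dec_)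
  open import Relation.Binary.PropositionalEquality
  open import Data.Nat.Tactic.RingSolver using (solve-∀)

  private
    variable
      a b : Level
      P Q : Set a

  Σ< : ℕ → (ℕ → ℕ) → ℕ
  Σ< zero    f = 0
  Σ< (suc n) f = f 0 + Σ< n (λ i → f (suc i))

  Π< : ℕ → (ℕ → ℕ) → ℕ
  Π< zero    f = 1
  Π< (suc n) f = f 0 * Π< n (λ i → f (suc i))

  𝟙 : Dec P → ℕ
  𝟙 d = if does d then 1 else 0

  count : ∀ {P : ℕ → Set a} → ℕ → (∀ i → Dec (P i)) → ℕ
  count n P? = Σ< n (λ i → 𝟙 (P? i))

  𝟙-yes : (d : Dec P) → P → 𝟙 d ≡ 1
  𝟙-yes (yes _) _  = refl
  𝟙-yes (no ¬p) p = ⊥-elim (¬p p)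

  𝟙-no : (d : Dec P) → ¬ P → 𝟙 d ≡ 0
  𝟙-no (yes p) ¬p = ⊥-elim (¬p p)
  𝟙-no (no _)  _  = refl

  𝟙≤1 : (d : Dec P) → 𝟙 d ≤ 1
  𝟙≤1 (yes _) = s≤s z≤n
  𝟙≤1 (no _)  = z≤n

  𝟙-witness : (d : Dec P) → 0 < 𝟙 d → P
  𝟙-witness (yes p) _ = p

  𝟙-cong : (d : Dec P) (e : Dec Q) → (P → Q) → (Q → P) → 𝟙 d ≡ 𝟙 e
  𝟙-cong (yes p) (yes q) f g = refl
  𝟙-cong (yes p) (no ¬q) f g = ⊥-elim (¬q (f p))
  𝟙-cong (no ¬p) (yes q) f g = ⊥-elim (¬p (g q))
  𝟙-cong (no _)  (no _)  f g = refl

  𝟙-mono : (d : Dec P) (e : Dec Q) → (P → Q) → 𝟙 d ≤ 𝟙 e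
  𝟙-mono (yes p) (yes q) f = ≤-refl
  𝟙-mono (yes p) (no ¬q) f = ⊥-elim (¬q (f p))
  𝟙-mono (no _)  e       f = z≤n

  𝟙-× : (d : Dec P) (e : Dec Q) → 𝟙 d * 𝟙 e ≡ 𝟙 (d ×-dec e)
  𝟙-× (yes _) (yes _) = refl
  𝟙-× (yes _) (no _)  = refl
  𝟙-× (no _)  _       = refl

  𝟙*-cong : (d : Dec P) {m n : ℕ} → (P → m ≡ n) → 𝟙 d * m ≡ 𝟙 d * n
  𝟙*-cong (yes p) f = cong (_+ 0) (f p)
  𝟙*-cong (no _)  f = refl

  𝟙*-mono : (d : Dec P) {m n : ℕ} → (P → m ≤ n) → 𝟙 d * m ≤ 𝟙 d * n
  𝟙*-mono (yes p) f = +-monoˡ-≤ 0 (f p)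
  𝟙*-mono (no _)  f = z≤n

  𝟙*-cancel : (d : Dec P) {m n : ℕ} → P → 𝟙 d * m ≡ 𝟙 d * n → m ≡ n
  𝟙*-cancel (yes _) _ e = +-cancelʳ-≡ 0 _ _ e
  𝟙*-cancel (no ¬p) p _ = ⊥-elim (¬p p)

  Σ-cong : ∀ n {f g : ℕ → ℕ} → (∀ i → i < n → f i ≡ g i) → Σ< n f ≡ Σ< n g
  Σ-cong zero    h = refl
  Σ-cong (suc n) h = cong₂ _+_ (h 0 z<s) (Σ-cong n (λ i i<n → h (suc i) (s<s i<n)))

  Σ-mono-≤ : ∀ n {f g : ℕ → ℕ} → (∀ i → i < n → f i ≤ g i) → Σ< n f ≤ Σ< n g
  Σ-mono-≤ zero    h = z≤n
  Σ-mono-≤ (suc n) h = +-mono-≤ (h 0 z<s) (Σ-mono-≤ n (λ i i<n → h (suc i) (s<s i<n)))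

  Σ-distrib-+ : ∀ n (f g : ℕ → ℕ) → Σ< n (λ i → f i + g i) ≡ Σ< n f + Σ< n g
  Σ-distrib-+ zero    f g = refl
  Σ-distrib-+ (suc n) f g =
    trans (cong (f 0 + g 0 +_) (Σ-distrib-+ n _ _)) (interchange (f 0) (g 0) _ _)
    where
    interchange : ∀ a b c d → (a + b) + (c + d) ≡ (a + c) + (b + d)
    interchange = solve-∀

  Σ-*ˡ : ∀ n c (f : ℕ → ℕ) → Σ< n (λ i → c * f i) ≡ c * Σ< n f
  Σ-*ˡ zero    c f = sym (*-zeroʳ c)
  Σ-*ˡ (suc n) c f = trans (cong (c * f 0 +_) (Σ-*ˡ n c _)) (sym (*-distribˡ-+ c (f 0) _))

  Σ-const : ∀ n c → Σ< n (λ _ → c) ≡ n * c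
  Σ-const zero    c = refl
  Σ-const (suc n) c = cong (c +_) (Σ-const n c)

  Σ-zero : ∀ n {f : ℕ → ℕ} → (∀ i → i < n → f i ≡ 0) → Σ< n f ≡ 0
  Σ-zero n h = trans (Σ-cong n h) (trans (Σ-const n 0) (*-zeroʳ n))

  Σ-swap : ∀ n m (f : ℕ → ℕ → ℕ) →
           Σ< n (λ i → Σ< m (λ j → f i j)) ≡ Σ< m (λ j → Σ< n (λ i → f i j))
  Σ-swap zero    m f = sym (Σ-zero m (λ _ _ → refl))
  Σ-swap (suc n) m f = trans (cong (Σ< m (f 0) +_) (Σ-swap n m (λ i → f (suc i))))
                             (sym (Σ-distrib-+ m (f 0) _))

  Σ-last : ∀ n (f : ℕ → ℕ) → Σ< (suc n) f ≡ Σ< n f + f n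
  Σ-last zero    f = +-comm (f 0) 0
  Σ-last (suc n) f = trans (cong (f 0 +_) (Σ-last n (λ i → f (suc i)))) (sym (+-assoc (f 0) _ _))

  Σ-split : ∀ m n (f : ℕ → ℕ) → Σ< (m + n) f ≡ Σ< m f + Σ< n (λ i → f (m + i))
  Σ-split zero    n f = refl
  Σ-split (suc m) n f = trans (cong (f 0 +_) (Σ-split m n (λ i → f (suc i)))) (sym (+-assoc (f 0) _ _))

  Σ-blocks : ∀ k l (f : ℕ → ℕ) → Σ< (k * l) f ≡ Σ< k (λ a → Σ< l (λ b → f (a * l + b)))
  Σ-blocks zero    l f = refl
  Σ-blocks (suc k) l f = trans (Σ-split l (k * l) f) (cong (Σ< l f +_) (trans
    (Σ-blocks k l (λ i → f (l + i)))
    (Σ-cong k (λ a _ → Σ-cong l (λ b _ → cong f (sym (+-assoc l (a * l) b)))))))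

  Σ-δ : ∀ n k (g : ℕ → ℕ) → k < n → Σ< n (λ x → g x * 𝟙 (k ≟ x)) ≡ g k
  Σ-δ (suc n) zero g _ = trans
    (cong₂ _+_ (*-identityʳ (g 0))
               (Σ-zero n (λ i _ → trans (cong (g (suc i) *_) (𝟙-no (0 ≟ suc i) (λ ()))) (*-zeroʳ (g (suc i))))))
    (+-identityʳ _)
  Σ-δ (suc n) (suc k) g (s≤s k<n) = cong₂ _+_
    (trans (cong (g 0 *_) (𝟙-no (suc k ≟ 0) (λ ()))) (*-zeroʳ (g 0)))
    (trans (Σ-cong n (λ i _ → cong (g (suc i) *_) (𝟙-cong (suc k ≟ suc i) (k ≟ i) suc-injective (cong suc))))
           (Σ-δ n k (λ i → g (suc i)) k<n))

  Σ-fibres : ∀ n n′ (w g φ : ℕ → ℕ) → (∀ y → y < n → w y ≡ 0 ⊎ φ y < n′) →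
             Σ< n (λ y → w y * g (φ y)) ≡ Σ< n′ (λ x → g x * Σ< n (λ y → w y * 𝟙 (φ y ≟ x)))
  Σ-fibres n n′ w g φ h = begin
    Σ< n (λ y → w y * g (φ y))                            ≡⟨ Σ-cong n (λ y y<n → expand y (h y y<n)) ⟩
    Σ< n (λ y → Σ< n′ (λ x → g x * (w y * 𝟙 (φ y ≟ x)))) ≡⟨ Σ-swap n n′ _ ⟩
    Σ< n′ (λ x → Σ< n (λ y → g x * (w y * 𝟙 (φ y ≟ x)))) ≡⟨ Σ-cong n′ (λ x _ → Σ-*ˡ n (g x) _) ⟩
    Σ< n′ (λ x → g x * Σ< n (λ y → w y * 𝟙 (φ y ≟ x)))   ∎
    where
    open ≡-Reasoning
    swap : ∀ w g d → w * (g * d) ≡ g * (w * d)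
    swap = solve-∀
    expand : ∀ y → w y ≡ 0 ⊎ φ y < n′ → w y * g (φ y) ≡ Σ< n′ (λ x → g x * (w y * 𝟙 (φ y ≟ x)))
    expand y (inj₁ w≡0) rewrite w≡0 = sym (Σ-zero n′ (λ x _ → *-zeroʳ (g x)))
    expand y (inj₂ φy<n′) = trans (cong (w y *_) (sym (Σ-δ n′ (φ y) g φy<n′)))
      (trans (sym (Σ-*ˡ n′ (w y) _)) (Σ-cong n′ (λ x _ → swap (w y) (g x) _)))

  Σ>0⇒ : ∀ n (f : ℕ → ℕ) → 0 < Σ< n f → Σ ℕ (λ i → i < n × 0 < f i)
  Σ>0⇒ (suc n) f pos with f 0 in eq
  ... | suc _ = 0 , z<s , subst (0 <_) (sym eq) z<s
  ... | zero with Σ>0⇒ n (λ i → f (suc i)) pos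
  ...   | i , i<n , fi>0 = suc i , s<s i<n , fi>0

  Σ≤1 : ∀ n (f : ℕ → ℕ) → (∀ i → i < n → f i ≤ 1) →
        (∀ i j → i < n → j < n → 0 < f i → 0 < f j → i ≡ j) → Σ< n f ≤ 1
  Σ≤1 zero    f bound unique = z≤n
  Σ≤1 (suc n) f bound unique with f 0 in eq
  ... | zero  = Σ≤1 n (λ i → f (suc i)) (λ i i<n → bound (suc i) (s<s i<n))
                  (λ i j i<n j<n fi fj → suc-injective (unique (suc i) (suc j) (s<s i<n) (s<s j<n) fi fj))
  ... | suc k = subst (λ z → suc k + z ≤ 1) (sym (Σ-zero n rest))
                  (subst (_≤ 1) (trans eq (sym (+-identityʳ (suc k)))) (bound 0 z<s))
    where
    rest : ∀ i → i < n → f (suc i) ≡ 0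
    rest i i<n with f (suc i) in eq′
    ... | zero  = refl
    ... | suc _ with unique 0 (suc i) z<s (s<s i<n) (subst (0 <_) (sym eq) z<s) (subst (0 <_) (sym eq′) z<s)
    ...   | ()

  Σ-tight : ∀ n {f g : ℕ → ℕ} → (∀ i → i < n → f i ≤ g i) → Σ< n f ≡ Σ< n g → ∀ i → i < n → f i ≡ g i
  Σ-tight (suc n) {f} {g} f≤g eq i i<n = go i i<n
    where
    split : ∀ {a b c d} → a ≤ b → c ≤ d → a + c ≡ b + d → a ≡ b × c ≡ d
    split {a} {b} {c} {d} a≤b c≤d e with m≤n⇒m<n∨m≡n a≤b
    ... | inj₂ a≡b = a≡b , +-cancelˡ-≡ a c d (trans e (cong (_+ d) (sym a≡b)))
    ... | inj₁ a<b = ⊥-elim (<-irrefl e (+-mono-<-≤ a<b c≤d))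
    heads : f 0 ≡ g 0 × Σ< n (λ i → f (suc i)) ≡ Σ< n (λ i → g (suc i))
    heads = split (f≤g 0 z<s) (Σ-mono-≤ n (λ j j<n → f≤g (suc j) (s<s j<n))) eq
    go : ∀ i → i < suc n → f i ≡ g i
    go zero    _         = proj₁ heads
    go (suc i) (s≤s i<n) = Σ-tight n (λ j j<n → f≤g (suc j) (s<s j<n)) (proj₂ heads) i i<n

  count-cong : ∀ n {P : ℕ → Set a} {Q : ℕ → Set b} (P? : ∀ i → Dec (P i)) (Q? : ∀ i → Dec (Q i)) →
               (∀ i → i < n → P i → Q i) → (∀ i → i < n → Q i → P i) → count n P? ≡ count n Q?
  count-cong n P? Q? f g = Σ-cong n (λ i i<n → 𝟙-cong (P? i) (Q? i) (f i i<n) (g i i<n))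

  count-mono : ∀ n {P : ℕ → Set a} {Q : ℕ → Set b} (P? : ∀ i → Dec (P i)) (Q? : ∀ i → Dec (Q i)) →
               (∀ i → i < n → P i → Q i) → count n P? ≤ count n Q?
  count-mono n P? Q? f = Σ-mono-≤ n (λ i i<n → 𝟙-mono (P? i) (Q? i) (f i i<n))

  count-none : ∀ n {P : ℕ → Set a} (P? : ∀ i → Dec (P i)) → (∀ i → i < n → ¬ P i) → count n P? ≡ 0
  count-none n P? h = Σ-zero n (λ i i<n → 𝟙-no (P? i) (h i i<n))

  count-all : ∀ n {P : ℕ → Set a} (P? : ∀ i → Dec (P i)) → (∀ i → i < n → P i) → count n P? ≡ n
  count-all n P? h = trans (Σ-cong n (λ i i<n → 𝟙-yes (P? i) (h i i<n))) (trans (Σ-const n 1) (*-identityʳ n))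

  count>0⇒ : ∀ n {P : ℕ → Set a} (P? : ∀ i → Dec (P i)) → 0 < count n P? → Σ ℕ (λ i → i < n × P i)
  count>0⇒ n P? pos with Σ>0⇒ n _ pos
  ... | i , i<n , 𝟙>0 = i , i<n , 𝟙-witness (P? i) 𝟙>0

  count-≟≤1 : ∀ n a → count n (_≟ a) ≤ 1
  count-≟≤1 n a = Σ≤1 n _ (λ i _ → 𝟙≤1 (i ≟ a))
    (λ i j _ _ i≡a j≡a → trans (𝟙-witness (i ≟ a) i≡a) (sym (𝟙-witness (j ≟ a) j≡a)))

  count-⊎ : ∀ n {P : ℕ → Set a} {Q : ℕ → Set b} (P? : ∀ i → Dec (P i)) (Q? : ∀ i → Dec (Q i)) →
            count n (λ i → P? i ⊎-dec Q? i) ≤ count n P? + count n Q?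
  count-⊎ n P? Q? = ≤-trans (Σ-mono-≤ n (λ i _ → 𝟙-⊎ (P? i) (Q? i))) (≤-reflexive (Σ-distrib-+ n _ _))
    where
    𝟙-⊎ : (d : Dec P) (e : Dec Q) → 𝟙 (d ⊎-dec e) ≤ 𝟙 d + 𝟙 e
    𝟙-⊎ (yes _) _       = s≤s z≤n
    𝟙-⊎ (no _)  (yes _) = s≤s z≤n
    𝟙-⊎ (no _)  (no _)  = z≤n

  count≡0⇒ : ∀ n {P : ℕ → Set a} (P? : ∀ i → Dec (P i)) → count n P? ≡ 0 → ∀ i → i < n → ¬ P i
  count≡0⇒ n P? none i i<n p = 0≢1+n (trans (Σ-tight n (λ j _ → z≤n) (trans (Σ-zero n (λ _ _ → refl)) (sym none)) i i<n)
                                            (𝟙-yes (P? i) p))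

  module _ {P : ℕ → Set a} {Q : ℕ → Set b} (n n′ : ℕ) (P? : ∀ i → Dec (P i)) (Q? : ∀ i → Dec (Q i))
           (φ : ℕ → ℕ) (maps-to : ∀ y → y < n → P y → φ y < n′ × Q (φ y)) where

    Σ-fibres-𝟙 : Σ< n (λ y → 𝟙 (P? y)) ≡ Σ< n′ (λ x → 𝟙 (Q? x) * Σ< n (λ y → 𝟙 (P? y) * 𝟙 (φ y ≟ x)))
    Σ-fibres-𝟙 = trans (Σ-cong n weight) (Σ-fibres n n′ (λ y → 𝟙 (P? y)) (λ x → 𝟙 (Q? x)) φ vanishes)
      where
      weight : ∀ y → y < n → 𝟙 (P? y) ≡ 𝟙 (P? y) * 𝟙 (Q? (φ y))
      weight y y<n with P? y
      ... | yes py = sym (trans (+-identityʳ _) (𝟙-yes (Q? (φ y)) (proj₂ (maps-to y y<n py))))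
      ... | no _   = refl
      vanishes : ∀ y → y < n → 𝟙 (P? y) ≡ 0 ⊎ φ y < n′
      vanishes y y<n with P? y
      ... | yes py = inj₂ (proj₁ (maps-to y y<n py))
      ... | no _   = inj₁ refl

    module _ (injective : ∀ y y′ → y < n → y′ < n → P y → P y′ → φ y ≡ φ y′ → y ≡ y′) where

      fibre≤1 : ∀ x → Σ< n (λ y → 𝟙 (P? y) * 𝟙 (φ y ≟ x)) ≤ 1
      fibre≤1 x = Σ≤1 n _ bound unique
        where
        bound : ∀ y → y < n → 𝟙 (P? y) * 𝟙 (φ y ≟ x) ≤ 1
        bound y _ = ≤-trans (*-monoˡ-≤ (𝟙 (φ y ≟ x)) (𝟙≤1 (P? y)))
                            (≤-trans (≤-reflexive (+-identityʳ _)) (𝟙≤1 (φ y ≟ x)))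
        factors : ∀ {m n} → 0 < m * n → 0 < m × 0 < n
        factors {suc _} {suc _} _ = z<s , z<s
        factors {suc m} {zero}  p = ⊥-elim (<-irrefl (sym (*-zeroʳ m)) p)
        unique : ∀ y y′ → y < n → y′ < n → 0 < 𝟙 (P? y) * 𝟙 (φ y ≟ x) → 0 < 𝟙 (P? y′) * 𝟙 (φ y′ ≟ x) → y ≡ y′
        unique y y′ y<n y′<n t t′ with factors t | factors t′
        ... | p , e | p′ , e′ = injective y y′ y<n y′<n (𝟙-witness (P? y) p) (𝟙-witness (P? y′) p′)
                                  (trans (𝟙-witness (φ y ≟ x) e) (sym (𝟙-witness (φ y′ ≟ x) e′)))

      count-injection : count n P? ≤ count n′ Q?
      count-injection = begin
        count n P?                                                       ≡⟨ Σ-fibres-𝟙 ⟩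
        Σ< n′ (λ x → 𝟙 (Q? x) * Σ< n (λ y → 𝟙 (P? y) * 𝟙 (φ y ≟ x))) ≤⟨ Σ-mono-≤ n′ bound ⟩
        count n′ Q?                                                      ∎
        where
        open ≤-Reasoning
        bound : ∀ x → x < n′ → 𝟙 (Q? x) * Σ< n (λ y → 𝟙 (P? y) * 𝟙 (φ y ≟ x)) ≤ 𝟙 (Q? x)
        bound x _ = ≤-trans (*-monoʳ-≤ (𝟙 (Q? x)) (fibre≤1 x)) (≤-reflexive (*-identityʳ _))

  count-bijection : ∀ n n′ {P : ℕ → Set a} {Q : ℕ → Set b} (P? : ∀ i → Dec (P i)) (Q? : ∀ i → Dec (Q i))
    (φ ψ : ℕ → ℕ) → (∀ y → y < n → P y → φ y < n′ × Q (φ y)) → (∀ x → x < n′ → Q x → ψ x < n × P (ψ x)) →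
    (∀ y → y < n → P y → ψ (φ y) ≡ y) → (∀ x → x < n′ → Q x → φ (ψ x) ≡ x) → count n P? ≡ count n′ Q?
  count-bijection n n′ P? Q? φ ψ φ-to ψ-to ψφ φψ = ≤-antisym
    (count-injection n n′ P? Q? φ φ-to (λ y y′ y<n y′<n py py′ e →
       trans (sym (ψφ y y<n py)) (trans (cong ψ e) (ψφ y′ y′<n py′))))
    (count-injection n′ n Q? P? ψ ψ-to (λ x x′ x<n x′<n qx qx′ e →
       trans (sym (φψ x x<n qx)) (trans (cong φ e) (φψ x′ x′<n qx′))))

  -- Pigeonhole: an injective self-map of a finite set is onto.
  fibre-of-injective-endomap : ∀ n {P : ℕ → Set a} (P? : ∀ i → Dec (P i)) (φ : ℕ → ℕ) →
    (∀ y → y < n → P y → φ y < n × P (φ y)) → (∀ y y′ → y < n → y′ < n → P y → P y′ → φ y ≡ φ y′ → y ≡ y′) →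
    ∀ x → x < n → P x → Σ< n (λ y → 𝟙 (P? y) * 𝟙 (φ y ≟ x)) ≡ 1
  fibre-of-injective-endomap n P? φ maps-to injective x x<n px =
    𝟙*-cancel (P? x) px (Σ-tight n bound total x x<n)
    where
    fibre : ℕ → ℕ
    fibre x = Σ< n (λ y → 𝟙 (P? y) * 𝟙 (φ y ≟ x))
    bound : ∀ x → x < n → 𝟙 (P? x) * fibre x ≤ 𝟙 (P? x) * 1
    bound x _ = *-monoʳ-≤ (𝟙 (P? x)) (fibre≤1 n n P? P? φ maps-to injective x)
    total : Σ< n (λ x → 𝟙 (P? x) * fibre x) ≡ Σ< n (λ x → 𝟙 (P? x) * 1)
    total = trans (sym (Σ-fibres-𝟙 n n P? P? φ maps-to)) (Σ-cong n (λ x _ → sym (*-identityʳ _)))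

  Π-cong : ∀ n {f g : ℕ → ℕ} → (∀ i → i < n → f i ≡ g i) → Π< n f ≡ Π< n g
  Π-cong zero    h = refl
  Π-cong (suc n) h = cong₂ _*_ (h 0 z<s) (Π-cong n (λ i i<n → h (suc i) (s<s i<n)))

  Π-distrib-* : ∀ n (f g : ℕ → ℕ) → Π< n (λ i → f i * g i) ≡ Π< n f * Π< n g
  Π-distrib-* zero    f g = refl
  Π-distrib-* (suc n) f g =
    trans (cong (f 0 * g 0 *_) (Π-distrib-* n _ _)) (interchange (f 0) (g 0) _ _)
    where
    interchange : ∀ a b c d → (a * b) * (c * d) ≡ (a * c) * (b * d)
    interchange = solve-∀

  Π-const : ∀ n a → Π< n (λ _ → a) ≡ a ^ n
  Π-const zero    a = refl
  Π-const (suc n) a = cong (a *_) (Π-const n a)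

  Π-one : ∀ n {f : ℕ → ℕ} → (∀ i → i < n → f i ≡ 1) → Π< n f ≡ 1
  Π-one n h = trans (Π-cong n h) (trans (Π-const n 1) (^-zeroˡ n))

  Π-δ : ∀ n k (g : ℕ → ℕ) → k < n → Π< n (λ x → g x ^ 𝟙 (k ≟ x)) ≡ g k
  Π-δ (suc n) zero g _ = trans
    (cong₂ _*_ (*-identityʳ (g 0)) (Π-one n (λ i _ → cong (g (suc i) ^_) (𝟙-no (0 ≟ suc i) (λ ())))))
    (*-identityʳ _)
  Π-δ (suc n) (suc k) g (s≤s k<n) = trans
    (cong₂ _*_ (cong (g 0 ^_) (𝟙-no (suc k ≟ 0) (λ ())))
               (trans (Π-cong n (λ i _ → cong (g (suc i) ^_) (𝟙-cong (suc k ≟ suc i) (k ≟ i) suc-injective (cong suc))))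
                      (Π-δ n k (λ i → g (suc i)) k<n)))
    (+-identityʳ _)

  Π-fibres : ∀ n n′ (g φ : ℕ → ℕ) → (∀ y → y < n → φ y < n′) →
             Π< n (λ y → g (φ y)) ≡ Π< n′ (λ x → g x ^ count n (λ y → φ y ≟ x))
  Π-fibres zero    n′ g φ h = sym (Π-one n′ (λ _ _ → refl))
  Π-fibres (suc n) n′ g φ h = begin
    g (φ 0) * Π< n (λ y → g (φ (suc y)))
      ≡⟨ cong₂ _*_ (sym (Π-δ n′ (φ 0) g (h 0 z<s))) (Π-fibres n n′ g (λ y → φ (suc y)) (λ y y<n → h (suc y) (s<s y<n))) ⟩
    Π< n′ (λ x → g x ^ 𝟙 (φ 0 ≟ x)) * Π< n′ (λ x → g x ^ count n (λ y → φ (suc y) ≟ x))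
      ≡⟨ sym (Π-distrib-* n′ _ _) ⟩
    Π< n′ (λ x → g x ^ 𝟙 (φ 0 ≟ x) * g x ^ count n (λ y → φ (suc y) ≟ x))
      ≡⟨ Π-cong n′ (λ x _ → sym (^-distribˡ-+-* (g x) (𝟙 (φ 0 ≟ x)) _)) ⟩
    Π< n′ (λ x → g x ^ count (suc n) (λ y → φ y ≟ x))
      ∎
    where open ≡-Reasoning

module NatProperties where

  open import Data.Nat
  open import Data.Nat.Properties
  open import Data.Nat.DivMod
  open import Data.Nat.Divisibility
  open import Data.Sum using (inj₁; inj₂)
  open import Relation.Nullary using (contradiction)
  open import Relation.Binary.PropositionalEquality
  open import Data.Nat.Tactic.RingSolver using (solve-∀)

  ^-distribʳ-* : ∀ a b n → (a * b) ^ n ≡ a ^ n * b ^ n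
  ^-distribʳ-* a b zero    = refl
  ^-distribʳ-* a b (suc n) = trans (cong (a * b *_) (^-distribʳ-* a b n)) (interchange a b (a ^ n) (b ^ n))
    where
    interchange : ∀ a b c d → (a * b) * (c * d) ≡ (a * c) * (b * d)
    interchange = solve-∀

  ∣∧<⇒≡0 : ∀ {N n} → N ∣ n → n < N → n ≡ 0
  ∣∧<⇒≡0 {n = zero}  _   _   = refl
  ∣∧<⇒≡0 {n = suc _} N∣n n<N = contradiction N∣n (>⇒∤ n<N)

  module _ (N : ℕ) .{{_ : NonZero N}} where

    %≡⇒≡ : ∀ {a b} → a < N → b < N → a % N ≡ b % N → a ≡ b
    %≡⇒≡ {a} {b} a<N b<N e = trans (sym (m<n⇒m%n≡m a<N)) (trans e (m<n⇒m%n≡m b<N))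

    %≡⇒∣∸ : ∀ {a b} → a % N ≡ b % N → a ≤ b → N ∣ b ∸ a
    %≡⇒∣∸ {a} {b} e a≤b = divides (b / N ∸ a / N) (begin
      b ∸ a                                     ≡⟨ cong₂ _∸_ (m≡m%n+[m/n]*n b N) (m≡m%n+[m/n]*n a N) ⟩
      (b % N + b / N * N) ∸ (a % N + a / N * N) ≡⟨ cong (λ r → (b % N + b / N * N) ∸ (r + a / N * N)) e ⟩
      (b % N + b / N * N) ∸ (b % N + a / N * N) ≡⟨ [m+n]∸[m+o]≡n∸o (b % N) (b / N * N) (a / N * N) ⟩
      b / N * N ∸ a / N * N                     ≡⟨ *-distribʳ-∸ N (b / N) (a / N) ⟨
      (b / N ∸ a / N) * N                       ∎)
      where open ≡-Reasoning

    %-congʳ-* : ∀ s c → (s * (c % N)) % N ≡ (s * c) % N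
    %-congʳ-* s c = begin
      (s * (c % N)) % N             ≡⟨ %-distribˡ-* s (c % N) N ⟩
      (s % N * (c % N % N)) % N     ≡⟨ cong (λ r → (s % N * r) % N) (m%n%n≡m%n c N) ⟩
      (s % N * (c % N)) % N         ≡⟨ %-distribˡ-* s c N ⟨
      (s * c) % N                   ∎
      where open ≡-Reasoning

    %-congˡ-+ : ∀ a b → (a % N + b) % N ≡ (a + b) % N
    %-congˡ-+ a b = begin
      (a % N + b) % N               ≡⟨ %-distribˡ-+ (a % N) b N ⟩
      (a % N % N + b % N) % N       ≡⟨ cong (λ r → (r + b % N) % N) (m%n%n≡m%n a N) ⟩
      (a % N + b % N) % N           ≡⟨ %-distribˡ-+ a b N ⟨
      (a + b) % N                   ∎
      where open ≡-Reasoning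

    *-distribˡ-+-% : ∀ s a b → ((s * a) % N + (s * b) % N) % N ≡ (s * ((a % N + b) % N)) % N
    *-distribˡ-+-% s a b = begin
      ((s * a) % N + (s * b) % N) % N   ≡⟨ %-distribˡ-+ (s * a) (s * b) N ⟨
      (s * a + s * b) % N               ≡⟨ cong (_% N) (*-distribˡ-+ s a b) ⟨
      (s * (a + b)) % N                 ≡⟨ %-congʳ-* s (a + b) ⟨
      (s * ((a + b) % N)) % N           ≡⟨ cong (λ c → (s * c) % N) (%-congˡ-+ a b) ⟨
      (s * ((a % N + b) % N)) % N       ∎
      where open ≡-Reasoning

    module _ (t : ℕ) (cancel : ∀ d → N ∣ d * t → N ∣ d) where

      private
        ordered : ∀ {a b} → a ≤ b → b < N → (a * t) % N ≡ (b * t) % N → a ≡ b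
        ordered {a} {b} a≤b b<N e = ≤-antisym a≤b (m∸n≡0⇒m≤n (∣∧<⇒≡0
          (cancel (b ∸ a) (subst (N ∣_) (sym (*-distribʳ-∸ t b a)) (%≡⇒∣∸ e (*-monoˡ-≤ t a≤b))))
          (≤-<-trans (m∸n≤m b a) b<N)))

      *-cancelʳ-% : ∀ {a b} → a < N → b < N → (a * t) % N ≡ (b * t) % N → a ≡ b
      *-cancelʳ-% {a} {b} a<N b<N e with ≤-total a b
      ... | inj₁ a≤b = ordered a≤b b<N e
      ... | inj₂ b≤a = sym (ordered b≤a a<N (sym e))

module PrimeField (k : ℕ) (q-prime : Prime (suc (suc k))) where

  open import Level using (0ℓ)
  open import Data.Nat
  open import Data.Nat.Properties
  open import Data.Nat.DivMod
  open import Data.Nat.Divisibility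
  open import Data.Nat.Primality using (euclidsLemma)
  open import Data.Product using (_,_)
  open import Data.Unit using (tt)
  open import Data.Sum using (_⊎_; inj₁; inj₂; [_,_]′)
  open import Data.Empty using (⊥-elim)
  open import Relation.Nullary using (Dec; yes; no; ¬_)
  open import Relation.Binary.Bundles using (Setoid)
  open import Relation.Binary.PropositionalEquality
  import Relation.Binary.Reasoning.Setoid as SetoidReasoning
  open import Data.Nat.Tactic.RingSolver using (solve-∀)
  open FiniteSum
  open NatProperties

  q : ℕ
  q = suc (suc k)

  infix 4 _≈_ _≈?_

  record _≈_ (a b : ℕ) : Set where
    constructor mk≈
    field un≈ : a % q ≡ b % q
  open _≈_ public

  _≈?_ : ∀ a b → Dec (a ≈ b)
  a ≈? b with a % q ≟ b % q
  ... | yes e = yes (mk≈ e)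
  ... | no ne = no (λ e → ne (un≈ e))

  ≈-refl : ∀ {a} → a ≈ a
  ≈-refl = mk≈ refl

  ≈-sym : ∀ {a b} → a ≈ b → b ≈ a
  ≈-sym (mk≈ e) = mk≈ (sym e)

  ≈-trans : ∀ {a b c} → a ≈ b → b ≈ c → a ≈ c
  ≈-trans (mk≈ e) (mk≈ f) = mk≈ (trans e f)

  ≡⇒≈ : ∀ {a b} → a ≡ b → a ≈ b
  ≡⇒≈ refl = ≈-refl

  ≈-setoid : Setoid 0ℓ 0ℓ
  ≈-setoid = record
    { Carrier       = ℕ
    ; _≈_           = _≈_
    ; isEquivalence = record { refl = ≈-refl ; sym = ≈-sym ; trans = ≈-trans }
    }

  module ≈-Reasoning = SetoidReasoning ≈-setoid

  +-cong : ∀ {a a′ b b′} → a ≈ a′ → b ≈ b′ → a + b ≈ a′ + b′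
  +-cong {a} {a′} {b} {b′} (mk≈ e) (mk≈ f) = mk≈ (begin
    (a + b) % q               ≡⟨ %-distribˡ-+ a b q ⟩
    (a % q + b % q) % q       ≡⟨ cong₂ (λ x y → (x + y) % q) e f ⟩
    (a′ % q + b′ % q) % q     ≡⟨ %-distribˡ-+ a′ b′ q ⟨
    (a′ + b′) % q             ∎)
    where open ≡-Reasoning

  *-cong : ∀ {a a′ b b′} → a ≈ a′ → b ≈ b′ → a * b ≈ a′ * b′
  *-cong {a} {a′} {b} {b′} (mk≈ e) (mk≈ f) = mk≈ (begin
    (a * b) % q               ≡⟨ %-distribˡ-* a b q ⟩
    (a % q * (b % q)) % q     ≡⟨ cong₂ (λ x y → (x * y) % q) e f ⟩
    (a′ % q * (b′ % q)) % q   ≡⟨ %-distribˡ-* a′ b′ q ⟨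
    (a′ * b′) % q             ∎)
    where open ≡-Reasoning

  *-congˡ : ∀ a {b b′} → b ≈ b′ → a * b ≈ a * b′
  *-congˡ a = *-cong (≈-refl {a})

  *-congʳ : ∀ b {a a′} → a ≈ a′ → a * b ≈ a′ * b
  *-congʳ b e = *-cong e (≈-refl {b})

  ^-congˡ : ∀ {a b} n → a ≈ b → a ^ n ≈ b ^ n
  ^-congˡ zero    e = ≈-refl
  ^-congˡ (suc n) e = *-cong e (^-congˡ n e)

  Π-cong-≈ : ∀ n {f g : ℕ → ℕ} → (∀ i → i < n → f i ≈ g i) → Π< n f ≈ Π< n g
  Π-cong-≈ zero    h = ≈-refl
  Π-cong-≈ (suc n) h = *-cong (h 0 z<s) (Π-cong-≈ n (λ i i<n → h (suc i) (s<s i<n)))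

  m%q≈m : ∀ a → a % q ≈ a
  m%q≈m a = mk≈ (m%n%n≡m%n a q)

  q≈0 : q ≈ 0
  q≈0 = mk≈ (n%n≡0 q)

  1≉0 : ¬ (1 ≈ 0)
  1≉0 (mk≈ ())

  ≈⇒≡ : ∀ {a b} → a < q → b < q → a ≈ b → a ≡ b
  ≈⇒≡ a<q b<q (mk≈ e) = %≡⇒≡ q a<q b<q e

  ≈0⇒∣ : ∀ {a} → a ≈ 0 → q ∣ a
  ≈0⇒∣ {a} (mk≈ e) = m%n≡0⇒n∣m a q e

  ∣⇒≈0 : ∀ {a} → q ∣ a → a ≈ 0
  ∣⇒≈0 {a} d = mk≈ (n∣m⇒m%n≡0 a q d)

  <q⇒≉0 : ∀ {a} → 0 < a → a < q → ¬ (a ≈ 0)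
  <q⇒≉0 {a} 0<a a<q e = <-irrefl (sym (∣∧<⇒≡0 (≈0⇒∣ e) a<q)) 0<a

  ≉0⇒>0 : ∀ {a} → ¬ (a ≈ 0) → 0 < a
  ≉0⇒>0 {zero}  a≉0 = ⊥-elim (a≉0 ≈-refl)
  ≉0⇒>0 {suc _} _   = z<s

  *≈0⇒ : ∀ a b → a * b ≈ 0 → a ≈ 0 ⊎ b ≈ 0
  *≈0⇒ a b e with euclidsLemma a b q-prime (≈0⇒∣ e)
  ... | inj₁ q∣a = inj₁ (∣⇒≈0 q∣a)
  ... | inj₂ q∣b = inj₂ (∣⇒≈0 q∣b)

  *-≉0 : ∀ a b → ¬ (a ≈ 0) → ¬ (b ≈ 0) → ¬ (a * b ≈ 0)
  *-≉0 a b a≉0 b≉0 e = [ a≉0 , b≉0 ]′ (*≈0⇒ a b e)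

  ^-≉0 : ∀ a n → ¬ (a ≈ 0) → ¬ (a ^ n ≈ 0)
  ^-≉0 a zero    a≉0 = 1≉0
  ^-≉0 a (suc n) a≉0 = *-≉0 a (a ^ n) a≉0 (^-≉0 a n a≉0)

  Π-≉0 : ∀ n (f : ℕ → ℕ) → (∀ i → i < n → ¬ (f i ≈ 0)) → ¬ (Π< n f ≈ 0)
  Π-≉0 zero    f h = 1≉0
  Π-≉0 (suc n) f h = *-≉0 (f 0) _ (h 0 z<s) (Π-≉0 n (λ i → f (suc i)) (λ i i<n → h (suc i) (s<s i<n)))

  *-cancelˡ-≈ : ∀ a {b c} → ¬ (a ≈ 0) → a * b ≈ a * c → b ≈ c
  *-cancelˡ-≈ a {b} {c} a≉0 e = mk≈ (*-cancelʳ-% q a cancel (m%n<n b q) (m%n<n c q) (un≈ reduced))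
    where
    cancel : ∀ d → q ∣ d * a → q ∣ d
    cancel d q∣da with euclidsLemma d a q-prime q∣da
    ... | inj₁ q∣d = q∣d
    ... | inj₂ q∣a = ⊥-elim (a≉0 (∣⇒≈0 q∣a))
    reduced : b % q * a ≈ c % q * a
    reduced = begin
      b % q * a ≈⟨ *-congʳ a (m%q≈m b) ⟩
      b * a     ≡⟨ *-comm b a ⟩
      a * b     ≈⟨ e ⟩
      a * c     ≡⟨ *-comm a c ⟩
      c * a     ≈⟨ *-congʳ a (m%q≈m c) ⟨
      c % q * a ∎
      where open ≈-Reasoning

  *-cancelʳ-≈ : ∀ a {b c} → ¬ (a ≈ 0) → b * a ≈ c * a → b ≈ c
  *-cancelʳ-≈ a {b} {c} a≉0 e = *-cancelˡ-≈ a a≉0 (subst₂ _≈_ (*-comm b a) (*-comm c a) e)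

  +-cancelʳ-≈ : ∀ a b c → a + c ≈ b + c → a ≈ b
  +-cancelʳ-≈ a b c e = begin
    a                  ≡⟨ +-identityʳ a ⟨
    a + 0              ≈⟨ +-cong (≈-refl {a}) q≈0 ⟨
    a + q              ≡⟨ cong (a +_) (m+[n∸m]≡n c%q≤q) ⟨
    a + (c % q + d)    ≡⟨ +-assoc a (c % q) d ⟨
    a + c % q + d      ≈⟨ +-cong (+-cong (≈-refl {a}) (m%q≈m c)) (≈-refl {d}) ⟩
    a + c + d          ≈⟨ +-cong e (≈-refl {d}) ⟩
    b + c + d          ≈⟨ +-cong (+-cong (≈-refl {b}) (m%q≈m c)) (≈-refl {d}) ⟨
    b + c % q + d      ≡⟨ +-assoc b (c % q) d ⟩
    b + (c % q + d)    ≡⟨ cong (b +_) (m+[n∸m]≡n c%q≤q) ⟩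
    b + q              ≈⟨ +-cong (≈-refl {b}) q≈0 ⟩
    b + 0              ≡⟨ +-identityʳ b ⟩
    b                  ∎
    where
    open ≈-Reasoning
    d : ℕ
    d = q ∸ c % q
    c%q≤q : c % q ≤ q
    c%q≤q = <⇒≤ (m%n<n c q)

  -- y ↦ a y permutes the residues and fixes 0 (which `nonzero` weighs as 1); comparing the
  -- products of the nonzero residues before and after the permutation gives a^(q-1) ≈ 1.
  fermat : ∀ a → ¬ (a ≈ 0) → a ^ (q ∸ 1) ≈ 1
  fermat a a≉0 = *-cancelʳ-≈ P (Π-≉0 (suc k) suc (λ i i<k → <q⇒≉0 z<s (s<s i<k))) products
    where
    φ : ℕ → ℕ
    φ y = (a * y) % q
    P : ℕ
    P = Π< (suc k) suc
    nonzero : ℕ → ℕ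
    nonzero zero    = 1
    nonzero (suc x) = suc x
    φ-injective : ∀ y y′ → y < q → y′ < q → φ y ≡ φ y′ → y ≡ y′
    φ-injective y y′ y<q y′<q e = ≈⇒≡ y<q y′<q (*-cancelˡ-≈ a a≉0 (mk≈ e))
    fibre : ∀ x → x < q → count q (λ y → φ y ≟ x) ≡ 1
    fibre x x<q = trans (Σ-cong q {λ y → 𝟙 (φ y ≟ x)} {λ y → 1 * 𝟙 (φ y ≟ x)} (λ y _ → sym (+-identityʳ _)))
      (fibre-of-injective-endomap q (λ _ → yes tt) φ (λ y _ _ → m%n<n (a * y) q , tt)
        (λ y y′ y<q y′<q _ _ → φ-injective y y′ y<q y′<q) x x<q tt)
    permuted : Π< q (λ y → nonzero (φ y)) ≡ Π< q nonzero
    permuted = trans (Π-fibres q q nonzero φ (λ y _ → m%n<n (a * y) q))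
                     (Π-cong q (λ x x<q → trans (cong (nonzero x ^_) (fibre x x<q)) (*-identityʳ (nonzero x))))
    φ0≡0 : φ 0 ≡ 0
    φ0≡0 = cong (_% q) (*-zeroʳ a)
    φ-suc : ∀ y → y < suc k → nonzero (φ (suc y)) ≈ a * suc y
    φ-suc y y<k with φ (suc y) in eq
    ... | zero  = ⊥-elim (*-≉0 a (suc y) a≉0 (<q⇒≉0 z<s (s<s y<k)) (mk≈ eq))
    ... | suc _ = ≈-trans (≡⇒≈ (sym eq)) (m%q≈m (a * suc y))
    products : a ^ suc k * P ≈ 1 * P
    products = begin
      a ^ suc k * P                               ≡⟨ cong (_* P) (Π-const (suc k) a) ⟨
      Π< (suc k) (λ _ → a) * P                    ≡⟨ Π-distrib-* (suc k) (λ _ → a) suc ⟨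
      Π< (suc k) (λ y → a * suc y)                ≈⟨ Π-cong-≈ (suc k) φ-suc ⟨
      Π< (suc k) (λ y → nonzero (φ (suc y)))      ≡⟨ +-identityʳ _ ⟨
      1 * Π< (suc k) (λ y → nonzero (φ (suc y)))  ≡⟨ cong (λ z → nonzero z * Π< (suc k) (λ y → nonzero (φ (suc y)))) φ0≡0 ⟨
      Π< q (λ y → nonzero (φ y))                  ≡⟨ permuted ⟩
      1 * P                                       ∎
      where open ≈-Reasoning

  inv : ℕ → ℕ
  inv x = x ^ k

  *-inverseʳ : ∀ x → ¬ (x ≈ 0) → x * inv x ≈ 1
  *-inverseʳ = fermat

  *-inverseˡ : ∀ x → ¬ (x ≈ 0) → inv x * x ≈ 1
  *-inverseˡ x x≉0 = ≈-trans (≡⇒≈ (*-comm (inv x) x)) (fermat x x≉0)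

  inv-≉0 : ∀ x → ¬ (x ≈ 0) → ¬ (inv x ≈ 0)
  inv-≉0 x = ^-≉0 x k

  -- The residue of 1 - z, computed as in the definition of the Jacobi sum.
  one-minus : ℕ → ℕ
  one-minus z = (suc q ∸ z % q) % q

  one-minus<q : ∀ z → one-minus z < q
  one-minus<q z = m%n<n (suc q ∸ z % q) q

  one-minus-+ : ∀ z → one-minus z + z ≈ 1
  one-minus-+ z = begin
    one-minus z + z         ≈⟨ +-cong (m%q≈m (suc q ∸ z % q)) (≈-sym (m%q≈m z)) ⟩
    (suc q ∸ z % q) + z % q ≡⟨ m∸n+n≡m (≤-trans (<⇒≤ (m%n<n z q)) (n≤1+n q)) ⟩
    suc q                   ≡⟨ +-comm 1 q ⟩
    q + 1                   ≈⟨ +-cong q≈0 (≈-refl {1}) ⟩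
    1                       ∎
    where open ≈-Reasoning

  one-minus-unique : ∀ z v → v < q → z + v ≈ 1 → one-minus z ≡ v
  one-minus-unique z v v<q e = ≈⇒≡ (one-minus<q z) v<q
    (+-cancelʳ-≈ (one-minus z) v z (≈-trans (one-minus-+ z) (≈-trans (≈-sym e) (≡⇒≈ (+-comm z v)))))

  one-minus-involutive : ∀ v → v < q → one-minus (one-minus v) ≡ v
  one-minus-involutive v v<q = one-minus-unique (one-minus v) v v<q (one-minus-+ v)

  inverse-pairs : ∀ a b c d → a * d ≈ 1 → b * c ≈ 1 → a * b ≈ 1 → c * d ≈ 1
  inverse-pairs a b c d ad≈1 bc≈1 ab≈1 = begin
    c * d                 ≡⟨ *-identityʳ _ ⟨
    (c * d) * 1           ≈⟨ *-congˡ (c * d) ab≈1 ⟨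
    (c * d) * (a * b)     ≡⟨ regroup a b c d ⟩
    (a * d) * (b * c)     ≈⟨ *-cong ad≈1 bc≈1 ⟩
    1                     ∎
    where
    open ≈-Reasoning
    regroup : ∀ a b c d → (c * d) * (a * b) ≡ (a * d) * (b * c)
    regroup = solve-∀

  ≉0,1⇒2≤ : ∀ {v} → ¬ (v ≈ 0) → ¬ (v ≈ 1) → 2 ≤ v
  ≉0,1⇒2≤ {zero}        v≉0 _   = ⊥-elim (v≉0 ≈-refl)
  ≉0,1⇒2≤ {suc zero}    _   v≉1 = ⊥-elim (v≉1 ≈-refl)
  ≉0,1⇒2≤ {suc (suc _)} _   _   = s≤s (s≤s z≤n)

  ^≈1⇒≉0 : ∀ a n .{{_ : NonZero n}} → a ^ n ≈ 1 → ¬ (a ≈ 0)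
  ^≈1⇒≉0 a (suc n) a^n≈1 a≈0 = 1≉0 (≈-trans (≈-sym a^n≈1) (*-congʳ (a ^ n) a≈0))

module RootBound (k : ℕ) (q-prime : Prime (suc (suc k))) where

  open import Data.Nat
  open import Data.Nat.Properties
  open import Data.List using (List; []; _∷_)
  open import Data.Product using (_,_)
  open import Data.Sum using (_⊎_; inj₁; inj₂)
  open import Relation.Nullary using (¬_; yes; no)
  open import Relation.Nullary.Decidable using (_⊎-dec_)
  open import Relation.Binary.PropositionalEquality
  open import Data.Nat.Tactic.RingSolver using (solve-∀)
  open FiniteSum
  open PrimeField k q-prime

  eval : List ℕ → ℕ → ℕ
  eval []       x = 0
  eval (c ∷ cs) x = c + x * eval cs x

  -- Synthetic division: the quotient of P(X) - P(a) by X - a.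
  quotient : List ℕ → ℕ → List ℕ
  quotient []            a = []
  quotient (c ∷ [])      a = []
  quotient (c ∷ c′ ∷ cs) a = eval (c′ ∷ cs) a ∷ quotient (c′ ∷ cs) a

  -- P(x) - P(a) = (x - a) Q(x), with both sides moved so that no subtraction occurs.
  eval-quotient : ∀ P a x → eval P x + a * eval (quotient P a) x ≡ x * eval (quotient P a) x + eval P a
  eval-quotient []            a x = trans (*-zeroʳ a) (sym (trans (+-identityʳ (x * 0)) (*-zeroʳ x)))
  eval-quotient (c ∷ [])      a x = constant c x a
    where
    constant : ∀ c x a → c + x * 0 + a * 0 ≡ x * 0 + (c + a * 0)
    constant = solve-∀
  eval-quotient (c ∷ c′ ∷ cs) a x = begin
    c + x * Px + a * (Pa + x * Qx) ≡⟨ regroup c x Px a Pa Qx ⟩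
    c + a * Pa + x * (Px + a * Qx) ≡⟨ cong (λ z → c + a * Pa + x * z) (eval-quotient (c′ ∷ cs) a x) ⟩
    c + a * Pa + x * (x * Qx + Pa) ≡⟨ regroup′ c x a Pa Qx ⟩
    x * (Pa + x * Qx) + (c + a * Pa) ∎
    where
    open ≡-Reasoning
    Px Pa Qx : ℕ
    Px = eval (c′ ∷ cs) x
    Pa = eval (c′ ∷ cs) a
    Qx = eval (quotient (c′ ∷ cs) a) x
    regroup : ∀ c x Px a Pa Q → c + x * Px + a * (Pa + x * Q) ≡ c + a * Pa + x * (Px + a * Q)
    regroup = solve-∀
    regroup′ : ∀ c x a Pa Q → c + a * Pa + x * (x * Q + Pa) ≡ x * (Pa + x * Q) + (c + a * Pa)
    regroup′ = solve-∀

  data Degree : List ℕ → ℕ → Set where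
    constant : ∀ {c} → ¬ (c ≈ 0) → Degree (c ∷ []) 0
    _∷_      : ∀ c {cs d} → Degree cs d → Degree (c ∷ cs) (suc d)

  quotient-degree : ∀ {P d} a → Degree P (suc d) → Degree (quotient P a) d
  quotient-degree {c ∷ c′ ∷ []} a (_ ∷ constant c′≉0) =
    constant (λ e → c′≉0 (≈-trans (≡⇒≈ (sym (trans (cong (c′ +_) (*-zeroʳ a)) (+-identityʳ c′)))) e))
  quotient-degree {c ∷ c′ ∷ c″ ∷ cs} a (_ ∷ D@(_ ∷ _)) = eval (c′ ∷ c″ ∷ cs) a ∷ quotient-degree a D

  root-of-quotient : ∀ P {a x} → eval P a ≈ 0 → eval P x ≈ 0 → x ≈ a ⊎ eval (quotient P a) x ≈ 0
  root-of-quotient P {a} {x} Pa≈0 Px≈0 with eval (quotient P a) x ≈? 0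
  ... | yes Qx≈0 = inj₂ Qx≈0
  ... | no  Qx≉0 = inj₁ (*-cancelʳ-≈ (eval Q x) Qx≉0 (≈-sym (begin
    a * eval Q x                 ≈⟨ +-cong (≈-sym Px≈0) (≈-refl {a * eval Q x}) ⟩
    eval P x + a * eval Q x      ≡⟨ eval-quotient P a x ⟩
    x * eval Q x + eval P a      ≈⟨ +-cong (≈-refl {x * eval Q x}) Pa≈0 ⟩
    x * eval Q x + 0             ≡⟨ +-identityʳ _ ⟩
    x * eval Q x                 ∎)))
    where
    open ≈-Reasoning
    Q : List ℕ
    Q = quotient P a

  roots≤degree : ∀ P d → Degree P d → count q (λ x → eval P x ≈? 0) ≤ d
  roots≤degree (c ∷ []) zero (constant c≉0) = ≤-reflexive (count-none q (λ x → eval (c ∷ []) x ≈? 0)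
    (λ x _ e → c≉0 (≈-trans (≡⇒≈ (sym (trans (cong (c +_) (*-zeroʳ x)) (+-identityʳ c)))) e)))
  roots≤degree P (suc d) D with count q (λ x → eval P x ≈? 0) in eq
  ... | zero  = z≤n
  ... | suc _ with count>0⇒ q (λ x → eval P x ≈? 0) (subst (0 <_) (sym eq) z<s)
  ...   | a , a<q , Pa≈0 = subst (_≤ suc d) eq (begin
    count q (λ x → eval P x ≈? 0)
      ≤⟨ count-mono q (λ x → eval P x ≈? 0) (λ x → (x ≟ a) ⊎-dec (eval Q x ≈? 0)) a-or-root-of-Q ⟩
    count q (λ x → (x ≟ a) ⊎-dec (eval Q x ≈? 0))
      ≤⟨ count-⊎ q (_≟ a) (λ x → eval Q x ≈? 0) ⟩
    count q (_≟ a) + count q (λ x → eval Q x ≈? 0)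
      ≤⟨ +-mono-≤ (count-≟≤1 q a) (roots≤degree Q d (quotient-degree a D)) ⟩
    1 + d
      ∎)
    where
    open ≤-Reasoning
    Q : List ℕ
    Q = quotient P a
    a-or-root-of-Q : ∀ x → x < q → eval P x ≈ 0 → x ≡ a ⊎ eval Q x ≈ 0
    a-or-root-of-Q x x<q Px≈0 with root-of-quotient P Pa≈0 Px≈0
    ... | inj₁ x≈a   = inj₁ (≈⇒≡ x<q a<q x≈a)
    ... | inj₂ Qx≈0  = inj₂ Qx≈0

  monomial : ℕ → List ℕ
  monomial zero    = 1 ∷ []
  monomial (suc n) = 0 ∷ monomial n

  eval-monomial : ∀ n x → eval (monomial n) x ≡ x ^ n
  eval-monomial zero    x = cong (1 +_) (*-zeroʳ x)
  eval-monomial (suc n) x = cong (x *_) (eval-monomial n x)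

  degree-monomial : ∀ n → Degree (monomial n) n
  degree-monomial zero    = constant 1≉0
  degree-monomial (suc n) = 0 ∷ degree-monomial n

  roots-of-unity≤ : ∀ n .{{_ : NonZero n}} → count q (λ x → x ^ n ≈? 1) ≤ n
  roots-of-unity≤ (suc n) = ≤-trans (count-mono q (λ x → x ^ suc n ≈? 1) (λ x → eval P x ≈? 0) root)
                              (roots≤degree P (suc n) (suc k ∷ degree-monomial n))
    where
    P : List ℕ
    P = suc k ∷ monomial n
    root : ∀ x → x < q → x ^ suc n ≈ 1 → eval P x ≈ 0
    root x _ e = begin
      suc k + x * eval (monomial n) x ≡⟨ cong (λ z → suc k + x * z) (eval-monomial n x) ⟩
      suc k + x ^ suc n              ≈⟨ +-cong (≈-refl {suc k}) e ⟩
      suc k + 1                      ≡⟨ +-comm (suc k) 1 ⟩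
      q                              ≈⟨ q≈0 ⟩
      0                              ∎
      where open ≈-Reasoning

-- u plays the role of the reduction of ζ modulo the fixed prime above q, so
-- x^((q-1)/L) ≈ u^(index x) and χ(x) = ζ^(index x).
module CharacterIndex (k : ℕ) (q-prime : Prime (suc (suc k)))
  (L : ℕ) {{L≢0 : NonZero L}} (q≡1 : suc (suc k) % L ≡ 1)
  (u : ℕ) (u-order : HasOrder (suc (suc k)) u L) where

  open import Data.Nat
  open import Data.Nat.Properties
  open NatProperties using (^-distribʳ-*)
  open import Data.Nat.DivMod hiding (_div_; _mod_)
  open import Data.Bool using (Bool; true; false; T)
  open import Data.Unit using (⊤; tt)
  open import Data.Product using (Σ; _×_; _,_; proj₁; proj₂)
  open import Data.Sum using (_⊎_; inj₁; inj₂)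
  open import Data.Empty using (⊥-elim)
  open import Relation.Nullary using (Dec; yes; no; ¬_; contradiction)
  open import Relation.Nullary.Decidable using (⌊_⌋; _×-dec_; toWitness)
  open import Relation.Binary.PropositionalEquality
  open import Defs using (firstBelow; _div_; _mod_)
  open FiniteSum
  open PrimeField k q-prime
  open RootBound k q-prime

  m : ℕ
  m = (q ∸ 1) div L

  m*L≡q-1 : m * L ≡ q ∸ 1
  m*L≡q-1 = begin
    m * L                     ≡⟨ cong (_* L) (div≡/ L) ⟩
    suc k / L * L             ≡⟨ cong (_+ suc k / L * L) L∣q-1 ⟨
    suc k % L + suc k / L * L ≡⟨ m≡m%n+[m/n]*n (suc k) L ⟨
    suc k                     ∎
    where
    div≡/ : ∀ n .{{_ : NonZero n}} → suc k div n ≡ suc k / n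
    div≡/ (suc n) = refl
    open ≡-Reasoning
    q-1≡ : suc k ≡ q / L * L
    q-1≡ = suc-injective (trans (m≡m%n+[m/n]*n q L) (cong (_+ q / L * L) q≡1))
    L∣q-1 : suc k % L ≡ 0
    L∣q-1 = trans (cong (_% L) q-1≡) (m*n%n≡0 (q / L) L)

  instance
    m≢0 : NonZero m
    m≢0 = ≢-nonZero (λ m≡0 → 0≢1+n (trans (cong (_* L) (sym m≡0)) m*L≡q-1))

  fermat-mL : ∀ x → ¬ (x ≈ 0) → x ^ (m * L) ≈ 1
  fermat-mL x x≉0 = subst (λ e → x ^ e ≈ 1) (sym m*L≡q-1) (fermat x x≉0)

  u^L≈1 : u ^ L ≈ 1
  u^L≈1 = mk≈ (proj₁ u-order)

  u≉0 : ¬ (u ≈ 0)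
  u≉0 = ^≈1⇒≉0 u L u^L≈1

  [u^j]^L≈1 : ∀ j → (u ^ j) ^ L ≈ 1
  [u^j]^L≈1 j = begin
    (u ^ j) ^ L         ≡⟨ ^-*-assoc u j L ⟩
    u ^ (j * L)         ≡⟨ cong (u ^_) (*-comm j L) ⟩
    u ^ (L * j)         ≡⟨ ^-*-assoc u L j ⟨
    (u ^ L) ^ j         ≈⟨ ^-congˡ j u^L≈1 ⟩
    1 ^ j               ≡⟨ ^-zeroˡ j ⟩
    1                   ∎
    where open ≈-Reasoning

  u^≈u^% : ∀ a → u ^ a ≈ u ^ (a % L)
  u^≈u^% a = begin
    u ^ a                             ≡⟨ cong (u ^_) (m≡m%n+[m/n]*n a L) ⟩
    u ^ (a % L + a / L * L)           ≡⟨ ^-distribˡ-+-* u (a % L) (a / L * L) ⟩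
    u ^ (a % L) * u ^ (a / L * L)     ≡⟨ cong (λ e → u ^ (a % L) * u ^ e) (*-comm (a / L) L) ⟩
    u ^ (a % L) * u ^ (L * (a / L))   ≡⟨ cong (u ^ (a % L) *_) (^-*-assoc u L (a / L)) ⟨
    u ^ (a % L) * (u ^ L) ^ (a / L)   ≈⟨ *-congˡ (u ^ (a % L)) (^-congˡ (a / L) u^L≈1) ⟩
    u ^ (a % L) * 1 ^ (a / L)         ≡⟨ cong (u ^ (a % L) *_) (^-zeroˡ (a / L)) ⟩
    u ^ (a % L) * 1                   ≡⟨ *-identityʳ _ ⟩
    u ^ (a % L)                       ∎
    where open ≈-Reasoning

  private
    u^-injective-≤ : ∀ {i j} → i ≤ j → j < L → u ^ i ≈ u ^ j → i ≡ j
    u^-injective-≤ {i} {j} i≤j j<L e with j ∸ i in eq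
    ... | zero  = ≤-antisym i≤j (m∸n≡0⇒m≤n eq)
    ... | suc d = ⊥-elim (proj₂ u-order (suc d) z<s (subst (_< L) eq (≤-<-trans (m∸n≤m j i) j<L)) (un≈ u^[1+d]≈1))
      where
      u^[1+d]≈1 : u ^ suc d ≈ 1
      u^[1+d]≈1 = *-cancelˡ-≈ (u ^ i) (^-≉0 u i u≉0) (begin
        u ^ i * u ^ suc d     ≡⟨ cong (λ e → u ^ i * u ^ e) eq ⟨
        u ^ i * u ^ (j ∸ i)   ≡⟨ ^-distribˡ-+-* u i (j ∸ i) ⟨
        u ^ (i + (j ∸ i))     ≡⟨ cong (u ^_) (m+[n∸m]≡n i≤j) ⟩
        u ^ j                 ≈⟨ e ⟨
        u ^ i                 ≡⟨ *-identityʳ _ ⟨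
        u ^ i * 1             ∎)
        where open ≈-Reasoning

  u^-injective : ∀ {i j} → i < L → j < L → u ^ i ≈ u ^ j → i ≡ j
  u^-injective {i} {j} i<L j<L e with ≤-total i j
  ... | inj₁ i≤j = u^-injective-≤ i≤j j<L e
  ... | inj₂ j≤i = sym (u^-injective-≤ j≤i i<L (≈-sym e))

  u^≈1⇒ : ∀ a → u ^ a ≈ 1 → a % L ≡ 0
  u^≈1⇒ a e = u^-injective (m%n<n a L) (>-nonZero⁻¹ L) (≈-trans (≈-sym (u^≈u^% a)) e)

  u^≈1⇐ : ∀ a → a % L ≡ 0 → u ^ a ≈ 1
  u^≈1⇐ a e = ≈-trans (u^≈u^% a) (≡⇒≈ (cong (u ^_) e))

  -- Otherwise u^0, …, u^(L-1) and y would be L + 1 distinct roots of X^L - 1.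
  powers-of-u-exhaust : ∀ y → y ^ L ≈ 1 → Σ ℕ (λ j → j < L × y ≈ u ^ j)
  powers-of-u-exhaust y y^L≈1 with count L (λ j → y ≈? u ^ j) in eq
  ... | suc _ = count>0⇒ L (λ j → y ≈? u ^ j) (subst (0 <_) (sym eq) z<s)
  ... | zero  = ⊥-elim (<-irrefl refl (≤-trans too-many (roots-of-unity≤ L)))
    where
    y≉u^ : ∀ j → j < L → ¬ (y ≈ u ^ j)
    y≉u^ = count≡0⇒ L (λ j → y ≈? u ^ j) eq
    φ : ℕ → ℕ
    φ j with j <? L
    ... | yes _ = (u ^ j) % q
    ... | no _  = y % q
    root : ∀ j → j < suc L → ⊤ → φ j < q × φ j ^ L ≈ 1
    root j _ _ with j <? L
    ... | yes _ = m%n<n (u ^ j) q , ≈-trans (^-congˡ L (m%q≈m (u ^ j))) ([u^j]^L≈1 j)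
    ... | no _  = m%n<n y q , ≈-trans (^-congˡ L (m%q≈m y)) y^L≈1
    injective : ∀ i j → i < suc L → j < suc L → ⊤ → ⊤ → φ i ≡ φ j → i ≡ j
    injective i j i<1+L j<1+L _ _ e with i <? L | j <? L
    ... | yes i<L | yes j<L = u^-injective i<L j<L (mk≈ e)
    ... | yes i<L | no _    = ⊥-elim (y≉u^ i i<L (mk≈ (sym e)))
    ... | no _    | yes j<L = ⊥-elim (y≉u^ j j<L (mk≈ e))
    ... | no i≮L  | no j≮L  = trans (≤-antisym (≤-pred i<1+L) (≮⇒≥ i≮L)) (sym (≤-antisym (≤-pred j<1+L) (≮⇒≥ j≮L)))
    too-many : suc L ≤ count q (λ x → x ^ L ≈? 1)
    too-many = subst (_≤ count q (λ x → x ^ L ≈? 1)) (count-all (suc L) (λ _ → yes tt) (λ _ _ → tt))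
      (count-injection (suc L) q (λ _ → yes tt) (λ x → x ^ L ≈? 1) φ root injective)

  firstBelow-spec : ∀ n (p : ℕ → Bool) j → j < n → p j ≡ true → firstBelow n p < n × p (firstBelow n p) ≡ true
  firstBelow-spec (suc n) p j j<n pj with p 0 in p0
  ... | true  = z<s , p0
  ... | false with j
  ...   | zero   = contradiction (trans (sym p0) pj) (λ ())
  ...   | suc j′ with firstBelow-spec n (λ i → p (suc i)) j′ (≤-pred j<n) pj
  ...     | lt , pf = s<s lt , pf

  private
    ⌊⌋≡true : ∀ {a} {P : Set a} (d : Dec P) → P → ⌊ d ⌋ ≡ true
    ⌊⌋≡true (yes _) _ = refl
    ⌊⌋≡true (no ¬p) p = contradiction p ¬p

  -- Defs.indχ ℓ q u with ℓ * ℓ generalised to L.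
  index : ℕ → ℕ
  index x = firstBelow L (λ j → ⌊ (x ^ m) mod q ≟ (u ^ j) mod q ⌋)

  index-spec : ∀ x → ¬ (x ≈ 0) → index x < L × x ^ m ≈ u ^ index x
  index-spec x x≉0 = proj₁ found , mk≈ (toWitness {a? = (x ^ m) % q ≟ (u ^ index x) % q} (subst T (sym (proj₂ found)) tt))
    where
    p : ℕ → Bool
    p j = ⌊ (x ^ m) mod q ≟ (u ^ j) mod q ⌋
    root : Σ ℕ (λ j → j < L × x ^ m ≈ u ^ j)
    root = powers-of-u-exhaust (x ^ m) (≈-trans (≡⇒≈ (^-*-assoc x m L)) (fermat-mL x x≉0))
    found : index x < L × p (index x) ≡ true
    found = firstBelow-spec L p (proj₁ root) (proj₁ (proj₂ root))
              (⌊⌋≡true ((x ^ m) % q ≟ (u ^ proj₁ root) % q) (un≈ (proj₂ (proj₂ root))))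

  index<L : ∀ x → ¬ (x ≈ 0) → index x < L
  index<L x x≉0 = proj₁ (index-spec x x≉0)

  index-unique : ∀ x j → ¬ (x ≈ 0) → x ^ m ≈ u ^ j → index x ≡ j % L
  index-unique x j x≉0 e = u^-injective (index<L x x≉0) (m%n<n j L)
    (≈-trans (≈-sym (proj₂ (index-spec x x≉0))) (≈-trans e (u^≈u^% j)))

  index-* : ∀ x y → ¬ (x ≈ 0) → ¬ (y ≈ 0) → index (x * y) ≡ (index x + index y) % L
  index-* x y x≉0 y≉0 = index-unique (x * y) (index x + index y) (*-≉0 x y x≉0 y≉0) (begin
    (x * y) ^ m             ≡⟨ ^-distribʳ-* x y m ⟩
    x ^ m * y ^ m           ≈⟨ *-cong (proj₂ (index-spec x x≉0)) (proj₂ (index-spec y y≉0)) ⟩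
    u ^ index x * u ^ index y ≡⟨ ^-distribˡ-+-* u (index x) (index y) ⟨
    u ^ (index x + index y) ∎)
    where open ≈-Reasoning

  x^[m*d]≈u^[d*index] : ∀ x d → ¬ (x ≈ 0) → x ^ (m * d) ≈ u ^ (d * index x)
  x^[m*d]≈u^[d*index] x d x≉0 = begin
    x ^ (m * d)         ≡⟨ ^-*-assoc x m d ⟨
    (x ^ m) ^ d         ≈⟨ ^-congˡ d (proj₂ (index-spec x x≉0)) ⟩
    (u ^ index x) ^ d   ≡⟨ ^-*-assoc u (index x) d ⟩
    u ^ (index x * d)   ≡⟨ cong (u ^_) (*-comm (index x) d) ⟩
    u ^ (d * index x)   ∎
    where open ≈-Reasoning

  index-^ : ∀ x n → ¬ (x ≈ 0) → index (x ^ n) ≡ (n * index x) % L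
  index-^ x n x≉0 = index-unique (x ^ n) (n * index x) (^-≉0 x n x≉0) (begin
    (x ^ n) ^ m         ≡⟨ ^-*-assoc x n m ⟩
    x ^ (n * m)         ≡⟨ cong (x ^_) (*-comm n m) ⟩
    x ^ (m * n)         ≈⟨ x^[m*d]≈u^[d*index] x n x≉0 ⟩
    u ^ (n * index x)   ∎)
    where open ≈-Reasoning

  ^[m*d]≈1⇒ : ∀ x d → ¬ (x ≈ 0) → x ^ (m * d) ≈ 1 → (d * index x) % L ≡ 0
  ^[m*d]≈1⇒ x d x≉0 e = u^≈1⇒ (d * index x) (≈-trans (≈-sym (x^[m*d]≈u^[d*index] x d x≉0)) e)

  ^[m*d]≈1⇐ : ∀ x d → ¬ (x ≈ 0) → (d * index x) % L ≡ 0 → x ^ (m * d) ≈ 1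
  ^[m*d]≈1⇐ x d x≉0 e = ≈-trans (x^[m*d]≈u^[d*index] x d x≉0) (u^≈1⇐ (d * index x) e)

  count-nonzero : count q (0 <?_) ≡ q ∸ 1
  count-nonzero = trans (Σ-cong (suc k) (λ i _ → 𝟙-yes (0 <? suc i) z<s)) (trans (Σ-const (suc k) 1) (*-identityʳ (suc k)))

  index-fibre? : ∀ j w → Dec (0 < w × index w ≡ j)
  index-fibre? j w = (0 <? w) ×-dec (index w ≟ j)

  Σ-by-index : ∀ (h : ℕ → ℕ) → Σ< q (λ w → 𝟙 (0 <? w) * h (index w)) ≡ Σ< L (λ j → h j * count q (index-fibre? j))
  Σ-by-index h = trans (Σ-fibres q L (λ w → 𝟙 (0 <? w)) h index in-range)
    (Σ-cong L (λ j _ → cong (h j *_) (Σ-cong q (λ w _ → 𝟙-× (0 <? w) (index w ≟ j)))))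
    where
    in-range : ∀ w → w < q → 𝟙 (0 <? w) ≡ 0 ⊎ index w < L
    in-range w w<q with 0 <? w
    ... | yes 0<w = inj₂ (index<L w (<q⇒≉0 0<w w<q))
    ... | no ¬0<w = inj₁ (𝟙-no (0 <? w) ¬0<w)

  -- Dividing by one element g of the fibre maps the fibre injectively into the m-th roots of unity.
  index-fibre≤m : ∀ j → count q (index-fibre? j) ≤ m
  index-fibre≤m j with count q (index-fibre? j) in eq
  ... | zero  = z≤n
  ... | suc _ with count>0⇒ q (index-fibre? j) (subst (0 <_) (sym eq) z<s)
  ...   | g , g<q , (0<g , index-g) = subst (_≤ m) eq
    (≤-trans (count-injection q q (index-fibre? j) (λ w → w ^ m ≈? 1) φ root injective) (roots-of-unity≤ m))
    where
    g≉0 : ¬ (g ≈ 0)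
    g≉0 = <q⇒≉0 0<g g<q
    φ : ℕ → ℕ
    φ w = (w * inv g) % q
    root : ∀ w → w < q → 0 < w × index w ≡ j → φ w < q × φ w ^ m ≈ 1
    root w w<q (0<w , index-w) = m%n<n (w * inv g) q , (begin
      ((w * inv g) % q) ^ m   ≈⟨ ^-congˡ m (m%q≈m (w * inv g)) ⟩
      (w * inv g) ^ m         ≡⟨ ^-distribʳ-* w (inv g) m ⟩
      w ^ m * inv g ^ m       ≈⟨ *-congʳ (inv g ^ m) same-power ⟩
      g ^ m * inv g ^ m       ≡⟨ ^-distribʳ-* g (inv g) m ⟨
      (g * inv g) ^ m         ≈⟨ ^-congˡ m (*-inverseʳ g g≉0) ⟩
      1 ^ m                   ≡⟨ ^-zeroˡ m ⟩
      1                       ∎)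
      where
      open ≈-Reasoning
      same-power : w ^ m ≈ g ^ m
      same-power = ≈-trans (proj₂ (index-spec w (<q⇒≉0 0<w w<q)))
                   (≈-trans (≡⇒≈ (cong (u ^_) (trans index-w (sym index-g)))) (≈-sym (proj₂ (index-spec g g≉0))))
    injective : ∀ w w′ → w < q → w′ < q → 0 < w × index w ≡ j → 0 < w′ × index w′ ≡ j → φ w ≡ φ w′ → w ≡ w′
    injective w w′ w<q w′<q _ _ e = ≈⇒≡ w<q w′<q (*-cancelʳ-≈ (inv g) (inv-≉0 g g≉0) (mk≈ e))

  index-fibre : ∀ j → j < L → count q (index-fibre? j) ≡ m
  index-fibre j j<L = trans (sym (+-identityʳ _)) (Σ-tight L {λ j → 1 * count q (index-fibre? j)} {λ _ → m}
    (λ j _ → subst (_≤ m) (sym (+-identityʳ _)) (index-fibre≤m j)) total j j<L)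
    where
    total : Σ< L (λ j → 1 * count q (index-fibre? j)) ≡ Σ< L (λ _ → m)
    total = begin
      Σ< L (λ j → 1 * count q (index-fibre? j))   ≡⟨ Σ-by-index (λ _ → 1) ⟨
      Σ< q (λ w → 𝟙 (0 <? w) * 1)                 ≡⟨ Σ-cong q (λ w _ → *-identityʳ (𝟙 (0 <? w))) ⟩
      count q (0 <?_)                              ≡⟨ count-nonzero ⟩
      q ∸ 1                                        ≡⟨ m*L≡q-1 ⟨
      m * L                                        ≡⟨ *-comm m L ⟩
      L * m                                        ≡⟨ Σ-const L m ⟨
      Σ< L (λ _ → m)                               ∎
      where open ≡-Reasoning

  Σ-over-index : ∀ (h : ℕ → ℕ) → Σ< q (λ w → 𝟙 (0 <? w) * h (index w)) ≡ m * Σ< L h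
  Σ-over-index h = trans (Σ-by-index h)
    (trans (Σ-cong L (λ j j<L → trans (cong (h j *_) (index-fibre j j<L)) (*-comm (h j) m))) (Σ-*ˡ L m h))

module PowerResidues (k : ℕ) (q-prime : Prime (suc (suc k))) (ℓ′ : ℕ)
  (q≡1 : suc (suc k) % (suc ℓ′ * suc ℓ′) ≡ 1)
  (u : ℕ) (u-order : HasOrder (suc (suc k)) u (suc ℓ′ * suc ℓ′)) where

  open import Data.Nat
  open import Data.Nat.Properties
  open import Data.Nat.DivMod
  open import Data.Unit using (⊤; tt)
  open import Data.Product using (_×_; _,_)
  open import Data.Sum using (inj₂)
  open import Data.Empty using (⊥-elim)
  open import Relation.Nullary using (yes; no; ¬_)
  open import Relation.Binary.PropositionalEquality
  open import Data.Nat.Tactic.RingSolver using (solve-∀)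
  open NatProperties using (^-distribʳ-*)
  open FiniteSum
  open PrimeField k q-prime
  open RootBound k q-prime

  ℓ : ℕ
  ℓ = suc ℓ′

  L : ℕ
  L = ℓ * ℓ

  open CharacterIndex k q-prime L q≡1 u u-order public

  count-ℓ-torsion : count L (λ j → (ℓ * j) % L ≟ 0) ≡ ℓ
  count-ℓ-torsion = begin
    count L (λ j → (ℓ * j) % L ≟ 0)
      ≡⟨ Σ-blocks ℓ ℓ (λ j → 𝟙 ((ℓ * j) % L ≟ 0)) ⟩
    Σ< ℓ (λ a → Σ< ℓ (λ b → 𝟙 ((ℓ * (a * ℓ + b)) % L ≟ 0)))
      ≡⟨ Σ-cong ℓ (λ a _ → Σ-cong ℓ (λ b b<ℓ →
           𝟙-cong ((ℓ * (a * ℓ + b)) % L ≟ 0) (b ≟ 0) (⇒b≡0 a b b<ℓ) (⇐b≡0 a b b<ℓ))) ⟩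
    Σ< ℓ (λ a → Σ< ℓ (λ b → 𝟙 (b ≟ 0)))
      ≡⟨ Σ-cong ℓ (λ a _ → cong suc (Σ-zero ℓ′ (λ _ _ → refl))) ⟩
    Σ< ℓ (λ a → 1)
      ≡⟨ trans (Σ-const ℓ 1) (*-identityʳ ℓ) ⟩
    ℓ
      ∎
    where
    open ≡-Reasoning
    reduce : ∀ a b → b < ℓ → (ℓ * (a * ℓ + b)) % L ≡ ℓ * b
    reduce a b b<ℓ = begin
      (ℓ * (a * ℓ + b)) % L     ≡⟨ cong (_% L) (*-distribˡ-+ ℓ (a * ℓ) b) ⟩
      (ℓ * (a * ℓ) + ℓ * b) % L ≡⟨ cong (λ z → (z + ℓ * b) % L) (regroup ℓ a) ⟩
      (a * L + ℓ * b) % L       ≡⟨ cong (_% L) (+-comm (a * L) (ℓ * b)) ⟩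
      (ℓ * b + a * L) % L       ≡⟨ [m+kn]%n≡m%n (ℓ * b) a L ⟩
      (ℓ * b) % L               ≡⟨ m<n⇒m%n≡m (*-monoʳ-< ℓ b<ℓ) ⟩
      ℓ * b                     ∎
      where
      regroup : ∀ l a → l * (a * l) ≡ a * (l * l)
      regroup = solve-∀
    ⇒b≡0 : ∀ a b → b < ℓ → (ℓ * (a * ℓ + b)) % L ≡ 0 → b ≡ 0
    ⇒b≡0 a b b<ℓ e = m+n≡0⇒m≡0 b (trans (sym (reduce a b b<ℓ)) e)
    ⇐b≡0 : ∀ a b → b < ℓ → b ≡ 0 → (ℓ * (a * ℓ + b)) % L ≡ 0
    ⇐b≡0 a b b<ℓ b≡0 = trans (reduce a b b<ℓ) (trans (cong (ℓ *_) b≡0) (*-zeroʳ ℓ))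

  count-ℓth-roots-of-unity : count q (λ z → z ^ ℓ ≈? 1) ≡ ℓ
  count-ℓth-roots-of-unity = ≤-antisym (roots-of-unity≤ ℓ)
    (subst (_≤ count q (λ z → z ^ ℓ ≈? 1)) (count-all ℓ (λ _ → yes tt) (λ _ _ → tt))
      (count-injection ℓ q (λ _ → yes tt) (λ z → z ^ ℓ ≈? 1) φ root injective))
    where
    φ : ℕ → ℕ
    φ j = (u ^ (ℓ * j)) % q
    root : ∀ j → j < ℓ → ⊤ → φ j < q × φ j ^ ℓ ≈ 1
    root j _ _ = m%n<n (u ^ (ℓ * j)) q , (begin
      ((u ^ (ℓ * j)) % q) ^ ℓ ≈⟨ ^-congˡ ℓ (m%q≈m (u ^ (ℓ * j))) ⟩
      (u ^ (ℓ * j)) ^ ℓ       ≡⟨ ^-*-assoc u (ℓ * j) ℓ ⟩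
      u ^ (ℓ * j * ℓ)         ≡⟨ cong (u ^_) (regroup ℓ j) ⟩
      u ^ (j * L)             ≡⟨ ^-*-assoc u j L ⟨
      (u ^ j) ^ L             ≈⟨ [u^j]^L≈1 j ⟩
      1                       ∎)
      where
      open ≈-Reasoning
      regroup : ∀ l j → l * j * l ≡ j * (l * l)
      regroup = solve-∀
    injective : ∀ i j → i < ℓ → j < ℓ → ⊤ → ⊤ → φ i ≡ φ j → i ≡ j
    injective i j i<ℓ j<ℓ _ _ e = *-cancelˡ-≡ i j ℓ (u^-injective (*-monoʳ-< ℓ i<ℓ) (*-monoʳ-< ℓ j<ℓ)
      (mk≈ e))

  ℓth-roots : ℕ → ℕ
  ℓth-roots c = count q (λ y → y ^ ℓ ≈? c)

  ℓth-roots-cong : ∀ {c c′} → c ≈ c′ → ℓth-roots c ≡ ℓth-roots c′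
  ℓth-roots-cong {c} {c′} e = count-cong q (λ y → y ^ ℓ ≈? c) (λ y → y ^ ℓ ≈? c′)
    (λ y _ y^ℓ≈c → ≈-trans y^ℓ≈c e) (λ y _ y^ℓ≈c′ → ≈-trans y^ℓ≈c′ (≈-sym e))

  ℓth-roots-of-0 : ∀ c → c ≈ 0 → ℓth-roots c ≡ 1
  ℓth-roots-of-0 c c≈0 = trans (count-cong q (λ y → y ^ ℓ ≈? c) (_≟ 0) only-0 (λ { .0 _ refl → ≈-sym c≈0 }))
                               (cong suc (Σ-zero (suc k) (λ _ _ → refl)))
    where
    only-0 : ∀ y → y < q → y ^ ℓ ≈ c → y ≡ 0
    only-0 y y<q y^ℓ≈c with y ≈? 0
    ... | yes y≈0 = ≈⇒≡ y<q z<s y≈0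
    ... | no  y≉0 = ⊥-elim (^-≉0 y ℓ y≉0 (≈-trans y^ℓ≈c c≈0))

  -- Multiplication by a fixed ℓ-th root y₀ of c is a bijection from the ℓ-th roots of unity.
  ℓth-roots-of-power : ∀ c y₀ → ¬ (c ≈ 0) → y₀ ^ ℓ ≈ c → ℓth-roots c ≡ ℓ
  ℓth-roots-of-power c y₀ c≉0 y₀^ℓ≈c = trans
    (count-bijection q q (λ y → y ^ ℓ ≈? c) (λ z → z ^ ℓ ≈? 1) φ ψ φ-root ψ-root ψφ φψ)
    count-ℓth-roots-of-unity
    where
    y₀≉0 : ¬ (y₀ ≈ 0)
    y₀≉0 y₀≈0 = c≉0 (≈-trans (≈-sym y₀^ℓ≈c) (^-congˡ ℓ y₀≈0))
    φ ψ : ℕ → ℕ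
    φ y = (y * inv y₀) % q
    ψ z = (z * y₀) % q
    φ-root : ∀ y → y < q → y ^ ℓ ≈ c → φ y < q × φ y ^ ℓ ≈ 1
    φ-root y _ y^ℓ≈c = m%n<n (y * inv y₀) q , (begin
      ((y * inv y₀) % q) ^ ℓ  ≈⟨ ^-congˡ ℓ (m%q≈m (y * inv y₀)) ⟩
      (y * inv y₀) ^ ℓ        ≡⟨ ^-distribʳ-* y (inv y₀) ℓ ⟩
      y ^ ℓ * inv y₀ ^ ℓ      ≈⟨ *-congʳ (inv y₀ ^ ℓ) (≈-trans y^ℓ≈c (≈-sym y₀^ℓ≈c)) ⟩
      y₀ ^ ℓ * inv y₀ ^ ℓ     ≡⟨ ^-distribʳ-* y₀ (inv y₀) ℓ ⟨
      (y₀ * inv y₀) ^ ℓ       ≈⟨ ^-congˡ ℓ (*-inverseʳ y₀ y₀≉0) ⟩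
      1 ^ ℓ                   ≡⟨ ^-zeroˡ ℓ ⟩
      1                       ∎)
      where open ≈-Reasoning
    ψ-root : ∀ z → z < q → z ^ ℓ ≈ 1 → ψ z < q × ψ z ^ ℓ ≈ c
    ψ-root z _ z^ℓ≈1 = m%n<n (z * y₀) q , (begin
      ((z * y₀) % q) ^ ℓ  ≈⟨ ^-congˡ ℓ (m%q≈m (z * y₀)) ⟩
      (z * y₀) ^ ℓ        ≡⟨ ^-distribʳ-* z y₀ ℓ ⟩
      z ^ ℓ * y₀ ^ ℓ      ≈⟨ *-cong z^ℓ≈1 y₀^ℓ≈c ⟩
      1 * c               ≡⟨ *-identityˡ c ⟩
      c                   ∎)
      where open ≈-Reasoning
    cancels : ∀ a b b′ → b * b′ ≈ 1 → ((a * b) % q * b′) % q ≈ a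
    cancels a b b′ bb′≈1 = begin
      ((a * b) % q * b′) % q  ≈⟨ m%q≈m ((a * b) % q * b′) ⟩
      (a * b) % q * b′        ≈⟨ *-congʳ b′ (m%q≈m (a * b)) ⟩
      a * b * b′              ≡⟨ *-assoc a b b′ ⟩
      a * (b * b′)            ≈⟨ *-congˡ a bb′≈1 ⟩
      a * 1                   ≡⟨ *-identityʳ a ⟩
      a                       ∎
      where open ≈-Reasoning
    ψφ : ∀ y → y < q → y ^ ℓ ≈ c → ψ (φ y) ≡ y
    ψφ y y<q _ = ≈⇒≡ (m%n<n ((y * inv y₀) % q * y₀) q) y<q (cancels y (inv y₀) y₀ (*-inverseˡ y₀ y₀≉0))
    φψ : ∀ z → z < q → z ^ ℓ ≈ 1 → φ (ψ z) ≡ z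
    φψ z z<q _ = ≈⇒≡ (m%n<n ((z * y₀) % q * inv y₀) q) z<q (cancels z y₀ (inv y₀) (*-inverseʳ y₀ y₀≉0))

  [y^ℓ]^mℓ≈1 : ∀ y → ¬ (y ≈ 0) → (y ^ ℓ) ^ (m * ℓ) ≈ 1
  [y^ℓ]^mℓ≈1 y y≉0 = ≈-trans (≡⇒≈ (trans (^-*-assoc y ℓ (m * ℓ)) (cong (y ^_) (regroup ℓ m)))) (fermat-mL y y≉0)
    where
    regroup : ∀ l m → l * (m * l) ≡ m * (l * l)
    regroup = solve-∀

  ℓth-roots≤ : ∀ c → ¬ (c ≈ 0) → ℓth-roots c ≤ ℓ * 𝟙 (c ^ (m * ℓ) ≈? 1)
  ℓth-roots≤ c c≉0 with ℓth-roots c in eq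
  ... | zero  = z≤n
  ... | suc _ with count>0⇒ q (λ y → y ^ ℓ ≈? c) (subst (0 <_) (sym eq) z<s)
  ...   | y₀ , _ , y₀^ℓ≈c = ≤-reflexive (begin
    suc _                        ≡⟨ eq ⟨
    ℓth-roots c                  ≡⟨ ℓth-roots-of-power c y₀ c≉0 y₀^ℓ≈c ⟩
    ℓ                            ≡⟨ *-identityʳ ℓ ⟨
    ℓ * 1                        ≡⟨ cong (ℓ *_) (𝟙-yes (c ^ (m * ℓ) ≈? 1) c-power) ⟨
    ℓ * 𝟙 (c ^ (m * ℓ) ≈? 1)   ∎)
    where
    open ≡-Reasoning
    c-power : c ^ (m * ℓ) ≈ 1
    c-power = ≈-trans (^-congˡ (m * ℓ) (≈-sym y₀^ℓ≈c))
                      ([y^ℓ]^mℓ≈1 y₀ (λ y₀≈0 → c≉0 (≈-trans (≈-sym y₀^ℓ≈c) (^-congˡ ℓ y₀≈0))))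

  -- c^(mℓ) ≈ 1 iff ℓ · index c ≡ 0 (mod ℓ²), and the index is equidistributed.
  count-c^mℓ≈1 : Σ< q (λ c → 𝟙 (0 <? c) * 𝟙 (c ^ (m * ℓ) ≈? 1)) ≡ m * ℓ
  count-c^mℓ≈1 = begin
    Σ< q (λ c → 𝟙 (0 <? c) * 𝟙 (c ^ (m * ℓ) ≈? 1))       ≡⟨ Σ-cong q (λ c c<q → 𝟙*-cong (0 <? c) (by-index c c<q)) ⟩
    Σ< q (λ c → 𝟙 (0 <? c) * 𝟙 ((ℓ * index c) % L ≟ 0))  ≡⟨ Σ-over-index (λ j → 𝟙 ((ℓ * j) % L ≟ 0)) ⟩
    m * count L (λ j → (ℓ * j) % L ≟ 0)                    ≡⟨ cong (m *_) count-ℓ-torsion ⟩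
    m * ℓ                                                   ∎
    where
    open ≡-Reasoning
    by-index : ∀ c → c < q → 0 < c → 𝟙 (c ^ (m * ℓ) ≈? 1) ≡ 𝟙 ((ℓ * index c) % L ≟ 0)
    by-index c c<q 0<c = 𝟙-cong (c ^ (m * ℓ) ≈? 1) ((ℓ * index c) % L ≟ 0)
      (^[m*d]≈1⇒ c ℓ (<q⇒≉0 0<c c<q)) (^[m*d]≈1⇐ c ℓ (<q⇒≉0 0<c c<q))

  -- Every nonzero y is an ℓ-th root of exactly one nonzero residue.
  Σ-ℓth-roots : Σ< q (λ c → 𝟙 (0 <? c) * ℓth-roots c) ≡ q ∸ 1
  Σ-ℓth-roots = begin
    Σ< q (λ c → 𝟙 (0 <? c) * ℓth-roots c)
      ≡⟨ Σ-cong q (λ c c<q → trans (sym (Σ-*ˡ q (𝟙 (0 <? c)) (λ y → 𝟙 (y ^ ℓ ≈? c))))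
                                    (trans (Σ-cong q (λ y y<q → fibre-term c y c<q y<q)) (sym (+-identityʳ _)))) ⟩
    Σ< q (λ c → 1 * Σ< q (λ y → 𝟙 (0 <? y) * 𝟙 (φ y ≟ c)))
      ≡⟨ Σ-fibres q q (λ y → 𝟙 (0 <? y)) (λ _ → 1) φ (λ y _ → inj₂ (m%n<n (y ^ ℓ) q)) ⟨
    Σ< q (λ y → 𝟙 (0 <? y) * 1)
      ≡⟨ Σ-cong q (λ y _ → *-identityʳ (𝟙 (0 <? y))) ⟩
    count q (0 <?_)
      ≡⟨ count-nonzero ⟩
    q ∸ 1
      ∎
    where
    open ≡-Reasoning
    φ : ℕ → ℕ
    φ y = (y ^ ℓ) % q
    fibre-term : ∀ c y → c < q → y < q → 𝟙 (0 <? c) * 𝟙 (y ^ ℓ ≈? c) ≡ 𝟙 (0 <? y) * 𝟙 (φ y ≟ c)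
    fibre-term c y c<q y<q = trans (𝟙-× (0 <? c) (y ^ ℓ ≈? c))
      (trans (𝟙-cong ((0 <? c) ×-dec (y ^ ℓ ≈? c)) ((0 <? y) ×-dec (φ y ≟ c)) ⇒ ⇐) (sym (𝟙-× (0 <? y) (φ y ≟ c))))
      where
      open import Relation.Nullary.Decidable using (_×-dec_)
      ⇒ : 0 < c × y ^ ℓ ≈ c → 0 < y × φ y ≡ c
      ⇒ (0<c , e) = ≉0⇒>0 (λ y≈0 → <q⇒≉0 0<c c<q (≈-trans (≈-sym e) (^-congˡ ℓ y≈0))) ,
                    trans (un≈ e) (m<n⇒m%n≡m c<q)
      ⇐ : 0 < y × φ y ≡ c → 0 < c × y ^ ℓ ≈ c
      ⇐ (0<y , e) = ≉0⇒>0 (λ c≈0 → ^-≉0 y ℓ (<q⇒≉0 0<y y<q) (≈-trans y^ℓ≈c c≈0)) , y^ℓ≈c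
        where
        y^ℓ≈c : y ^ ℓ ≈ c
        y^ℓ≈c = mk≈ (trans e (sym (m<n⇒m%n≡m c<q)))

  -- Termwise ≤ (ℓth-roots≤) between two sums that both equal q - 1 forces equality.
  ℓth-roots-reduced : ∀ c → c < q → 0 < c → ℓth-roots c ≡ ℓ * 𝟙 (c ^ (m * ℓ) ≈? 1)
  ℓth-roots-reduced c c<q 0<c = 𝟙*-cancel (0 <? c) 0<c (Σ-tight q termwise sums c c<q)
    where
    termwise : ∀ c → c < q → 𝟙 (0 <? c) * ℓth-roots c ≤ 𝟙 (0 <? c) * (ℓ * 𝟙 (c ^ (m * ℓ) ≈? 1))
    termwise c c<q = 𝟙*-mono (0 <? c) (λ 0<c → ℓth-roots≤ c (<q⇒≉0 0<c c<q))
    regroup : ∀ a l b → a * (l * b) ≡ l * (a * b)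
    regroup = solve-∀
    sums : Σ< q (λ c → 𝟙 (0 <? c) * ℓth-roots c) ≡ Σ< q (λ c → 𝟙 (0 <? c) * (ℓ * 𝟙 (c ^ (m * ℓ) ≈? 1)))
    sums = begin
      Σ< q (λ c → 𝟙 (0 <? c) * ℓth-roots c)
        ≡⟨ Σ-ℓth-roots ⟩
      q ∸ 1
        ≡⟨ m*L≡q-1 ⟨
      m * L
        ≡⟨ regroup ℓ m ℓ ⟨
      ℓ * (m * ℓ)
        ≡⟨ cong (ℓ *_) count-c^mℓ≈1 ⟨
      ℓ * Σ< q (λ c → 𝟙 (0 <? c) * 𝟙 (c ^ (m * ℓ) ≈? 1))
        ≡⟨ Σ-*ˡ q ℓ (λ c → 𝟙 (0 <? c) * 𝟙 (c ^ (m * ℓ) ≈? 1)) ⟨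
      Σ< q (λ c → ℓ * (𝟙 (0 <? c) * 𝟙 (c ^ (m * ℓ) ≈? 1)))
        ≡⟨ Σ-cong q (λ c _ → regroup (𝟙 (0 <? c)) ℓ (𝟙 (c ^ (m * ℓ) ≈? 1))) ⟨
      Σ< q (λ c → 𝟙 (0 <? c) * (ℓ * 𝟙 (c ^ (m * ℓ) ≈? 1)))
        ∎
      where open ≡-Reasoning

  ℓth-roots-of-unit : ∀ c → ¬ (c ≈ 0) → ℓth-roots c ≡ ℓ * 𝟙 (c ^ (m * ℓ) ≈? 1)
  ℓth-roots-of-unit c c≉0 = begin
    ℓth-roots c
      ≡⟨ ℓth-roots-cong (m%q≈m c) ⟨
    ℓth-roots (c % q)
      ≡⟨ ℓth-roots-reduced (c % q) (m%n<n c q) (≉0⇒>0 (λ e → c≉0 (≈-trans (≈-sym (m%q≈m c)) e))) ⟩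
    ℓ * 𝟙 ((c % q) ^ (m * ℓ) ≈? 1)
      ≡⟨ cong (ℓ *_) (𝟙-cong ((c % q) ^ (m * ℓ) ≈? 1) (c ^ (m * ℓ) ≈? 1) (≈-trans (≈-sym reduce)) (≈-trans reduce)) ⟩
    ℓ * 𝟙 (c ^ (m * ℓ) ≈? 1)
      ∎
    where
    open ≡-Reasoning
    reduce : (c % q) ^ (m * ℓ) ≈ c ^ (m * ℓ)
    reduce = ^-congˡ (m * ℓ) (m%q≈m c)

module CurvePoints (k : ℕ) (q-prime : Prime (suc (suc k))) (ℓ′ : ℕ)
  (q≡1 : suc (suc k) % (suc ℓ′ * suc ℓ′) ≡ 1)
  (u : ℕ) (u-order : HasOrder (suc (suc k)) u (suc ℓ′ * suc ℓ′)) where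

  open import Data.Nat
  open import Data.Nat.Properties
  open import Data.Nat.DivMod
  open import Data.Product using (_×_; _,_; proj₁; proj₂)
  open import Data.Sum using (_⊎_; inj₁; inj₂)
  open import Relation.Nullary using (Dec; yes; no; ¬_)
  open import Relation.Nullary.Decidable using (_×-dec_; _⊎-dec_; ¬?)
  open import Relation.Binary.PropositionalEquality
  open import Data.Nat.Tactic.RingSolver using (solve-∀)
  open NatProperties using (^-distribʳ-*)
  open FiniteSum
  open PrimeField k q-prime
  open PowerResidues k q-prime ℓ′ q≡1 u u-order

  F : ℕ → ℕ
  F x = x * (x ^ ℓ + (q ∸ 1))

  affine-points : ℕ
  affine-points = Σ< q (λ x → ℓth-roots (F x))

  F≈0⇒ : ∀ x → x < q → F x ≈ 0 → x ≡ 0 ⊎ x ^ ℓ ≈ 1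
  F≈0⇒ x x<q F≈0 with *≈0⇒ x (x ^ ℓ + suc k) F≈0
  ... | inj₁ x≈0 = inj₁ (≈⇒≡ x<q z<s x≈0)
  ... | inj₂ e   = inj₂ (+-cancelʳ-≈ (x ^ ℓ) 1 (suc k) (≈-trans e (≈-sym q≈0)))

  F≈0⇐ : ∀ x → x ≡ 0 ⊎ x ^ ℓ ≈ 1 → F x ≈ 0
  F≈0⇐ .0 (inj₁ refl)  = ≈-refl
  F≈0⇐ x  (inj₂ x^ℓ≈1) = ≈-trans (*-congˡ x (≈-trans (+-cong x^ℓ≈1 (≈-refl {suc k})) q≈0)) (≡⇒≈ (*-zeroʳ x))

  count-zeros-of-F : count q (λ x → F x ≈? 0) ≡ suc ℓ
  count-zeros-of-F = begin
    count q (λ x → F x ≈? 0)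
      ≡⟨ count-cong q (λ x → F x ≈? 0) (λ x → (x ≟ 0) ⊎-dec (x ^ ℓ ≈? 1)) F≈0⇒ (λ x _ → F≈0⇐ x) ⟩
    count q (λ x → (x ≟ 0) ⊎-dec (x ^ ℓ ≈? 1))
      ≡⟨⟩
    1 + Σ< (suc k) (λ i → 𝟙 (suc i ^ ℓ ≈? 1))
      ≡⟨ cong (λ n → 1 + (n + Σ< (suc k) (λ i → 𝟙 (suc i ^ ℓ ≈? 1)))) (𝟙-no (0 ^ ℓ ≈? 1) (λ e → 1≉0 (≈-sym e))) ⟨
    1 + count q (λ x → x ^ ℓ ≈? 1)
      ≡⟨ cong suc count-ℓth-roots-of-unity ⟩
    suc ℓ
      ∎
    where open ≡-Reasoning

  nonzero-ℓth-power? : ∀ c → Dec (¬ (c ≈ 0) × c ^ (m * ℓ) ≈ 1)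
  nonzero-ℓth-power? c = ¬? (c ≈? 0) ×-dec (c ^ (m * ℓ) ≈? 1)

  ℓth-roots-split : ∀ c → ℓth-roots c ≡ 𝟙 (c ≈? 0) + ℓ * 𝟙 (nonzero-ℓth-power? c)
  ℓth-roots-split c = split (c ≈? 0)
    where
    open ≡-Reasoning
    split : (d : Dec (c ≈ 0)) → ℓth-roots c ≡ 𝟙 d + ℓ * 𝟙 (nonzero-ℓth-power? c)
    split (yes c≈0) = begin
      ℓth-roots c                         ≡⟨ ℓth-roots-of-0 c c≈0 ⟩
      1                                   ≡⟨ cong suc (*-zeroʳ ℓ) ⟨
      1 + ℓ * 0                           ≡⟨ cong (λ n → 1 + ℓ * n) (𝟙-no (nonzero-ℓth-power? c) (λ p → proj₁ p c≈0)) ⟨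
      1 + ℓ * 𝟙 (nonzero-ℓth-power? c)   ∎
    split (no c≉0) = trans (ℓth-roots-of-unit c c≉0)
      (cong (ℓ *_) (𝟙-cong (c ^ (m * ℓ) ≈? 1) (nonzero-ℓth-power? c) (λ e → c≉0 , e) proj₂))

  affine-points≡ : affine-points ≡ suc ℓ + ℓ * count q (λ x → nonzero-ℓth-power? (F x))
  affine-points≡ = begin
    Σ< q (λ x → ℓth-roots (F x))
      ≡⟨ Σ-cong q (λ x _ → ℓth-roots-split (F x)) ⟩
    Σ< q (λ x → 𝟙 (F x ≈? 0) + ℓ * 𝟙 (nonzero-ℓth-power? (F x)))
      ≡⟨ Σ-distrib-+ q (λ x → 𝟙 (F x ≈? 0)) (λ x → ℓ * 𝟙 (nonzero-ℓth-power? (F x))) ⟩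
    count q (λ x → F x ≈? 0) + Σ< q (λ x → ℓ * 𝟙 (nonzero-ℓth-power? (F x)))
      ≡⟨ cong₂ _+_ count-zeros-of-F (Σ-*ˡ q ℓ (λ x → 𝟙 (nonzero-ℓth-power? (F x)))) ⟩
    suc ℓ + ℓ * count q (λ x → nonzero-ℓth-power? (F x))
      ∎
    where open ≡-Reasoning

  G : ℕ → ℕ
  G v = v ^ (ℓ * ℓ′) * one-minus v

  G-Lth-power? : ∀ v → Dec (2 ≤ v × G v ^ m ≈ 1)
  G-Lth-power? v = (2 ≤? v) ×-dec (G v ^ m ≈? 1)

  G-ℓth-power? : ∀ v → Dec (2 ≤ v × G v ^ (m * ℓ) ≈ 1)
  G-ℓth-power? v = (2 ≤? v) ×-dec (G v ^ (m * ℓ) ≈? 1)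

  substitute : ℕ → ℕ
  substitute x = one-minus (inv x ^ ℓ)

  x^ℓ*inv≈1 : ∀ x → ¬ (x ≈ 0) → x ^ ℓ * inv x ^ ℓ ≈ 1
  x^ℓ*inv≈1 x x≉0 = ≈-trans (≡⇒≈ (sym (^-distribʳ-* x (inv x) ℓ)))
                             (≈-trans (^-congˡ ℓ (*-inverseʳ x x≉0)) (≡⇒≈ (^-zeroˡ ℓ)))

  F≈x*x^ℓ*v : ∀ x v → x ^ ℓ * one-minus v ≈ 1 → F x ≈ x * (x ^ ℓ * v)
  F≈x*x^ℓ*v x v zw≈1 = *-congˡ x (begin
    z + suc k                 ≈⟨ +-cong zv+1≈z (≈-refl {suc k}) ⟨
    z * v + 1 + suc k         ≡⟨ +-assoc (z * v) 1 (suc k) ⟩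
    z * v + q                 ≈⟨ +-cong (≈-refl {z * v}) q≈0 ⟩
    z * v + 0                 ≡⟨ +-identityʳ _ ⟩
    z * v                     ∎)
    where
    open ≈-Reasoning
    z w : ℕ
    z = x ^ ℓ
    w = one-minus v
    zv+1≈z : z * v + 1 ≈ z
    zv+1≈z = begin
      z * v + 1       ≈⟨ +-cong (≈-refl {z * v}) zw≈1 ⟨
      z * v + z * w   ≡⟨ *-distribˡ-+ z v w ⟨
      z * (v + w)     ≈⟨ *-congˡ z (≈-trans (≡⇒≈ (+-comm v w)) (one-minus-+ v)) ⟩
      z * 1           ≡⟨ *-identityʳ z ⟩
      z               ∎

  -- With a = x^(mℓ), b = v^(mℓ), c = v^(ℓ(ℓ-1)m), d = (1-v)^m one has F(x)^(mℓ) ≈ ab and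
  -- G(v)^m = cd, while ad ≈ 1 (from x^ℓ (1-v) ≈ 1) and bc = v^(q-1) ≈ 1.
  F-test⇔G-test : ∀ x v → ¬ (x ≈ 0) → ¬ (v ≈ 0) → x ^ ℓ * one-minus v ≈ 1 →
                  (F x ^ (m * ℓ) ≈ 1 → G v ^ m ≈ 1) × (G v ^ m ≈ 1 → F x ^ (m * ℓ) ≈ 1)
  F-test⇔G-test x v x≉0 v≉0 zw≈1 =
    (λ e → ≈-trans (≡⇒≈ G^m≡cd) (inverse-pairs a b c d ad≈1 bc≈1 (≈-trans (≈-sym F^mℓ≈ab) e))) ,
    (λ e → ≈-trans F^mℓ≈ab (inverse-pairs c d a b (≈-trans (≡⇒≈ (*-comm c b)) bc≈1)
                              (≈-trans (≡⇒≈ (*-comm d a)) ad≈1) (≈-trans (≡⇒≈ (sym G^m≡cd)) e)))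
    where
    z w : ℕ
    z = x ^ ℓ
    w = one-minus v
    a b c d : ℕ
    a = x ^ (m * ℓ)
    b = v ^ (m * ℓ)
    c = v ^ (ℓ * ℓ′ * m)
    d = w ^ m
    G^m≡cd : G v ^ m ≡ c * d
    G^m≡cd = trans (^-distribʳ-* (v ^ (ℓ * ℓ′)) w m) (cong (_* d) (^-*-assoc v (ℓ * ℓ′) m))
    F^mℓ≈ab : F x ^ (m * ℓ) ≈ a * b
    F^mℓ≈ab = begin
      F x ^ (m * ℓ)               ≈⟨ ^-congˡ (m * ℓ) (F≈x*x^ℓ*v x v zw≈1) ⟩
      (x * (z * v)) ^ (m * ℓ)     ≡⟨ ^-distribʳ-* x (z * v) (m * ℓ) ⟩
      a * (z * v) ^ (m * ℓ)       ≡⟨ cong (a *_) (^-distribʳ-* z v (m * ℓ)) ⟩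
      a * (z ^ (m * ℓ) * b)       ≈⟨ *-congˡ a (*-congʳ b ([y^ℓ]^mℓ≈1 x x≉0)) ⟩
      a * (1 * b)                 ≡⟨ cong (a *_) (*-identityˡ b) ⟩
      a * b                       ∎
      where open ≈-Reasoning
    ad≈1 : a * d ≈ 1
    ad≈1 = begin
      x ^ (m * ℓ) * w ^ m     ≡⟨ cong (λ e → x ^ e * w ^ m) (*-comm m ℓ) ⟩
      x ^ (ℓ * m) * w ^ m     ≡⟨ cong (_* w ^ m) (^-*-assoc x ℓ m) ⟨
      z ^ m * w ^ m           ≡⟨ ^-distribʳ-* z w m ⟨
      (z * w) ^ m             ≈⟨ ^-congˡ m zw≈1 ⟩
      1 ^ m                   ≡⟨ ^-zeroˡ m ⟩
      1                       ∎
      where open ≈-Reasoning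
    regroup : ∀ m l′ → m * (suc l′ * suc l′) ≡ m * suc l′ + suc l′ * l′ * m
    regroup = solve-∀
    bc≈1 : b * c ≈ 1
    bc≈1 = begin
      v ^ (m * ℓ) * v ^ (ℓ * ℓ′ * m)  ≡⟨ ^-distribˡ-+-* v (m * ℓ) (ℓ * ℓ′ * m) ⟨
      v ^ (m * ℓ + ℓ * ℓ′ * m)        ≡⟨ cong (v ^_) (regroup m ℓ′) ⟨
      v ^ (m * L)                     ≈⟨ fermat-mL v v≉0 ⟩
      1                               ∎
      where open ≈-Reasoning

  substitution-fibre⇒ : ∀ x v → (¬ (F x ≈ 0) × F x ^ (m * ℓ) ≈ 1) × substitute x ≡ v →
                        (2 ≤ v × G v ^ m ≈ 1) × x ^ ℓ * one-minus v ≈ 1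
  substitution-fibre⇒ x v ((F≉0 , F-test) , t′≡v) =
    (≉0,1⇒2≤ v≉0 v≉1 , proj₁ (F-test⇔G-test x v x≉0 v≉0 zw≈1) F-test) , zw≈1
    where
    z t w : ℕ
    z = x ^ ℓ
    t = inv x ^ ℓ
    w = one-minus v
    x≉0 : ¬ (x ≈ 0)
    x≉0 x≈0 = F≉0 (*-congʳ (x ^ ℓ + suc k) x≈0)
    t+v≈1 : t + v ≈ 1
    t+v≈1 = ≈-trans (≡⇒≈ (trans (cong (t +_) (sym t′≡v)) (+-comm t (one-minus t)))) (one-minus-+ t)
    w≈t : w ≈ t
    w≈t = +-cancelʳ-≈ w t v (≈-trans (one-minus-+ v) (≈-sym t+v≈1))
    zw≈1 : z * w ≈ 1
    zw≈1 = ≈-trans (*-congˡ z w≈t) (x^ℓ*inv≈1 x x≉0)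
    v≉0 : ¬ (v ≈ 0)
    v≉0 v≈0 = F≉0 (F≈0⇐ x (inj₂ (≈-trans (≡⇒≈ (sym (*-identityʳ z))) (≈-trans (*-congˡ z (≈-sym w≈1)) zw≈1))))
      where
      w≈1 : w ≈ 1
      w≈1 = ≈-trans (≡⇒≈ (sym (+-identityʳ w))) (≈-trans (+-cong (≈-refl {w}) (≈-sym v≈0)) (one-minus-+ v))
    v≉1 : ¬ (v ≈ 1)
    v≉1 v≈1 = 1≉0 (≈-trans (≈-sym zw≈1) (≈-trans (*-congˡ z w≈0) (≡⇒≈ (*-zeroʳ z))))
      where
      w≈0 : w ≈ 0
      w≈0 = +-cancelʳ-≈ w 0 v (≈-trans (one-minus-+ v) (≈-sym v≈1))

  substitution-fibre⇐ : ∀ x v → v < q → (2 ≤ v × G v ^ m ≈ 1) × x ^ ℓ * one-minus v ≈ 1 →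
                        (¬ (F x ≈ 0) × F x ^ (m * ℓ) ≈ 1) × substitute x ≡ v
  substitution-fibre⇐ x v v<q ((2≤v , G-test) , zw≈1) = (F≉0 , proj₂ (F-test⇔G-test x v x≉0 v≉0 zw≈1) G-test) , substitute≡v
    where
    z w : ℕ
    z = x ^ ℓ
    w = one-minus v
    x≉0 : ¬ (x ≈ 0)
    x≉0 x≈0 = 1≉0 (≈-trans (≈-sym zw≈1) (*-congʳ w (^-congˡ ℓ x≈0)))
    v≉0 : ¬ (v ≈ 0)
    v≉0 = <q⇒≉0 (≤-trans (s≤s z≤n) 2≤v) v<q
    z≉0 : ¬ (z ≈ 0)
    z≉0 = ^-≉0 x ℓ x≉0
    F≉0 : ¬ (F x ≈ 0)
    F≉0 F≈0 = *-≉0 x (z * v) x≉0 (*-≉0 z v z≉0 v≉0) (≈-trans (≈-sym (F≈x*x^ℓ*v x v zw≈1)) F≈0)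
    t≈w : inv x ^ ℓ ≈ w
    t≈w = *-cancelˡ-≈ z z≉0 (≈-trans (x^ℓ*inv≈1 x x≉0) (≈-sym zw≈1))
    substitute≡v : substitute x ≡ v
    substitute≡v = one-minus-unique (inv x ^ ℓ) v v<q (≈-trans (+-cong t≈w (≈-refl {v})) (one-minus-+ v))

  G^mℓ≈[1-v]^mℓ : ∀ v → ¬ (v ≈ 0) → G v ^ (m * ℓ) ≈ one-minus v ^ (m * ℓ)
  G^mℓ≈[1-v]^mℓ v v≉0 = begin
    G v ^ (m * ℓ)                               ≡⟨ ^-distribʳ-* (v ^ (ℓ * ℓ′)) w (m * ℓ) ⟩
    (v ^ (ℓ * ℓ′)) ^ (m * ℓ) * w ^ (m * ℓ)      ≡⟨ cong (_* w ^ (m * ℓ)) v-power ⟩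
    (v ^ (m * L)) ^ ℓ′ * w ^ (m * ℓ)            ≈⟨ *-congʳ (w ^ (m * ℓ)) (^-congˡ ℓ′ (fermat-mL v v≉0)) ⟩
    1 ^ ℓ′ * w ^ (m * ℓ)                        ≡⟨ cong (_* w ^ (m * ℓ)) (^-zeroˡ ℓ′) ⟩
    1 * w ^ (m * ℓ)                             ≡⟨ *-identityˡ _ ⟩
    w ^ (m * ℓ)                                 ∎
    where
    open ≈-Reasoning
    w : ℕ
    w = one-minus v
    regroup : ∀ m l′ → suc l′ * l′ * (m * suc l′) ≡ m * (suc l′ * suc l′) * l′
    regroup = solve-∀
    v-power : (v ^ (ℓ * ℓ′)) ^ (m * ℓ) ≡ (v ^ (m * L)) ^ ℓ′
    v-power = trans (^-*-assoc v (ℓ * ℓ′) (m * ℓ)) (trans (cong (v ^_) (regroup m ℓ′)) (sym (^-*-assoc v (m * L) ℓ′)))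

  solutions-of-x^ℓ[1-v]≈1 : ∀ v → v < q → 2 ≤ v × G v ^ m ≈ 1 → count q (λ x → x ^ ℓ * one-minus v ≈? 1) ≡ ℓ
  solutions-of-x^ℓ[1-v]≈1 v v<q (2≤v , G-test) = begin
    count q (λ x → x ^ ℓ * w ≈? 1)
      ≡⟨ count-cong q (λ x → x ^ ℓ * w ≈? 1) (λ x → x ^ ℓ ≈? inv w) (λ x _ → ⇒ {x}) (λ x _ → ⇐ {x}) ⟩
    ℓth-roots (inv w)
      ≡⟨ ℓth-roots-of-unit (inv w) (inv-≉0 w w≉0) ⟩
    ℓ * 𝟙 (inv w ^ (m * ℓ) ≈? 1)
      ≡⟨ cong (ℓ *_) (𝟙-yes (inv w ^ (m * ℓ) ≈? 1) inv-w-test) ⟩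
    ℓ * 1
      ≡⟨ *-identityʳ ℓ ⟩
    ℓ
      ∎
    where
    open ≡-Reasoning
    w : ℕ
    w = one-minus v
    v≉0 : ¬ (v ≈ 0)
    v≉0 = <q⇒≉0 (≤-trans (s≤s z≤n) 2≤v) v<q
    w≉0 : ¬ (w ≈ 0)
    w≉0 w≈0 = ^≈1⇒≉0 (G v) m G-test (≈-trans (*-congˡ (v ^ (ℓ * ℓ′)) w≈0) (≡⇒≈ (*-zeroʳ (v ^ (ℓ * ℓ′)))))
    w-test : w ^ (m * ℓ) ≈ 1
    w-test = ≈-trans (≈-sym (G^mℓ≈[1-v]^mℓ v v≉0))
               (≈-trans (≡⇒≈ (sym (^-*-assoc (G v) m ℓ))) (≈-trans (^-congˡ ℓ G-test) (≡⇒≈ (^-zeroˡ ℓ))))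
    inv-w-test : inv w ^ (m * ℓ) ≈ 1
    inv-w-test = ≈-trans (≡⇒≈ (trans (^-*-assoc w k (m * ℓ)) (trans (cong (w ^_) (*-comm k (m * ℓ))) (sym (^-*-assoc w (m * ℓ) k)))))
                         (≈-trans (^-congˡ k w-test) (≡⇒≈ (^-zeroˡ k)))
    ⇒ : ∀ {x} → x ^ ℓ * w ≈ 1 → x ^ ℓ ≈ inv w
    ⇒ {x} e = *-cancelʳ-≈ w w≉0 (≈-trans e (≈-sym (*-inverseˡ w w≉0)))
    ⇐ : ∀ {x} → x ^ ℓ ≈ inv w → x ^ ℓ * w ≈ 1
    ⇐ {x} e = ≈-trans (*-congʳ w e) (*-inverseˡ w w≉0)

  -- Count the x with F(x) a nonzero ℓ-th power by the fibres of x ↦ 1 - x^(-ℓ).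
  count-F-ℓth-powers : count q (λ x → nonzero-ℓth-power? (F x)) ≡ ℓ * count q G-Lth-power?
  count-F-ℓth-powers = begin
    count q D?
      ≡⟨ Σ-cong q (λ x _ → sym (*-identityʳ (𝟙 (D? x)))) ⟩
    Σ< q (λ x → 𝟙 (D? x) * 1)
      ≡⟨ Σ-fibres q q (λ x → 𝟙 (D? x)) (λ _ → 1) substitute (λ x _ → inj₂ (one-minus<q (inv x ^ ℓ))) ⟩
    Σ< q (λ v → 1 * Σ< q (λ x → 𝟙 (D? x) * 𝟙 (substitute x ≟ v)))
      ≡⟨ Σ-cong q (λ v v<q → trans (+-identityʳ _) (fibre v v<q)) ⟩
    Σ< q (λ v → ℓ * 𝟙 (G-Lth-power? v))
      ≡⟨ Σ-*ˡ q ℓ (λ v → 𝟙 (G-Lth-power? v)) ⟩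
    ℓ * count q G-Lth-power?
      ∎
    where
    open ≡-Reasoning
    D? : ∀ x → Dec (¬ (F x ≈ 0) × F x ^ (m * ℓ) ≈ 1)
    D? x = nonzero-ℓth-power? (F x)
    fibre : ∀ v → v < q → Σ< q (λ x → 𝟙 (D? x) * 𝟙 (substitute x ≟ v)) ≡ ℓ * 𝟙 (G-Lth-power? v)
    fibre v v<q = begin
      Σ< q (λ x → 𝟙 (D? x) * 𝟙 (substitute x ≟ v))               ≡⟨ Σ-cong q (λ x _ → term x) ⟩
      Σ< q (λ x → 𝟙 (G-Lth-power? v) * 𝟙 (x ^ ℓ * w ≈? 1))        ≡⟨ Σ-*ˡ q (𝟙 (G-Lth-power? v)) (λ x → 𝟙 (x ^ ℓ * w ≈? 1)) ⟩
      𝟙 (G-Lth-power? v) * count q (λ x → x ^ ℓ * w ≈? 1)         ≡⟨ 𝟙*-cong (G-Lth-power? v) (solutions-of-x^ℓ[1-v]≈1 v v<q) ⟩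
      𝟙 (G-Lth-power? v) * ℓ                                       ≡⟨ *-comm (𝟙 (G-Lth-power? v)) ℓ ⟩
      ℓ * 𝟙 (G-Lth-power? v)                                       ∎
      where
      w : ℕ
      w = one-minus v
      term : ∀ x → 𝟙 (D? x) * 𝟙 (substitute x ≟ v) ≡ 𝟙 (G-Lth-power? v) * 𝟙 (x ^ ℓ * w ≈? 1)
      term x = trans (𝟙-× (D? x) (substitute x ≟ v))
        (trans (𝟙-cong (D? x ×-dec (substitute x ≟ v)) (G-Lth-power? v ×-dec (x ^ ℓ * w ≈? 1))
                       (substitution-fibre⇒ x v) (substitution-fibre⇐ x v v<q))
               (sym (𝟙-× (G-Lth-power? v) (x ^ ℓ * w ≈? 1))))

  one-minus-≥2 : ∀ v → v < q → 2 ≤ v → 2 ≤ one-minus v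
  one-minus-≥2 v v<q 2≤v = ≉0,1⇒2≤ w≉0 w≉1
    where
    w : ℕ
    w = one-minus v
    w≉0 : ¬ (w ≈ 0)
    w≉0 w≈0 = <-irrefl (sym (≈⇒≡ v<q (s<s z<s) v≈1)) 2≤v
      where
      v≈1 : v ≈ 1
      v≈1 = ≈-trans (+-cong (≈-sym w≈0) (≈-refl {v})) (one-minus-+ v)
    w≉1 : ¬ (w ≈ 1)
    w≉1 w≈1 = <-irrefl (sym (≈⇒≡ v<q z<s v≈0)) (≤-trans (s≤s z≤n) 2≤v)
      where
      v≈0 : v ≈ 0
      v≈0 = +-cancelʳ-≈ v 0 1 (≈-trans (≡⇒≈ (+-comm v 1)) (≈-trans (+-cong (≈-sym w≈1) (≈-refl {v})) (one-minus-+ v)))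

  -- v ↦ 1 - v permutes the residues ≥ 2, and 1 is the remaining nonzero root of X^(mℓ) - 1.
  count-G-ℓth-powers : count q G-ℓth-power? + 1 ≡ m * ℓ
  count-G-ℓth-powers = begin
    count q G-ℓth-power? + 1
      ≡⟨ cong (_+ 1) (count-cong q G-ℓth-power? test-1-v? (λ v v<q (2≤v , e) → 2≤v , ≈-trans (≈-sym (G≈ v v<q 2≤v)) e)
                                                            (λ v v<q (2≤v , e) → 2≤v , ≈-trans (G≈ v v<q 2≤v) e)) ⟩
    count q test-1-v? + 1
      ≡⟨ cong (_+ 1) (count-bijection q q test-1-v? test? one-minus one-minus
           (λ v v<q (2≤v , e) → one-minus<q v , one-minus-≥2 v v<q 2≤v , e)
           (λ w w<q (2≤w , e) → one-minus<q w , one-minus-≥2 w w<q 2≤w ,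
                                 subst (λ z → z ^ (m * ℓ) ≈ 1) (sym (one-minus-involutive w w<q)) e)
           (λ v v<q _ → one-minus-involutive v v<q) (λ w w<q _ → one-minus-involutive w w<q)) ⟩
    count q test? + 1
      ≡⟨ +-comm (count q test?) 1 ⟩
    1 + count q test?
      ≡⟨ cong suc (Σ-cong k (λ i _ → 𝟙-cong (test? (2 + i)) (nonzero-test? (2 + i))
                                            (λ (_ , e) → z<s , e) (λ (_ , e) → s≤s (s≤s z≤n) , e))) ⟩
    1 + Σ< k (λ i → 𝟙 (nonzero-test? (2 + i)))
      ≡⟨ cong (_+ Σ< k (λ i → 𝟙 (nonzero-test? (2 + i)))) (𝟙-yes (nonzero-test? 1) (z<s , ≡⇒≈ (^-zeroˡ (m * ℓ)))) ⟨
    count q nonzero-test?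
      ≡⟨ Σ-cong q (λ c _ → sym (𝟙-× (0 <? c) (c ^ (m * ℓ) ≈? 1))) ⟩
    Σ< q (λ c → 𝟙 (0 <? c) * 𝟙 (c ^ (m * ℓ) ≈? 1))
      ≡⟨ count-c^mℓ≈1 ⟩
    m * ℓ
      ∎
    where
    open ≡-Reasoning
    test? : ∀ w → Dec (2 ≤ w × w ^ (m * ℓ) ≈ 1)
    test? w = (2 ≤? w) ×-dec (w ^ (m * ℓ) ≈? 1)
    test-1-v? : ∀ v → Dec (2 ≤ v × one-minus v ^ (m * ℓ) ≈ 1)
    test-1-v? v = (2 ≤? v) ×-dec (one-minus v ^ (m * ℓ) ≈? 1)
    nonzero-test? : ∀ c → Dec (0 < c × c ^ (m * ℓ) ≈ 1)
    nonzero-test? c = (0 <? c) ×-dec (c ^ (m * ℓ) ≈? 1)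
    G≈ : ∀ v → v < q → 2 ≤ v → G v ^ (m * ℓ) ≈ one-minus v ^ (m * ℓ)
    G≈ v v<q 2≤v = G^mℓ≈[1-v]^mℓ v (<q⇒≉0 (≤-trans (s≤s z≤n) 2≤v) v<q)

module ResidueClasses (ℓ′ : ℕ) where

  open import Data.Nat
  open import Data.Nat.Properties
  open import Data.Nat.DivMod
  open import Data.Product using (_×_; _,_)
  open import Relation.Nullary using (Dec; ¬_)
  open import Relation.Nullary.Decidable using (_×-dec_; ¬?)
  open import Relation.Binary.PropositionalEquality

  ℓ : ℕ
  ℓ = suc ℓ′

  L : ℕ
  L = ℓ * ℓ

  unit? : ∀ s → Dec (s % ℓ ≢ 0)
  unit? s = ¬? (s % ℓ ≟ 0)

  proper-multiple? : ∀ t → Dec (t % ℓ ≡ 0 × t ≢ 0)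
  proper-multiple? t = (t % ℓ ≟ 0) ×-dec ¬? (t ≟ 0)

  multiple<L? : ∀ i → Dec (i < L × i % ℓ ≡ 0)
  multiple<L? i = (i <? L) ×-dec (i % ℓ ≟ 0)

  proper-multiple<L? : ∀ i → Dec (i < L × (i % ℓ ≡ 0 × i ≢ 0))
  proper-multiple<L? i = (i <? L) ×-dec proper-multiple? i

  unit<L? : ∀ i → Dec (i < L × i % ℓ ≢ 0)
  unit<L? i = (i <? L) ×-dec unit? i

  [aℓ+b]%ℓ≡b%ℓ : ∀ a b → (a * ℓ + b) % ℓ ≡ b % ℓ
  [aℓ+b]%ℓ≡b%ℓ a b = trans (cong (_% ℓ) (+-comm (a * ℓ) b)) ([m+kn]%n≡m%n b a ℓ)

  divMod-unique : ∀ a b → b < ℓ → (a * ℓ + b) % ℓ ≡ b × (a * ℓ + b) / ℓ ≡ a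
  divMod-unique a b b<ℓ = mod≡b , *-cancelʳ-≡ ((a * ℓ + b) / ℓ) a ℓ (+-cancelˡ-≡ b _ _ (begin
    b + (a * ℓ + b) / ℓ * ℓ                   ≡⟨ cong (_+ (a * ℓ + b) / ℓ * ℓ) mod≡b ⟨
    (a * ℓ + b) % ℓ + (a * ℓ + b) / ℓ * ℓ     ≡⟨ m≡m%n+[m/n]*n (a * ℓ + b) ℓ ⟨
    a * ℓ + b                                 ≡⟨ +-comm (a * ℓ) b ⟩
    b + a * ℓ                                 ∎))
    where
    open ≡-Reasoning
    mod≡b : (a * ℓ + b) % ℓ ≡ b
    mod≡b = trans ([aℓ+b]%ℓ≡b%ℓ a b) (m<n⇒m%n≡m b<ℓ)

module UnitMultiples (ℓ′ : ℕ) (ℓ-prime : Prime (suc ℓ′)) where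

  open import Data.Nat
  open import Data.Nat.Properties
  open import Data.Nat.DivMod
  open import Data.Nat.Divisibility
  open import Data.Nat.Coprimality using (Coprime; coprime?; coprime-divisor)
  open import Data.Nat.Primality using (euclidsLemma; prime⇒irreducible; ¬prime[1])
  open import Data.Product using (_×_; _,_; proj₁; proj₂)
  open import Data.Sum using (inj₁; inj₂)
  open import Relation.Nullary using (Dec; yes; no; ¬_; contradiction)
  open import Relation.Nullary.Decidable using (_×-dec_)
  open import Relation.Binary.PropositionalEquality
  open import Data.Nat.Tactic.RingSolver using (solve-∀)
  open FiniteSum
  open NatProperties using (*-cancelʳ-%)
  open ResidueClasses ℓ′

  private
    %ℓ≡0⇒∣ : ∀ {s} → s % ℓ ≡ 0 → ℓ ∣ s
    %ℓ≡0⇒∣ {s} = m%n≡0⇒n∣m s ℓ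

    ∣⇒%ℓ≡0 : ∀ {s} → ℓ ∣ s → s % ℓ ≡ 0
    ∣⇒%ℓ≡0 {s} = n∣m⇒m%n≡0 s ℓ

  unit-* : ∀ s t → s % ℓ ≢ 0 → t % ℓ ≢ 0 → (s * t) % ℓ ≢ 0
  unit-* s t s-unit t-unit st≡0 with euclidsLemma s t ℓ-prime (%ℓ≡0⇒∣ st≡0)
  ... | inj₁ ℓ∣s = s-unit (∣⇒%ℓ≡0 ℓ∣s)
  ... | inj₂ ℓ∣t = t-unit (∣⇒%ℓ≡0 ℓ∣t)

  coprime⇒unit : ∀ s → Coprime s L → s % ℓ ≢ 0
  coprime⇒unit s coprime s%ℓ≡0 = ¬prime[1] (subst Prime (coprime (%ℓ≡0⇒∣ s%ℓ≡0 , m∣m*n ℓ)) ℓ-prime)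

  unit⇒coprime : ∀ s → s % ℓ ≢ 0 → Coprime s L
  unit⇒coprime s s-unit {i} (i∣s , i∣L) = coprime-to-ℓ (i∣s , coprime-divisor coprime-iℓ i∣L)
    where
    coprime-to-ℓ : Coprime s ℓ
    coprime-to-ℓ {d} (d∣s , d∣ℓ) with prime⇒irreducible ℓ-prime d∣ℓ
    ... | inj₁ d≡1 = d≡1
    ... | inj₂ d≡ℓ = contradiction (∣⇒%ℓ≡0 (subst (_∣ s) d≡ℓ d∣s)) s-unit
    coprime-iℓ : Coprime i ℓ
    coprime-iℓ (d∣i , d∣ℓ) = coprime-to-ℓ (∣-trans d∣i i∣s , d∣ℓ)

  𝟙-coprime≡𝟙-unit : ∀ s → 𝟙 (coprime? s L) ≡ 𝟙 (unit? s)
  𝟙-coprime≡𝟙-unit s = 𝟙-cong (coprime? s L) (unit? s) (coprime⇒unit s) (unit⇒coprime s)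

  unit-cancel-ℓ : ∀ d t → t % ℓ ≢ 0 → ℓ ∣ d * t → ℓ ∣ d
  unit-cancel-ℓ d t t-unit ℓ∣dt with euclidsLemma d t ℓ-prime ℓ∣dt
  ... | inj₁ ℓ∣d = ℓ∣d
  ... | inj₂ ℓ∣t = contradiction (∣⇒%ℓ≡0 ℓ∣t) t-unit

  unit-cancel-L : ∀ d t → t % ℓ ≢ 0 → L ∣ d * t → L ∣ d
  unit-cancel-L d t t-unit L∣dt with unit-cancel-ℓ d t t-unit (∣-trans (m∣m*n ℓ) L∣dt)
  ... | divides d′ refl = *-monoˡ-∣ ℓ (unit-cancel-ℓ d′ t t-unit (*-cancelʳ-∣ ℓ (subst (L ∣_) (regroup d′ t ℓ) L∣dt)))
    where
    regroup : ∀ d t l → d * l * t ≡ d * t * l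
    regroup = solve-∀

  -- Multiplication by a unit t permutes the units modulo N, for N = ℓ and N = ℓ².
  module _ (N : ℕ) .{{_ : NonZero N}} (ℓ∣N : ℓ ∣ N) (cancel : ∀ d t → t % ℓ ≢ 0 → N ∣ d * t → N ∣ d) where

    unit-orbit : ∀ t → t % ℓ ≢ 0 → ∀ i →
                 Σ< N (λ s → 𝟙 (unit? s) * 𝟙 ((s * t) % N ≟ i)) ≡ 𝟙 ((i <? N) ×-dec unit? i)
    unit-orbit t t-unit i = orbit ((i <? N) ×-dec unit? i)
      where
      unit-image : ∀ s → s % ℓ ≢ 0 → (s * t) % N % ℓ ≢ 0
      unit-image s s-unit e = unit-* s t s-unit t-unit (trans (sym (m∣n⇒o%n%m≡o%m ℓ N (s * t) ℓ∣N)) e)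
      injective : ∀ s s′ → s < N → s′ < N → s % ℓ ≢ 0 → s′ % ℓ ≢ 0 → (s * t) % N ≡ (s′ * t) % N → s ≡ s′
      injective s s′ s<N s′<N _ _ = *-cancelʳ-% N t (λ d → cancel d t t-unit) s<N s′<N
      orbit : (d : Dec (i < N × i % ℓ ≢ 0)) → Σ< N (λ s → 𝟙 (unit? s) * 𝟙 ((s * t) % N ≟ i)) ≡ 𝟙 d
      orbit (yes (i<N , i-unit)) = fibre-of-injective-endomap N unit? (λ s → (s * t) % N)
        (λ s _ s-unit → m%n<n (s * t) N , unit-image s s-unit) injective i i<N i-unit
      orbit (no ¬i-unit<N) = Σ-zero N (λ s _ → vanishes s (unit? s) ((s * t) % N ≟ i))
        where
        vanishes : ∀ s → (d : Dec (s % ℓ ≢ 0)) (e : Dec ((s * t) % N ≡ i)) → 𝟙 d * 𝟙 e ≡ 0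
        vanishes s (yes s-unit) (yes refl) = contradiction (m%n<n (s * t) N , unit-image s s-unit) ¬i-unit<N
        vanishes s (yes _)      (no _)     = refl
        vanishes s (no _)       _          = refl

  unit-multiples : ℕ → ℕ → ℕ
  unit-multiples t i = Σ< L (λ s → 𝟙 (unit? s) * 𝟙 ((s * t) % L ≟ i))

  𝟙-unit-block : ∀ a b → 𝟙 (unit? (a * ℓ + b)) ≡ 𝟙 (unit? b)
  𝟙-unit-block a b = 𝟙-cong (unit? (a * ℓ + b)) (unit? b)
    (λ unit e → unit (trans ([aℓ+b]%ℓ≡b%ℓ a b) e)) (λ unit e → unit (trans (sym ([aℓ+b]%ℓ≡b%ℓ a b)) e))

  count-units : count L unit? ≡ ℓ * ℓ′
  count-units = begin
    count L unit?                                  ≡⟨ Σ-blocks ℓ ℓ (λ s → 𝟙 (unit? s)) ⟩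
    Σ< ℓ (λ a → Σ< ℓ (λ b → 𝟙 (unit? (a * ℓ + b)))) ≡⟨ Σ-cong ℓ (λ a _ → trans (Σ-cong ℓ (λ b _ → 𝟙-unit-block a b)) units<ℓ) ⟩
    Σ< ℓ (λ a → ℓ′)                                 ≡⟨ Σ-const ℓ ℓ′ ⟩
    ℓ * ℓ′                                          ∎
    where
    open ≡-Reasoning
    units<ℓ : count ℓ unit? ≡ ℓ′
    units<ℓ = trans (Σ-cong ℓ′ (λ i i<ℓ′ → 𝟙-yes (unit? (suc i)) (λ e → 0≢1+n (trans (sym e) (m<n⇒m%n≡m (s<s i<ℓ′))))))
                    (trans (Σ-const ℓ′ 1) (*-identityʳ ℓ′))

  unit-multiples-of-0 : ∀ i → unit-multiples 0 i ≡ ℓ * ℓ′ * 𝟙 (i ≟ 0)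
  unit-multiples-of-0 i = begin
    unit-multiples 0 i
      ≡⟨ Σ-cong L (λ s _ → 𝟙*-cong (unit? s) (λ _ → 𝟙-cong ((s * 0) % L ≟ i) (i ≟ 0) (⇒ {s}) (⇐ {s}))) ⟩
    Σ< L (λ s → 𝟙 (unit? s) * 𝟙 (i ≟ 0))
      ≡⟨ Σ-cong L (λ s _ → *-comm (𝟙 (unit? s)) (𝟙 (i ≟ 0))) ⟩
    Σ< L (λ s → 𝟙 (i ≟ 0) * 𝟙 (unit? s))
      ≡⟨ Σ-*ˡ L (𝟙 (i ≟ 0)) (λ s → 𝟙 (unit? s)) ⟩
    𝟙 (i ≟ 0) * count L unit?
      ≡⟨ cong (𝟙 (i ≟ 0) *_) count-units ⟩
    𝟙 (i ≟ 0) * (ℓ * ℓ′)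
      ≡⟨ *-comm (𝟙 (i ≟ 0)) (ℓ * ℓ′) ⟩
    ℓ * ℓ′ * 𝟙 (i ≟ 0)
      ∎
    where
    open ≡-Reasoning
    ⇒ : ∀ {s} → (s * 0) % L ≡ i → i ≡ 0
    ⇒ {s} e = trans (sym e) (cong (_% L) (*-zeroʳ s))
    ⇐ : ∀ {s} → i ≡ 0 → (s * 0) % L ≡ i
    ⇐ {s} e = trans (cong (_% L) (*-zeroʳ s)) (sym e)

  unit-multiples-of-unit : ∀ t → t % ℓ ≢ 0 → ∀ i → unit-multiples t i ≡ 𝟙 (unit<L? i)
  unit-multiples-of-unit = unit-orbit L (m∣m*n ℓ) unit-cancel-L

  scaled-unit-orbit : ∀ t′ → t′ % ℓ ≢ 0 → ∀ i →
                      Σ< ℓ (λ b → 𝟙 (unit? b) * 𝟙 ((b * t′) % ℓ * ℓ ≟ i)) ≡ 𝟙 (proper-multiple<L? i)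
  scaled-unit-orbit t′ t′-unit i = begin
    Σ< ℓ (λ b → 𝟙 (unit? b) * 𝟙 ((b * t′) % ℓ * ℓ ≟ i))
      ≡⟨ Σ-cong ℓ (λ b _ → trans (cong (𝟙 (unit? b) *_) (split-condition ((b * t′) % ℓ)))
                                   (regroup (𝟙 (unit? b)) (𝟙 (i % ℓ ≟ 0)) (𝟙 ((b * t′) % ℓ ≟ i / ℓ)))) ⟩
    Σ< ℓ (λ b → 𝟙 (i % ℓ ≟ 0) * (𝟙 (unit? b) * 𝟙 ((b * t′) % ℓ ≟ i / ℓ)))
      ≡⟨ Σ-*ˡ ℓ (𝟙 (i % ℓ ≟ 0)) (λ b → 𝟙 (unit? b) * 𝟙 ((b * t′) % ℓ ≟ i / ℓ)) ⟩
    𝟙 (i % ℓ ≟ 0) * Σ< ℓ (λ b → 𝟙 (unit? b) * 𝟙 ((b * t′) % ℓ ≟ i / ℓ))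
      ≡⟨ cong (𝟙 (i % ℓ ≟ 0) *_) (unit-orbit ℓ ∣-refl unit-cancel-ℓ t′ t′-unit (i / ℓ)) ⟩
    𝟙 (i % ℓ ≟ 0) * 𝟙 ((i / ℓ <? ℓ) ×-dec unit? (i / ℓ))
      ≡⟨ 𝟙-× (i % ℓ ≟ 0) ((i / ℓ <? ℓ) ×-dec unit? (i / ℓ)) ⟩
    𝟙 ((i % ℓ ≟ 0) ×-dec ((i / ℓ <? ℓ) ×-dec unit? (i / ℓ)))
      ≡⟨ 𝟙-cong ((i % ℓ ≟ 0) ×-dec ((i / ℓ <? ℓ) ×-dec unit? (i / ℓ))) (proper-multiple<L? i) ⇒ ⇐ ⟩
    𝟙 (proper-multiple<L? i)
      ∎
    where
    open ≡-Reasoning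
    regroup : ∀ a b c → a * (b * c) ≡ b * (a * c)
    regroup = solve-∀
    i≡[i/ℓ]ℓ : i % ℓ ≡ 0 → i ≡ i / ℓ * ℓ
    i≡[i/ℓ]ℓ e = trans (m≡m%n+[m/n]*n i ℓ) (cong (_+ i / ℓ * ℓ) e)
    split-condition : ∀ X → 𝟙 (X * ℓ ≟ i) ≡ 𝟙 (i % ℓ ≟ 0) * 𝟙 (X ≟ i / ℓ)
    split-condition X = trans
      (𝟙-cong (X * ℓ ≟ i) ((i % ℓ ≟ 0) ×-dec (X ≟ i / ℓ))
         (λ e → trans (cong (_% ℓ) (sym e)) (m*n%n≡0 X ℓ) , sym (trans (cong (_/ ℓ) (sym e)) (m*n/n≡m X ℓ)))
         (λ (e , X≡i/ℓ) → trans (cong (_* ℓ) X≡i/ℓ) (sym (i≡[i/ℓ]ℓ e))))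
      (sym (𝟙-× (i % ℓ ≟ 0) (X ≟ i / ℓ)))
    ⇒ : i % ℓ ≡ 0 × (i / ℓ < ℓ × i / ℓ % ℓ ≢ 0) → i < L × (i % ℓ ≡ 0 × i ≢ 0)
    ⇒ (e , lt , unit) = subst (_< L) (sym (i≡[i/ℓ]ℓ e)) (*-monoˡ-< ℓ lt) , e , λ i≡0 → unit (cong (λ z → z / ℓ % ℓ) i≡0)
    ⇐ : i < L × (i % ℓ ≡ 0 × i ≢ 0) → i % ℓ ≡ 0 × (i / ℓ < ℓ × i / ℓ % ℓ ≢ 0)
    ⇐ (lt , e , i≢0) = e , m<n*o⇒m/o<n lt ,
      λ e′ → i≢0 (trans (i≡[i/ℓ]ℓ e) (cong (_* ℓ) (trans (sym (m<n⇒m%n≡m (m<n*o⇒m/o<n lt))) e′)))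

  -- Writing t = t′ℓ, the residue of s t modulo ℓ² only depends on s modulo ℓ.
  unit-multiples-of-proper-multiple : ∀ t → t < L → t % ℓ ≡ 0 × t ≢ 0 → ∀ i →
                                      unit-multiples t i ≡ ℓ * 𝟙 (proper-multiple<L? i)
  unit-multiples-of-proper-multiple t t<L (t%ℓ≡0 , t≢0) i = begin
    unit-multiples t i
      ≡⟨ Σ-cong L (λ s _ → cong (λ z → 𝟙 (unit? s) * 𝟙 (z ≟ i)) (reduce s)) ⟩
    Σ< L (λ s → 𝟙 (unit? s) * 𝟙 ((s * t′) % ℓ * ℓ ≟ i))
      ≡⟨ Σ-blocks ℓ ℓ (λ s → 𝟙 (unit? s) * 𝟙 ((s * t′) % ℓ * ℓ ≟ i)) ⟩
    Σ< ℓ (λ a → Σ< ℓ (λ b → 𝟙 (unit? (a * ℓ + b)) * 𝟙 (((a * ℓ + b) * t′) % ℓ * ℓ ≟ i)))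
      ≡⟨ Σ-cong ℓ (λ a _ → Σ-cong ℓ (λ b _ →
           cong₂ _*_ (𝟙-unit-block a b) (cong (λ z → 𝟙 (z * ℓ ≟ i)) (block-residue a b)))) ⟩
    Σ< ℓ (λ a → Σ< ℓ (λ b → 𝟙 (unit? b) * 𝟙 ((b * t′) % ℓ * ℓ ≟ i)))
      ≡⟨ Σ-cong ℓ (λ a _ → scaled-unit-orbit t′ t′-unit i) ⟩
    Σ< ℓ (λ a → 𝟙 (proper-multiple<L? i))
      ≡⟨ Σ-const ℓ (𝟙 (proper-multiple<L? i)) ⟩
    ℓ * 𝟙 (proper-multiple<L? i)
      ∎
    where
    open ≡-Reasoning
    t′ : ℕ
    t′ = t / ℓ
    t≡t′ℓ : t ≡ t′ * ℓ
    t≡t′ℓ = trans (m≡m%n+[m/n]*n t ℓ) (cong (_+ t′ * ℓ) t%ℓ≡0)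
    t′-unit : t′ % ℓ ≢ 0
    t′-unit e = t≢0 (trans t≡t′ℓ (cong (_* ℓ) (trans (sym (m<n⇒m%n≡m (m<n*o⇒m/o<n t<L))) e)))
    reduce : ∀ s → (s * t) % L ≡ (s * t′) % ℓ * ℓ
    reduce s = trans (cong (λ z → (s * z) % L) t≡t′ℓ)
                     (trans (cong (_% L) (sym (*-assoc s t′ ℓ))) (sym (m%n*o≡m*o%[n*o] (s * t′) ℓ ℓ)))
    regroup : ∀ a l b t′ → (a * l + b) * t′ ≡ b * t′ + a * t′ * l
    regroup = solve-∀
    block-residue : ∀ a b → ((a * ℓ + b) * t′) % ℓ ≡ (b * t′) % ℓ
    block-residue a b = trans (cong (_% ℓ) (regroup a ℓ b t′)) ([m+kn]%n≡m%n (b * t′) (a * t′) ℓ)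

  unit-multiples-formula : ∀ t i → t < L → unit-multiples t i ≡
    ℓ * ℓ′ * (𝟙 (t ≟ 0) * 𝟙 (i ≟ 0)) + ℓ * (𝟙 (proper-multiple? t) * 𝟙 (proper-multiple<L? i))
      + 𝟙 (unit? t) * 𝟙 (unit<L? i)
  unit-multiples-formula t i t<L = cases (t ≟ 0) (t % ℓ ≟ 0)
    where
    open ≡-Reasoning
    X Y Z : ℕ
    X = 𝟙 (i ≟ 0)
    Y = 𝟙 (proper-multiple<L? i)
    Z = 𝟙 (unit<L? i)
    combination : ℕ → ℕ → ℕ → ℕ
    combination a b c = ℓ * ℓ′ * (a * X) + ℓ * (b * Y) + c * Z
    only-first : ∀ a l x y z → a * (1 * x) + l * (0 * y) + 0 * z ≡ a * x
    only-first = solve-∀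
    only-second : ∀ a l x y z → a * (0 * x) + l * (1 * y) + 0 * z ≡ l * y
    only-second = solve-∀
    only-third : ∀ a l x y z → a * (0 * x) + l * (0 * y) + 1 * z ≡ z
    only-third = solve-∀
    combination-cong : ∀ {a a′ b b′ c c′} → a ≡ a′ → b ≡ b′ → c ≡ c′ → combination a b c ≡ combination a′ b′ c′
    combination-cong refl refl refl = refl
    cases : Dec (t ≡ 0) → Dec (t % ℓ ≡ 0) →
            unit-multiples t i ≡ combination (𝟙 (t ≟ 0)) (𝟙 (proper-multiple? t)) (𝟙 (unit? t))
    cases (yes refl) _ = begin
      unit-multiples 0 i
        ≡⟨ unit-multiples-of-0 i ⟩
      ℓ * ℓ′ * X
        ≡⟨ only-first (ℓ * ℓ′) ℓ X Y Z ⟨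
      combination 1 0 0
        ≡⟨ combination-cong (𝟙-yes (0 ≟ 0) refl) (𝟙-no (proper-multiple? 0) (λ p → proj₂ p refl)) (𝟙-no (unit? 0) (λ unit → unit refl)) ⟨
      combination (𝟙 (0 ≟ 0)) (𝟙 (proper-multiple? 0)) (𝟙 (unit? 0))
        ∎
    cases (no t≢0) (yes t%ℓ≡0) = begin
      unit-multiples t i
        ≡⟨ unit-multiples-of-proper-multiple t t<L (t%ℓ≡0 , t≢0) i ⟩
      ℓ * Y
        ≡⟨ only-second (ℓ * ℓ′) ℓ X Y Z ⟨
      combination 0 1 0
        ≡⟨ combination-cong (𝟙-no (t ≟ 0) t≢0) (𝟙-yes (proper-multiple? t) (t%ℓ≡0 , t≢0)) (𝟙-no (unit? t) (λ unit → unit t%ℓ≡0)) ⟨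
      combination (𝟙 (t ≟ 0)) (𝟙 (proper-multiple? t)) (𝟙 (unit? t))
        ∎
    cases (no t≢0) (no t-unit) = begin
      unit-multiples t i
        ≡⟨ unit-multiples-of-unit t t-unit i ⟩
      Z
        ≡⟨ only-third (ℓ * ℓ′) ℓ X Y Z ⟨
      combination 0 0 1
        ≡⟨ combination-cong (𝟙-no (t ≟ 0) t≢0) (𝟙-no (proper-multiple? t) (λ p → t-unit (proj₁ p))) (𝟙-yes (unit? t) t-unit) ⟨
      combination (𝟙 (t ≟ 0)) (𝟙 (proper-multiple? t)) (𝟙 (unit? t))
        ∎

module CyclotomicMultiple (ℓ′ : ℕ) where

  open import Data.Nat
  open import Data.Nat.Properties
  open import Data.Nat.DivMod
  open import Data.Integer as ℤ using (ℤ; +_)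
  open import Data.Integer.Properties using (pos-*)
  open import Data.List using (_∷_; map; upTo; applyUpTo; replicate)
  open import Data.List.Properties using (map-applyUpTo; map-cong)
  open import Data.Bool using (if_then_else_)
  open import Data.Product using (_×_; _,_; proj₁; proj₂)
  open import Function using (_∘_; id)
  open import Relation.Nullary using (Dec; yes; no)
  open import Relation.Nullary.Decidable using (⌊_⌋; _×-dec_)
  open import Relation.Binary.PropositionalEquality
  open import Data.Nat.Tactic.RingSolver using (solve-∀)
  open import Defs using (Poly; coeff; mulCoeff; sumℤ; cyclotomicPrimeSq)
  open FiniteSum
  open ResidueClasses ℓ′

  coeff-applyUpTo-< : ∀ n (h : ℕ → ℤ) j → j < n → coeff (applyUpTo h n) j ≡ h j
  coeff-applyUpTo-< (suc n) h zero    _         = refl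
  coeff-applyUpTo-< (suc n) h (suc j) (s≤s j<n) = coeff-applyUpTo-< n (h ∘ suc) j j<n

  coeff-applyUpTo-≥ : ∀ n (h : ℕ → ℤ) j → n ≤ j → coeff (applyUpTo h n) j ≡ + 0
  coeff-applyUpTo-≥ zero    h j       _         = refl
  coeff-applyUpTo-≥ (suc n) h (suc j) (s≤s n≤j) = coeff-applyUpTo-≥ n (h ∘ suc) j n≤j

  coeff-Φ : ∀ j → coeff (cyclotomicPrimeSq ℓ) j ≡ + 𝟙 (multiple<L? j)
  coeff-Φ j with j <? ℓ * ℓ′ + 1
  ... | yes j<deg = begin
    coeff (cyclotomicPrimeSq ℓ) j
      ≡⟨ cong (λ P → coeff P j) (map-applyUpTo id coefficient (ℓ * ℓ′ + 1)) ⟩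
    coeff (applyUpTo coefficient (ℓ * ℓ′ + 1)) j
      ≡⟨ coeff-applyUpTo-< (ℓ * ℓ′ + 1) coefficient j j<deg ⟩
    (if ⌊ j % ℓ ≟ 0 ⌋ then + 1 else + 0)
      ≡⟨ if⌊⌋ (j % ℓ ≟ 0) ⟩
    + 𝟙 (j % ℓ ≟ 0)
      ≡⟨ cong +_ (𝟙-cong (j % ℓ ≟ 0) (multiple<L? j) (λ e → <-≤-trans j<deg deg≤L , e) proj₂) ⟩
    + 𝟙 (multiple<L? j)
      ∎
    where
    open ≡-Reasoning
    coefficient : ℕ → ℤ
    coefficient i = if ⌊ i % ℓ ≟ 0 ⌋ then + 1 else + 0
    if⌊⌋ : ∀ {a} {P : Set a} (d : Dec P) → (if ⌊ d ⌋ then + 1 else + 0) ≡ + 𝟙 d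
    if⌊⌋ (yes _) = refl
    if⌊⌋ (no _)  = refl
    deg≤L : ℓ * ℓ′ + 1 ≤ L
    deg≤L = subst₂ _≤_ (+-comm 1 (ℓ * ℓ′)) (sym (*-suc ℓ ℓ′)) (+-monoˡ-≤ (ℓ * ℓ′) {1} {ℓ} (s≤s z≤n))
  ... | no j≮deg = trans (cong (λ P → coeff P j) (map-applyUpTo id _ (ℓ * ℓ′ + 1)))
    (trans (coeff-applyUpTo-≥ _ _ j (≮⇒≥ j≮deg)) (cong +_ (sym (𝟙-no (multiple<L? j) (λ (j<L , e) → j≮deg (below-degree e j<L))))))
    where
    below-degree : j % ℓ ≡ 0 → j < L → j < ℓ * ℓ′ + 1
    below-degree e j<L = subst (j <_) (+-comm 1 (ℓ * ℓ′))
      (s≤s (subst (_≤ ℓ * ℓ′) (sym j≡) (≤-trans (*-monoˡ-≤ ℓ j/ℓ≤ℓ′) (≤-reflexive (*-comm ℓ′ ℓ)))))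
      where
      j≡ : j ≡ j / ℓ * ℓ
      j≡ = trans (m≡m%n+[m/n]*n j ℓ) (cong (_+ j / ℓ * ℓ) e)
      j/ℓ≤ℓ′ : j / ℓ ≤ ℓ′
      j/ℓ≤ℓ′ = ≤-pred (m<n*o⇒m/o<n j<L)

  cofactor : ℕ → ℕ → Poly
  cofactor β γ = + β ∷ replicate ℓ′ (+ γ)

  cofactor-coeff : ℕ → ℕ → ℕ → ℕ
  cofactor-coeff β γ zero    = β
  cofactor-coeff β γ (suc n) = γ * 𝟙 (n <? ℓ′)

  coeff-cofactor : ∀ β γ n → coeff (cofactor β γ) n ≡ + cofactor-coeff β γ n
  coeff-cofactor β γ zero    = refl
  coeff-cofactor β γ (suc n) = coeff-replicate ℓ′ n
    where
    coeff-replicate : ∀ k n → coeff (replicate k (+ γ)) n ≡ + (γ * 𝟙 (n <? k))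
    coeff-replicate zero    n       = cong +_ (sym (*-zeroʳ γ))
    coeff-replicate (suc k) zero    = cong +_ (sym (*-identityʳ γ))
    coeff-replicate (suc k) (suc n) = coeff-replicate k n

  sumℤ-map-upTo : ∀ (f : ℕ → ℕ) n → sumℤ (map (λ j → + f j) (upTo n)) ≡ + Σ< n f
  sumℤ-map-upTo f n = go f id n
    where
    go : ∀ (f g : ℕ → ℕ) n → sumℤ (map (λ j → + f j) (applyUpTo g n)) ≡ + Σ< n (f ∘ g)
    go f g zero    = refl
    go f g (suc n) = cong (ℤ._+_ (+ f (g 0))) (go f (g ∘ suc) n)

  mulCoeff-Φ-cofactor-Σ : ∀ β γ i → mulCoeff (cyclotomicPrimeSq ℓ) (cofactor β γ) i ≡
                          + Σ< (suc i) (λ j → 𝟙 (multiple<L? j) * cofactor-coeff β γ (i ∸ j))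
  mulCoeff-Φ-cofactor-Σ β γ i = trans
    (cong sumℤ (map-cong (λ j → trans (cong₂ ℤ._*_ (coeff-Φ j) (coeff-cofactor β γ (i ∸ j)))
                                      (sym (pos-* (𝟙 (multiple<L? j)) (cofactor-coeff β γ (i ∸ j))))) (upTo (suc i))))
    (sumℤ-map-upTo (λ j → 𝟙 (multiple<L? j) * cofactor-coeff β γ (i ∸ j)) (suc i))

  ∸-suc : ∀ i j → j < i → i ∸ j ≡ suc (i ∸ suc j)
  ∸-suc (suc i) zero    _         = refl
  ∸-suc (suc i) (suc j) (s≤s j<i) = ∸-suc i j j<i

  window-multiple⇒ : ∀ i j → j < i → (j < L × j % ℓ ≡ 0) × i ∸ suc j < ℓ′ → (i < L × i % ℓ ≢ 0) × j ≡ i / ℓ * ℓ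
  window-multiple⇒ i j j<i ((j<L , j%ℓ≡0) , window) =
    (i<L , λ e → <-irrefl (sym (trans (sym i%ℓ≡d) e)) 0<d) , trans j≡aℓ (cong (_* ℓ) (sym i/ℓ≡a))
    where
    a d : ℕ
    a = j / ℓ
    d = i ∸ j
    j≡aℓ : j ≡ a * ℓ
    j≡aℓ = trans (m≡m%n+[m/n]*n j ℓ) (cong (_+ a * ℓ) j%ℓ≡0)
    0<d : 0 < d
    0<d = subst (0 <_) (sym (∸-suc i j j<i)) z<s
    d<ℓ : d < ℓ
    d<ℓ = subst (_< ℓ) (sym (∸-suc i j j<i)) (s≤s window)
    i≡aℓ+d : i ≡ a * ℓ + d
    i≡aℓ+d = trans (sym (m+[n∸m]≡n (<⇒≤ j<i))) (cong (_+ d) j≡aℓ)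
    i%ℓ≡d : i % ℓ ≡ d
    i%ℓ≡d = trans (cong (_% ℓ) i≡aℓ+d) (proj₁ (divMod-unique a d d<ℓ))
    i/ℓ≡a : i / ℓ ≡ a
    i/ℓ≡a = trans (cong (_/ ℓ) i≡aℓ+d) (proj₂ (divMod-unique a d d<ℓ))
    i<L : i < L
    i<L = subst (_< L) (sym i≡aℓ+d)
      (<-≤-trans (+-monoʳ-< (a * ℓ) d<ℓ) (subst (_≤ L) (+-comm ℓ (a * ℓ)) (*-monoˡ-≤ ℓ (m<n*o⇒m/o<n {j} {ℓ} {ℓ} j<L))))

  window-multiple⇐ : ∀ i j → j < i → (i < L × i % ℓ ≢ 0) × j ≡ i / ℓ * ℓ → (j < L × j % ℓ ≡ 0) × i ∸ suc j < ℓ′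
  window-multiple⇐ i j j<i ((i<L , _) , refl) =
    (<-trans j<i i<L , m*n%n≡0 (i / ℓ) ℓ) , ≤-pred (subst (_< ℓ) i%ℓ≡ (m%n<n i ℓ))
    where
    i%ℓ≡ : i % ℓ ≡ suc (i ∸ suc (i / ℓ * ℓ))
    i%ℓ≡ = trans (sym (trans (cong (_∸ i / ℓ * ℓ) (m≡m%n+[m/n]*n i ℓ)) (m+n∸n≡m (i % ℓ) (i / ℓ * ℓ))))
                 (∸-suc i (i / ℓ * ℓ) j<i)

  -- The window i - ℓ + 1 ≤ j < i contains a multiple of ℓ below ℓ², namely ⌊i/ℓ⌋ℓ,
  -- exactly when i is a unit below ℓ².
  count-multiples-in-window : ∀ i → Σ< i (λ j → 𝟙 (multiple<L? j ×-dec (i ∸ suc j <? ℓ′))) ≡ 𝟙 (unit<L? i)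
  count-multiples-in-window i = begin
    Σ< i (λ j → 𝟙 (multiple<L? j ×-dec (i ∸ suc j <? ℓ′)))
      ≡⟨ Σ-cong i (λ j j<i → trans (𝟙-cong (multiple<L? j ×-dec (i ∸ suc j <? ℓ′)) (unit<L? i ×-dec (j ≟ c))
                                            (window-multiple⇒ i j j<i) (window-multiple⇐ i j j<i))
                                    (sym (𝟙-× (unit<L? i) (j ≟ c)))) ⟩
    Σ< i (λ j → 𝟙 (unit<L? i) * 𝟙 (j ≟ c))
      ≡⟨ Σ-*ˡ i (𝟙 (unit<L? i)) (λ j → 𝟙 (j ≟ c)) ⟩
    𝟙 (unit<L? i) * count i (_≟ c)
      ≡⟨ 𝟙*-cong (unit<L? i) (λ (_ , i-unit) → one-hit i-unit) ⟩
    𝟙 (unit<L? i) * 1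
      ≡⟨ *-identityʳ _ ⟩
    𝟙 (unit<L? i)
      ∎
    where
    open ≡-Reasoning
    c : ℕ
    c = i / ℓ * ℓ
    one-hit : i % ℓ ≢ 0 → count i (_≟ c) ≡ 1
    one-hit i-unit = trans (Σ-cong i (λ j _ → trans (𝟙-cong (j ≟ c) (c ≟ j) sym sym) (sym (+-identityʳ _))))
                           (Σ-δ i c (λ _ → 1) c<i)
      where
      c<i : c < i
      c<i = subst (c <_) (trans (+-comm c (i % ℓ)) (sym (m≡m%n+[m/n]*n i ℓ))) (m<m+n c (n≢0⇒n>0 i-unit))

  mulCoeff-Φ-cofactor : ∀ β γ i → mulCoeff (cyclotomicPrimeSq ℓ) (cofactor β γ) i ≡ + (β * 𝟙 (multiple<L? i) + γ * 𝟙 (unit<L? i))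
  mulCoeff-Φ-cofactor β γ i = trans (mulCoeff-Φ-cofactor-Σ β γ i) (cong +_ (begin
    Σ< (suc i) term
      ≡⟨ Σ-last i term ⟩
    Σ< i term + term i
      ≡⟨ cong₂ _+_ lower (cong (λ n → 𝟙 (multiple<L? i) * cofactor-coeff β γ n) (n∸n≡0 i)) ⟩
    γ * 𝟙 (unit<L? i) + 𝟙 (multiple<L? i) * β
      ≡⟨ rearrange γ (𝟙 (unit<L? i)) (𝟙 (multiple<L? i)) β ⟩
    β * 𝟙 (multiple<L? i) + γ * 𝟙 (unit<L? i)
      ∎))
    where
    open ≡-Reasoning
    rearrange : ∀ g u m b → g * u + m * b ≡ b * m + g * u
    rearrange = solve-∀
    regroup : ∀ a g b → a * (g * b) ≡ g * (a * b)
    regroup = solve-∀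
    term : ℕ → ℕ
    term j = 𝟙 (multiple<L? j) * cofactor-coeff β γ (i ∸ j)
    lower : Σ< i term ≡ γ * 𝟙 (unit<L? i)
    lower = begin
      Σ< i term
        ≡⟨ Σ-cong i (λ j j<i → trans (cong (λ n → 𝟙 (multiple<L? j) * cofactor-coeff β γ n) (∸-suc i j j<i))
                                     (trans (regroup (𝟙 (multiple<L? j)) γ _) (cong (γ *_) (𝟙-× (multiple<L? j) (i ∸ suc j <? ℓ′))))) ⟩
      Σ< i (λ j → γ * 𝟙 (multiple<L? j ×-dec (i ∸ suc j <? ℓ′)))
        ≡⟨ Σ-*ˡ i γ (λ j → 𝟙 (multiple<L? j ×-dec (i ∸ suc j <? ℓ′))) ⟩
      γ * Σ< i (λ j → 𝟙 (multiple<L? j ×-dec (i ∸ suc j <? ℓ′)))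
        ≡⟨ cong (γ *_) (count-multiples-in-window i) ⟩
      γ * 𝟙 (unit<L? i)
        ∎

module ListCounting where

  open import Level using (Level)
  open import Data.Nat
  open import Data.Nat.Properties
  open import Data.Nat.ListAction using (sum)
  open import Data.List using (List; []; _∷_; _++_; map; filter; length; concatMap; applyUpTo; upTo)
  open import Data.List.Properties using (filter-++; length-++)
  open import Data.Bool using (true; false)
  open import Function using (_∘_; id)
  open import Relation.Nullary using (Dec; does)
  open import Relation.Binary.PropositionalEquality
  open FiniteSum

  private
    variable
      a p : Level
      A : Set a

  module _ {P : A → Set p} (P? : ∀ x → Dec (P x)) where

    length-filter-∷ : ∀ x xs → length (filter P? (x ∷ xs)) ≡ 𝟙 (P? x) + length (filter P? xs)
    length-filter-∷ x xs with does (P? x)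
    ... | true  = refl
    ... | false = refl

    length-filter-++ : ∀ xs ys → length (filter P? (xs ++ ys)) ≡ length (filter P? xs) + length (filter P? ys)
    length-filter-++ xs ys = trans (cong length (filter-++ P? xs ys)) (length-++ (filter P? xs))

    length-filter-concatMap : ∀ {B : Set} (f : B → List A) xs →
                              length (filter P? (concatMap f xs)) ≡ sum (map (length ∘ filter P? ∘ f) xs)
    length-filter-concatMap f []       = refl
    length-filter-concatMap f (x ∷ xs) =
      trans (length-filter-++ (f x) (concatMap f xs)) (cong (length (filter P? (f x)) +_) (length-filter-concatMap f xs))

    length-filter-map : ∀ {B : Set} (f : B → A) xs → length (filter P? (map f xs)) ≡ sum (map (λ y → 𝟙 (P? (f y))) xs)
    length-filter-map f []       = refl
    length-filter-map f (x ∷ xs) = trans (length-filter-∷ (f x) (map f xs)) (cong (𝟙 (P? (f x)) +_) (length-filter-map f xs))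

  sum-map-filter : ∀ {P : ℕ → Set p} (P? : ∀ x → Dec (P x)) (g : ℕ → ℕ) xs →
                   sum (map g (filter P? xs)) ≡ sum (map (λ x → 𝟙 (P? x) * g x) xs)
  sum-map-filter P? g []       = refl
  sum-map-filter P? g (x ∷ xs) with does (P? x)
  ... | true  = cong₂ _+_ (sym (+-identityʳ (g x))) (sum-map-filter P? g xs)
  ... | false = sum-map-filter P? g xs

  sum-map-upTo : ∀ (g : ℕ → ℕ) n → sum (map g (upTo n)) ≡ Σ< n g
  sum-map-upTo g n = go id n
    where
    go : ∀ (h : ℕ → ℕ) n → sum (map g (applyUpTo h n)) ≡ Σ< n (g ∘ h)
    go h zero    = refl
    go h (suc n) = cong (g (h 0) +_) (go (h ∘ suc) n)

module JacobiSum where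

  open import Data.Nat
  open import Data.Nat.ListAction using (sum)
  open import Data.List using (List; []; _∷_; map; filter; length; upTo; mapMaybe)
  open import Data.Maybe using (Maybe; just; nothing)
  open import Relation.Binary.PropositionalEquality
  open import Relation.Nullary using (yes; no; contradiction)
  open import Defs using (jacobi; mulχ; chiPow; indχ; _mod_)
  open FiniteSum
  open ListCounting using (length-filter-∷)

  jacobi-term : (ℓ q u a b x : ℕ) → Maybe ℕ
  jacobi-term ℓ q u a b x = mulχ ℓ (chiPow ℓ q u a x) (chiPow ℓ q u b ((suc q ∸ x) mod q))

  -- Defs.jacobi recurses through a local function that cannot be named here; abstracting
  -- upTo q exposes it, and Agda infers the type of the induction over the list.
  mutual
    jacobi≡mapMaybe : ∀ ℓ q u a b → jacobi ℓ q u a b ≡ mapMaybe (jacobi-term ℓ q u a b) (upTo q)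
    jacobi≡mapMaybe ℓ q u a b with upTo q
    ... | xs = collect≡mapMaybe ℓ q u a b xs

    collect≡mapMaybe : ∀ ℓ q u a b (xs : List ℕ) → _
    collect≡mapMaybe ℓ q u a b []       = refl
    collect≡mapMaybe ℓ q u a b (x ∷ xs) with jacobi-term ℓ q u a b x
    ... | just e  = cong (e ∷_) (collect≡mapMaybe ℓ q u a b xs)
    ... | nothing = collect≡mapMaybe ℓ q u a b xs

  multiplicity : Maybe ℕ → ℕ → ℕ
  multiplicity (just e) i = 𝟙 (e ≟ i)
  multiplicity nothing  i = 0

  length-filter-mapMaybe : ∀ (g : ℕ → Maybe ℕ) i xs →
                           length (filter (_≟ i) (mapMaybe g xs)) ≡ sum (map (λ x → multiplicity (g x) i) xs)
  length-filter-mapMaybe g i []       = refl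
  length-filter-mapMaybe g i (x ∷ xs) with g x
  ... | just e  = trans (length-filter-∷ (_≟ i) e (mapMaybe g xs)) (cong (𝟙 (e ≟ i) +_) (length-filter-mapMaybe g i xs))
  ... | nothing = length-filter-mapMaybe g i xs

  chiPow-at-0 : ∀ ℓ q u a → a mod (ℓ * ℓ) ≢ 0 → chiPow ℓ q u a 0 ≡ nothing
  chiPow-at-0 ℓ q u a a≢0 with (a mod (ℓ * ℓ)) ≟ 0
  ... | yes e = contradiction e a≢0
  ... | no _  = refl

  chiPow-at-nonzero : ∀ ℓ q u a w → 0 < w → chiPow ℓ q u a w ≡ just ((a * indχ ℓ q u w) mod (ℓ * ℓ))
  chiPow-at-nonzero ℓ q u a (suc w) _ = refl

module TraceFormula (k : ℕ) (q-prime : Prime (suc (suc k))) (ℓ′ : ℕ) (ℓ-prime : Prime (suc ℓ′))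
  (q≡1 : suc (suc k) % (suc ℓ′ * suc ℓ′) ≡ 1)
  (u : ℕ) (u-order : HasOrder (suc (suc k)) u (suc ℓ′ * suc ℓ′)) where

  open import Data.Nat
  open import Data.Nat.Properties
  open import Data.Nat.DivMod hiding (_mod_; _div_)
  open import Data.Nat.Divisibility
  open import Data.Nat.Primality using (euclidsLemma; ¬prime[1])
  open import Data.Product using (_×_; _,_; proj₁; proj₂)
  open import Data.Sum using ([_,_]′)
  open import Relation.Nullary using (Dec; yes; no; ¬_; contradiction)
  open import Relation.Nullary.Decidable using (_×-dec_; ⌊_⌋)
  open import Relation.Binary.PropositionalEquality
  open import Data.Nat.Tactic.RingSolver using (solve-∀)
  open import Data.List using (List; filter; length; map; upTo; mapMaybe)
  open import Data.Bool as Bool using (Bool; true)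
  open import Data.Nat.ListAction using (sum)
  open import Data.Nat.Coprimality using (coprime?)
  open import Function using (_∘_)
  open ListCounting
  open NatProperties using (*-distribˡ-+-%)
  open import Defs
    using (chiPow; mulχ; _mod_; jacobi; traceJacobi; affineCount; isAffinePoint; pointCount;
           CycEqInt; sumMonomials; constPoly; mulCoeff; cyclotomicPrimeSq)
  open FiniteSum
  open PrimeField k q-prime
  open CurvePoints k q-prime ℓ′ q≡1 u u-order
  open PowerResidues k q-prime ℓ′ q≡1 u u-order
  open ResidueClasses ℓ′ hiding (ℓ; L)
  open UnitMultiples ℓ′ ℓ-prime
  open JacobiSum
  open CyclotomicMultiple ℓ′
  open import Data.Integer as ℤ using (ℤ; +_)
  open import Data.Integer.Tactic.RingSolver renaming (solve-∀ to ℤ-solve-∀)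

  a₀ : ℕ
  a₀ = ℓ * (ℓ ∸ 1)

  T : ℕ → ℕ
  T x = index (G x)

  G≉0 : ∀ x → x < q → 2 ≤ x → ¬ (G x ≈ 0)
  G≉0 x x<q 2≤x = *-≉0 (x ^ (ℓ * ℓ′)) (one-minus x) (^-≉0 x (ℓ * ℓ′) x≉0) 1-x≉0
    where
    x≉0 : ¬ (x ≈ 0)
    x≉0 = <q⇒≉0 (≤-trans (s≤s z≤n) 2≤x) x<q
    1-x≉0 : ¬ (one-minus x ≈ 0)
    1-x≉0 e = <-irrefl (sym (≈⇒≡ x<q (s<s z<s) (≈-trans (+-cong (≈-sym e) (≈-refl {x})) (one-minus-+ x)))) 2≤x

  T<L : ∀ x → x < q → 2 ≤ x → T x < L
  T<L x x<q 2≤x = index<L (G x) (G≉0 x x<q 2≤x)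

  private
    ℓ∣⇒%≡0 : ∀ {s} → ℓ ∣ s → s % ℓ ≡ 0
    ℓ∣⇒%≡0 {s} = n∣m⇒m%n≡0 s ℓ

  -- χ^(s a₀) vanishes at 0, since ℓ² ∤ s ℓ (ℓ - 1) for a unit s.
  s*a₀-≢0 : ∀ s → s % ℓ ≢ 0 → (s * a₀) mod L ≢ 0
  s*a₀-≢0 s s-unit e = [ (λ ℓ∣s → s-unit (ℓ∣⇒%≡0 ℓ∣s)) ,
                          (λ ℓ∣ℓ′ → <⇒≱ (n<1+n ℓ′) (∣⇒≤ {{pred-nonZero ℓ′ ℓ-prime}} ℓ∣ℓ′)) ]′
                           (euclidsLemma s ℓ′ ℓ-prime (*-cancelˡ-∣ ℓ L∣ℓ*sℓ′))
    where
    regroup : ∀ s l l′ → s * (l * l′) ≡ l * (s * l′)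
    regroup = solve-∀
    L∣ℓ*sℓ′ : L ∣ ℓ * (s * ℓ′)
    L∣ℓ*sℓ′ = subst (L ∣_) (regroup s ℓ ℓ′) (m%n≡0⇒n∣m (s * a₀) L e)
    pred-nonZero : ∀ n → Prime (suc n) → NonZero n
    pred-nonZero zero    p = contradiction p ¬prime[1]
    pred-nonZero (suc n) _ = _

  s*1-≢0 : ∀ s → s % ℓ ≢ 0 → (s * 1) mod L ≢ 0
  s*1-≢0 s s-unit e = s-unit (trans (cong (_% ℓ) (sym (*-identityʳ s)))
    (trans (sym (m∣n⇒o%n%m≡o%m ℓ L (s * 1) (m∣m*n ℓ))) (cong (_% ℓ) e)))

  multiplicity-of-term : ∀ s x i → s % ℓ ≢ 0 → x < q →
    multiplicity (jacobi-term ℓ q u (s * a₀) (s * 1) x) i ≡ 𝟙 (2 ≤? x) * 𝟙 ((s * T x) % L ≟ i)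
  multiplicity-of-term s zero i s-unit _ =
    cong (λ c → multiplicity (mulχ ℓ c (chiPow ℓ q u (s * 1) ((suc q ∸ 0) mod q))) i) (chiPow-at-0 ℓ q u (s * a₀) (s*a₀-≢0 s s-unit))
  multiplicity-of-term s (suc zero) i s-unit _ =
    cong (λ c → multiplicity (mulχ ℓ (chiPow ℓ q u (s * a₀) 1) c) i)
         (trans (cong (chiPow ℓ q u (s * 1)) (n%n≡0 q)) (chiPow-at-0 ℓ q u (s * 1) (s*1-≢0 s s-unit)))
  multiplicity-of-term s x@(suc (suc _)) i s-unit x<q = begin
    multiplicity (jacobi-term ℓ q u (s * a₀) (s * 1) x) i
      ≡⟨ cong (λ c → multiplicity (mulχ ℓ (chiPow ℓ q u (s * a₀) x) c) i) (chiPow-at-nonzero ℓ q u (s * 1) y 0<y) ⟩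
    𝟙 (((s * a₀ * index x) mod L + (s * 1 * index y) mod L) mod L ≟ i)
      ≡⟨ cong (λ e → 𝟙 (e ≟ i)) exponent ⟩
    𝟙 ((s * T x) % L ≟ i)
      ≡⟨ +-identityʳ _ ⟨
    𝟙 (2 ≤? x) * 𝟙 ((s * T x) % L ≟ i)
      ∎
    where
    open ≡-Reasoning
    y : ℕ
    y = (suc q ∸ x) mod q
    y≡1-x : y ≡ one-minus x
    y≡1-x = cong (λ r → (suc q ∸ r) % q) (sym (m<n⇒m%n≡m x<q))
    x≉0 : ¬ (x ≈ 0)
    x≉0 = <q⇒≉0 z<s x<q
    1-x≉0 : ¬ (one-minus x ≈ 0)
    1-x≉0 e = <-irrefl (sym (≈⇒≡ x<q (s<s z<s) (≈-trans (+-cong (≈-sym e) (≈-refl {x})) (one-minus-+ x)))) (s≤s (s≤s z≤n))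
    0<y : 0 < y
    0<y = subst (0 <_) (sym y≡1-x) (≉0⇒>0 1-x≉0)
    T≡ : T x ≡ ((a₀ * index x) % L + index y) % L
    T≡ = trans (index-* (x ^ a₀) (one-minus x) (^-≉0 x a₀ x≉0) 1-x≉0)
               (cong₂ (λ a b → (a + b) % L) (index-^ x a₀ x≉0) (cong index (sym y≡1-x)))
    exponent : ((s * a₀ * index x) mod L + (s * 1 * index y) mod L) mod L ≡ (s * T x) % L
    exponent = begin
      ((s * a₀ * index x) mod L + (s * 1 * index y) mod L) mod L
        ≡⟨ cong₂ (λ a b → (a % L + b % L) % L) (*-assoc s a₀ (index x)) (cong (_* index y) (*-identityʳ s)) ⟩
      ((s * (a₀ * index x)) % L + (s * index y) % L) % L
        ≡⟨ *-distribˡ-+-% L s (a₀ * index x) (index y) ⟩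
      (s * (((a₀ * index x) % L + index y) % L)) % L
        ≡⟨ cong (λ t → (s * t) % L) T≡ ⟨
      (s * T x) % L
        ∎

  count-in-jacobi : ∀ s i → s % ℓ ≢ 0 →
    length (filter (_≟ i) (jacobi ℓ q u (s * a₀) (s * 1))) ≡ Σ< q (λ x → 𝟙 (2 ≤? x) * 𝟙 ((s * T x) % L ≟ i))
  count-in-jacobi s i s-unit = begin
    length (filter (_≟ i) (jacobi ℓ q u (s * a₀) (s * 1)))
      ≡⟨ cong (length ∘ filter (_≟ i)) (jacobi≡mapMaybe ℓ q u (s * a₀) (s * 1)) ⟩
    length (filter (_≟ i) (mapMaybe (jacobi-term ℓ q u (s * a₀) (s * 1)) (upTo q)))
      ≡⟨ length-filter-mapMaybe (jacobi-term ℓ q u (s * a₀) (s * 1)) i (upTo q) ⟩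
    sum (map (λ x → multiplicity (jacobi-term ℓ q u (s * a₀) (s * 1) x) i) (upTo q))
      ≡⟨ sum-map-upTo (λ x → multiplicity (jacobi-term ℓ q u (s * a₀) (s * 1) x) i) q ⟩
    Σ< q (λ x → multiplicity (jacobi-term ℓ q u (s * a₀) (s * 1) x) i)
      ≡⟨ Σ-cong q (λ x x<q → multiplicity-of-term s x i s-unit x<q) ⟩
    Σ< q (λ x → 𝟙 (2 ≤? x) * 𝟙 ((s * T x) % L ≟ i))
      ∎
    where open ≡-Reasoning

  exponent-count : ∀ i → length (filter (_≟ i) (traceJacobi ℓ q u a₀ 1)) ≡ Σ< q (λ x → 𝟙 (2 ≤? x) * unit-multiples (T x) i)
  exponent-count i = begin
    length (filter (_≟ i) (traceJacobi ℓ q u a₀ 1))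
      ≡⟨ length-filter-concatMap (_≟ i) (λ s → jacobi ℓ q u (s * a₀) (s * 1)) (filter (λ s → coprime? s (ℓ * ℓ)) (upTo (ℓ * ℓ))) ⟩
    sum (map count-in (filter (λ s → coprime? s (ℓ * ℓ)) (upTo (ℓ * ℓ))))
      ≡⟨ sum-map-filter (λ s → coprime? s (ℓ * ℓ)) count-in (upTo (ℓ * ℓ)) ⟩
    sum (map (λ s → 𝟙 (coprime? s L) * count-in s) (upTo L))
      ≡⟨ sum-map-upTo (λ s → 𝟙 (coprime? s L) * count-in s) L ⟩
    Σ< L (λ s → 𝟙 (coprime? s L) * count-in s)
      ≡⟨ Σ-cong L (λ s _ → trans (cong (_* count-in s) (𝟙-coprime≡𝟙-unit s)) (𝟙*-cong (unit? s) (count-in-jacobi s i))) ⟩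
    Σ< L (λ s → 𝟙 (unit? s) * Σ< q (λ x → 𝟙 (2 ≤? x) * 𝟙 ((s * T x) % L ≟ i)))
      ≡⟨ Σ-cong L (λ s _ → sym (Σ-*ˡ q (𝟙 (unit? s)) (λ x → 𝟙 (2 ≤? x) * 𝟙 ((s * T x) % L ≟ i)))) ⟩
    Σ< L (λ s → Σ< q (λ x → 𝟙 (unit? s) * (𝟙 (2 ≤? x) * 𝟙 ((s * T x) % L ≟ i))))
      ≡⟨ Σ-swap L q (λ s x → 𝟙 (unit? s) * (𝟙 (2 ≤? x) * 𝟙 ((s * T x) % L ≟ i))) ⟩
    Σ< q (λ x → Σ< L (λ s → 𝟙 (unit? s) * (𝟙 (2 ≤? x) * 𝟙 ((s * T x) % L ≟ i))))
      ≡⟨ Σ-cong q (λ x _ → trans (Σ-cong L (λ s _ → regroup (𝟙 (unit? s)) (𝟙 (2 ≤? x)) (𝟙 ((s * T x) % L ≟ i))))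
                                  (Σ-*ˡ L (𝟙 (2 ≤? x)) (λ s → 𝟙 (unit? s) * 𝟙 ((s * T x) % L ≟ i)))) ⟩
    Σ< q (λ x → 𝟙 (2 ≤? x) * unit-multiples (T x) i)
      ∎
    where
    open ≡-Reasoning
    count-in : ℕ → ℕ
    count-in s = length (filter (_≟ i) (jacobi ℓ q u (s * a₀) (s * 1)))
    regroup : ∀ a b c → a * (b * c) ≡ b * (a * c)
    regroup = solve-∀

  A₀ B₀ C₀ : ℕ
  A₀ = Σ< q (λ x → 𝟙 (2 ≤? x) * 𝟙 (T x ≟ 0))
  B₀ = Σ< q (λ x → 𝟙 (2 ≤? x) * 𝟙 (proper-multiple? (T x)))
  C₀ = Σ< q (λ x → 𝟙 (2 ≤? x) * 𝟙 (unit? (T x)))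

  exponent-count-formula : ∀ i → Σ< q (λ x → 𝟙 (2 ≤? x) * unit-multiples (T x) i) ≡
    ℓ * ℓ′ * 𝟙 (i ≟ 0) * A₀ + ℓ * 𝟙 (proper-multiple<L? i) * B₀ + 𝟙 (unit<L? i) * C₀
  exponent-count-formula i = begin
    Σ< q (λ x → 𝟙 (2 ≤? x) * unit-multiples (T x) i)
      ≡⟨ Σ-cong q (λ x x<q → trans (𝟙*-cong (2 ≤? x) (λ 2≤x → unit-multiples-formula (T x) i (T<L x x<q 2≤x)))
                                   (regroup (𝟙 (2 ≤? x)) (ℓ * ℓ′) ℓ (a x) X (b x) Y (c x) Z)) ⟩
    Σ< q (λ x → ℓ * ℓ′ * X * (𝟙 (2 ≤? x) * a x) + ℓ * Y * (𝟙 (2 ≤? x) * b x) + Z * (𝟙 (2 ≤? x) * c x))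
      ≡⟨ Σ-distrib-+ q (λ x → ℓ * ℓ′ * X * (𝟙 (2 ≤? x) * a x) + ℓ * Y * (𝟙 (2 ≤? x) * b x)) (λ x → Z * (𝟙 (2 ≤? x) * c x)) ⟩
    Σ< q (λ x → ℓ * ℓ′ * X * (𝟙 (2 ≤? x) * a x) + ℓ * Y * (𝟙 (2 ≤? x) * b x)) + Σ< q (λ x → Z * (𝟙 (2 ≤? x) * c x))
      ≡⟨ cong (_+ Σ< q (λ x → Z * (𝟙 (2 ≤? x) * c x)))
              (Σ-distrib-+ q (λ x → ℓ * ℓ′ * X * (𝟙 (2 ≤? x) * a x)) (λ x → ℓ * Y * (𝟙 (2 ≤? x) * b x))) ⟩
    Σ< q (λ x → ℓ * ℓ′ * X * (𝟙 (2 ≤? x) * a x)) + Σ< q (λ x → ℓ * Y * (𝟙 (2 ≤? x) * b x)) + Σ< q (λ x → Z * (𝟙 (2 ≤? x) * c x))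
      ≡⟨ cong₂ _+_ (cong₂ _+_ (Σ-*ˡ q (ℓ * ℓ′ * X) (λ x → 𝟙 (2 ≤? x) * a x)) (Σ-*ˡ q (ℓ * Y) (λ x → 𝟙 (2 ≤? x) * b x)))
                   (Σ-*ˡ q Z (λ x → 𝟙 (2 ≤? x) * c x)) ⟩
    ℓ * ℓ′ * X * A₀ + ℓ * Y * B₀ + Z * C₀
      ∎
    where
    open ≡-Reasoning
    X Y Z : ℕ
    X = 𝟙 (i ≟ 0)
    Y = 𝟙 (proper-multiple<L? i)
    Z = 𝟙 (unit<L? i)
    a b c : ℕ → ℕ
    a x = 𝟙 (T x ≟ 0)
    b x = 𝟙 (proper-multiple? (T x))
    c x = 𝟙 (unit? (T x))
    regroup : ∀ w α l a x b y c z → w * (α * (a * x) + l * (b * y) + c * z) ≡ α * x * (w * a) + l * y * (w * b) + z * (w * c)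
    regroup = solve-∀

  A₀≡ : A₀ ≡ count q G-Lth-power?
  A₀≡ = Σ-cong q (λ x x<q → trans (𝟙-× (2 ≤? x) (T x ≟ 0))
    (𝟙-cong ((2 ≤? x) ×-dec (T x ≟ 0)) (G-Lth-power? x) (⇒ x x<q) (⇐ x x<q)))
    where
    test≡ : ∀ x → G x ^ (m * 1) ≡ G x ^ m
    test≡ x = cong (G x ^_) (*-identityʳ m)
    ⇒ : ∀ x → x < q → 2 ≤ x × T x ≡ 0 → 2 ≤ x × G x ^ m ≈ 1
    ⇒ x x<q (2≤x , T≡0) = 2≤x , ≈-trans (≡⇒≈ (sym (test≡ x)))
      (^[m*d]≈1⇐ (G x) 1 (G≉0 x x<q 2≤x) (cong (_% L) (trans (+-identityʳ (T x)) T≡0)))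
    ⇐ : ∀ x → x < q → 2 ≤ x × G x ^ m ≈ 1 → 2 ≤ x × T x ≡ 0
    ⇐ x x<q (2≤x , e) = 2≤x , trans (sym (m<n⇒m%n≡m (T<L x x<q 2≤x)))
      (trans (cong (_% L) (sym (+-identityʳ (T x)))) (^[m*d]≈1⇒ (G x) 1 (G≉0 x x<q 2≤x) (≈-trans (≡⇒≈ (test≡ x)) e)))

  B₀+A₀≡ : B₀ + A₀ ≡ count q G-ℓth-power?
  B₀+A₀≡ = trans (sym (Σ-distrib-+ q (λ x → 𝟙 (2 ≤? x) * 𝟙 (proper-multiple? (T x))) (λ x → 𝟙 (2 ≤? x) * 𝟙 (T x ≟ 0))))
    (Σ-cong q (λ x x<q → begin
      𝟙 (2 ≤? x) * 𝟙 (proper-multiple? (T x)) + 𝟙 (2 ≤? x) * 𝟙 (T x ≟ 0)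
        ≡⟨ *-distribˡ-+ (𝟙 (2 ≤? x)) (𝟙 (proper-multiple? (T x))) (𝟙 (T x ≟ 0)) ⟨
      𝟙 (2 ≤? x) * (𝟙 (proper-multiple? (T x)) + 𝟙 (T x ≟ 0))
        ≡⟨ cong (𝟙 (2 ≤? x) *_) (multiple-split (T x)) ⟩
      𝟙 (2 ≤? x) * 𝟙 (T x % ℓ ≟ 0)
        ≡⟨ 𝟙-× (2 ≤? x) (T x % ℓ ≟ 0) ⟩
      𝟙 ((2 ≤? x) ×-dec (T x % ℓ ≟ 0))
        ≡⟨ 𝟙-cong ((2 ≤? x) ×-dec (T x % ℓ ≟ 0)) (G-ℓth-power? x) (⇒ x x<q) (⇐ x x<q) ⟩
      𝟙 (G-ℓth-power? x)
        ∎))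
    where
    open ≡-Reasoning
    multiple-split : ∀ t → 𝟙 (proper-multiple? t) + 𝟙 (t ≟ 0) ≡ 𝟙 (t % ℓ ≟ 0)
    multiple-split zero    = refl
    multiple-split (suc t) = trans (+-identityʳ _) (𝟙-cong (proper-multiple? (suc t)) (suc t % ℓ ≟ 0) proj₁ (λ e → e , λ ()))
    ℓ*t%L : ∀ t → (ℓ * t) % L ≡ t % ℓ * ℓ
    ℓ*t%L t = trans (cong (_% L) (*-comm ℓ t)) (sym (m%n*o≡m*o%[n*o] t ℓ ℓ))
    ⇒ : ∀ x → x < q → 2 ≤ x × T x % ℓ ≡ 0 → 2 ≤ x × G x ^ (m * ℓ) ≈ 1
    ⇒ x x<q (2≤x , e) = 2≤x , ^[m*d]≈1⇐ (G x) ℓ (G≉0 x x<q 2≤x) (trans (ℓ*t%L (T x)) (cong (_* ℓ) e))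
    ⇐ : ∀ x → x < q → 2 ≤ x × G x ^ (m * ℓ) ≈ 1 → 2 ≤ x × T x % ℓ ≡ 0
    ⇐ x x<q (2≤x , e) = 2≤x , m*n≡0⇒m≡0 (T x % ℓ) ℓ (trans (sym (ℓ*t%L (T x))) (^[m*d]≈1⇒ (G x) ℓ (G≉0 x x<q 2≤x) e))

  affineCount≡affine-points : affineCount ℓ q ≡ affine-points
  affineCount≡affine-points = begin
    affineCount ℓ q
      ≡⟨ length-filter-concatMap (true Bool.≟_) row (upTo q) ⟩
    sum (map (length ∘ filter (true Bool.≟_) ∘ row) (upTo q))
      ≡⟨ sum-map-upTo (length ∘ filter (true Bool.≟_) ∘ row) q ⟩
    Σ< q (length ∘ filter (true Bool.≟_) ∘ row)
      ≡⟨ Σ-cong q (λ x _ → trans (length-filter-map (true Bool.≟_) (isAffinePoint ℓ q x) (upTo q))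
                                 (trans (sum-map-upTo (λ y → 𝟙 (true Bool.≟ isAffinePoint ℓ q x y)) q)
                                        (Σ-cong q (λ y _ → on-curve x y)))) ⟩
    affine-points
      ∎
    where
    open ≡-Reasoning
    row : ℕ → List Bool
    row x = map (isAffinePoint ℓ q x) (upTo q)
    𝟙-true≟⌊⌋ : ∀ {a} {P : Set a} (d : Dec P) → 𝟙 (true Bool.≟ ⌊ d ⌋) ≡ 𝟙 d
    𝟙-true≟⌊⌋ (yes _) = refl
    𝟙-true≟⌊⌋ (no _)  = refl
    on-curve : ∀ x y → 𝟙 (true Bool.≟ isAffinePoint ℓ q x y) ≡ 𝟙 (y ^ ℓ ≈? F x)
    on-curve x y = trans (𝟙-true≟⌊⌋ ((y ^ ℓ) % q ≟ F x % q)) (𝟙-cong ((y ^ ℓ) % q ≟ F x % q) (y ^ ℓ ≈? F x) mk≈ un≈)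

  point-count-identity : affine-points + 1 + ℓ * B₀ ≡ ℓ * ℓ′ * A₀ + q + 1
  point-count-identity = begin
    affine-points + 1 + ℓ * B₀
      ≡⟨ cong (λ n → n + 1 + ℓ * B₀) (trans affine-points≡
           (cong (λ n → suc ℓ + ℓ * n) (trans count-F-ℓth-powers (cong (ℓ *_) (sym A₀≡))))) ⟩
    suc ℓ + ℓ * (ℓ * A₀) + 1 + ℓ * B₀
      ≡⟨ regroup ℓ′ A₀ B₀ ⟩
    2 + ℓ * ℓ′ * A₀ + ℓ * (B₀ + A₀ + 1)
      ≡⟨ cong (λ n → 2 + ℓ * ℓ′ * A₀ + ℓ * (n + 1)) B₀+A₀≡ ⟩
    2 + ℓ * ℓ′ * A₀ + ℓ * (count q G-ℓth-power? + 1)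
      ≡⟨ cong (λ n → 2 + ℓ * ℓ′ * A₀ + ℓ * n) count-G-ℓth-powers ⟩
    2 + ℓ * ℓ′ * A₀ + ℓ * (m * ℓ)
      ≡⟨ cong (λ n → 2 + ℓ * ℓ′ * A₀ + n) (trans (regroup′ ℓ m) m*L≡q-1) ⟩
    2 + ℓ * ℓ′ * A₀ + suc k
      ≡⟨ regroup″ (ℓ * ℓ′ * A₀) k ⟩
    ℓ * ℓ′ * A₀ + q + 1
      ∎
    where
    open ≡-Reasoning
    regroup : ∀ l A B → suc (suc l) + suc l * (suc l * A) + 1 + suc l * B ≡ 2 + suc l * l * A + suc l * (B + A + 1)
    regroup = solve-∀
    regroup′ : ∀ l m → l * (m * l) ≡ m * (l * l)
    regroup′ = solve-∀
    regroup″ : ∀ X k → 2 + X + suc k ≡ X + suc (suc k) + 1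
    regroup″ = solve-∀

  point-count-difference : + pointCount ℓ q ℤ.- + q ℤ.- + 1 ≡ + (ℓ * ℓ′ * A₀) ℤ.- + (ℓ * B₀)
  point-count-difference = begin
    + (affineCount ℓ q + 1) ℤ.- + q ℤ.- + 1
      ≡⟨ cong (λ n → + (n + 1) ℤ.- + q ℤ.- + 1) affineCount≡affine-points ⟩
    + (affine-points + 1) ℤ.- + q ℤ.- + 1
      ≡⟨ add-both (+ (affine-points + 1)) (+ q) (+ (ℓ * B₀)) ⟩
    + (affine-points + 1 + ℓ * B₀) ℤ.- (+ q ℤ.+ + 1 ℤ.+ + (ℓ * B₀))
      ≡⟨ cong (λ n → + n ℤ.- (+ q ℤ.+ + 1 ℤ.+ + (ℓ * B₀))) point-count-identity ⟩
    + (ℓ * ℓ′ * A₀ + q + 1) ℤ.- (+ q ℤ.+ + 1 ℤ.+ + (ℓ * B₀))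
      ≡⟨ cancel (+ (ℓ * ℓ′ * A₀)) (+ q) (+ (ℓ * B₀)) ⟩
    + (ℓ * ℓ′ * A₀) ℤ.- + (ℓ * B₀)
      ∎
    where
    open ≡-Reasoning
    add-both : ∀ (P Q Y : ℤ) → P ℤ.- Q ℤ.- + 1 ≡ (P ℤ.+ Y) ℤ.- (Q ℤ.+ + 1 ℤ.+ Y)
    add-both = ℤ-solve-∀
    cancel : ∀ (X Q Y : ℤ) → (X ℤ.+ Q ℤ.+ + 1) ℤ.- (Q ℤ.+ + 1 ℤ.+ Y) ≡ X ℤ.- Y
    cancel = ℤ-solve-∀

  sumMonomials-trace : ∀ i → sumMonomials (traceJacobi ℓ q u a₀ 1) i ≡
                       + (ℓ * ℓ′ * 𝟙 (i ≟ 0) * A₀ + ℓ * 𝟙 (proper-multiple<L? i) * B₀ + 𝟙 (unit<L? i) * C₀)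
  sumMonomials-trace i = cong +_ (trans (exponent-count i) (exponent-count-formula i))

  constant-coefficient : sumMonomials (traceJacobi ℓ q u a₀ 1) 0 ℤ.- (+ pointCount ℓ q ℤ.- + q ℤ.- + 1) ≡
                         mulCoeff (cyclotomicPrimeSq ℓ) (cofactor (ℓ * B₀) C₀) 0
  constant-coefficient = begin
    sumMonomials (traceJacobi ℓ q u a₀ 1) 0 ℤ.- (+ pointCount ℓ q ℤ.- + q ℤ.- + 1)
      ≡⟨ cong₂ ℤ._-_ (sumMonomials-trace 0) point-count-difference ⟩
    + (ℓ * ℓ′ * 1 * A₀ + ℓ * 𝟙 (proper-multiple<L? 0) * B₀ + 𝟙 (unit<L? 0) * C₀) ℤ.- (+ (ℓ * ℓ′ * A₀) ℤ.- + (ℓ * B₀))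
      ≡⟨ cong (λ n → + n ℤ.- (+ (ℓ * ℓ′ * A₀) ℤ.- + (ℓ * B₀))) (trans
           (cong₂ (λ y z → ℓ * ℓ′ * 1 * A₀ + ℓ * y * B₀ + z * C₀)
                  (𝟙-no (proper-multiple<L? 0) (λ p → proj₂ (proj₂ p) refl)) (𝟙-no (unit<L? 0) (λ p → proj₂ p refl)))
           (only-A₀ (ℓ * ℓ′) A₀ ℓ B₀)) ⟩
    + (ℓ * ℓ′ * A₀) ℤ.- (+ (ℓ * ℓ′ * A₀) ℤ.- + (ℓ * B₀))
      ≡⟨ x-[x-y]≡y (+ (ℓ * ℓ′ * A₀)) (+ (ℓ * B₀)) ⟩
    + (ℓ * B₀)
      ≡⟨ cong +_ (trans (cong₂ (λ x z → ℓ * B₀ * x + C₀ * z) (𝟙-yes (multiple<L? 0) (z<s , refl))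
                                                             (𝟙-no (unit<L? 0) (λ p → proj₂ p refl)))
                        (only-B₀ (ℓ * B₀) C₀)) ⟨
    + (ℓ * B₀ * 𝟙 (multiple<L? 0) + C₀ * 𝟙 (unit<L? 0))
      ≡⟨ mulCoeff-Φ-cofactor (ℓ * B₀) C₀ 0 ⟨
    mulCoeff (cyclotomicPrimeSq ℓ) (cofactor (ℓ * B₀) C₀) 0
      ∎
    where
    open ≡-Reasoning
    x-[x-y]≡y : ∀ (x y : ℤ) → x ℤ.- (x ℤ.- y) ≡ y
    x-[x-y]≡y = ℤ-solve-∀
    only-A₀ : ∀ a b c d → a * 1 * b + c * 0 * d + 0 * c ≡ a * b
    only-A₀ = solve-∀
    only-B₀ : ∀ y c → y * 1 + c * 0 ≡ y
    only-B₀ = solve-∀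

  higher-coefficient : ∀ j → sumMonomials (traceJacobi ℓ q u a₀ 1) (suc j) ℤ.- + 0 ≡
                             mulCoeff (cyclotomicPrimeSq ℓ) (cofactor (ℓ * B₀) C₀) (suc j)
  higher-coefficient j = begin
    sumMonomials (traceJacobi ℓ q u a₀ 1) (suc j) ℤ.- + 0
      ≡⟨ cong (ℤ._- + 0) (sumMonomials-trace (suc j)) ⟩
    + (ℓ * ℓ′ * 0 * A₀ + ℓ * 𝟙 (proper-multiple<L? (suc j)) * B₀ + 𝟙 (unit<L? (suc j)) * C₀) ℤ.- + 0
      ≡⟨ cong +_ (trans (cong (λ y → ℓ * ℓ′ * 0 * A₀ + ℓ * y * B₀ + 𝟙 (unit<L? (suc j)) * C₀ + 0) proper≡multiple)
                        (rearrange (ℓ * ℓ′) A₀ ℓ (𝟙 (multiple<L? (suc j))) B₀ (𝟙 (unit<L? (suc j))) C₀)) ⟩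
    + (ℓ * B₀ * 𝟙 (multiple<L? (suc j)) + C₀ * 𝟙 (unit<L? (suc j)))
      ≡⟨ mulCoeff-Φ-cofactor (ℓ * B₀) C₀ (suc j) ⟨
    mulCoeff (cyclotomicPrimeSq ℓ) (cofactor (ℓ * B₀) C₀) (suc j)
      ∎
    where
    open ≡-Reasoning
    proper≡multiple : 𝟙 (proper-multiple<L? (suc j)) ≡ 𝟙 (multiple<L? (suc j))
    proper≡multiple = 𝟙-cong (proper-multiple<L? (suc j)) (multiple<L? (suc j)) (λ (lt , e , _) → lt , e) (λ (lt , e) → lt , e , λ ())
    rearrange : ∀ a b l f d g c → a * 0 * b + l * f * d + g * c + 0 ≡ l * d * f + c * g
    rearrange = solve-∀

  trace-formula : CycEqInt ℓ (traceJacobi ℓ q u a₀ 1) (+ pointCount ℓ q ℤ.- + q ℤ.- + 1)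
  trace-formula = cofactor (ℓ * B₀) C₀ , coefficient
    where
    coefficient : ∀ i → sumMonomials (traceJacobi ℓ q u a₀ 1) i ℤ.- constPoly (+ pointCount ℓ q ℤ.- + q ℤ.- + 1) i ≡
                        mulCoeff (cyclotomicPrimeSq ℓ) (cofactor (ℓ * B₀) C₀) i
    coefficient zero    = constant-coefficient
    coefficient (suc j) = higher-coefficient j

open import Defs
open import Data.Nat using (zero; _∸_; _≤_; _<_)
open import Data.Nat.Primality using (¬prime[0]; ¬prime[1])
open import Data.Integer using (+_; _-_)
open import Relation.Nullary using (contradiction)

lemma2p9 : (ℓ q : ℕ) → Prime ℓ → 3 ≤ ℓ → Prime q → q mod (ℓ * ℓ) ≡ 1 →
    (u : ℕ) → u < q → HasOrder q u (ℓ * ℓ) →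
    CycEqInt ℓ (traceJacobi ℓ q u (ℓ * (ℓ ∸ 1)) 1) (+ pointCount ℓ q - + q - + 1)
lemma2p9 zero          q             ℓ-prime _ _       _   _ _ _       = contradiction ℓ-prime ¬prime[0]
lemma2p9 (suc ℓ′)      zero          _       _ q-prime _   _ _ _       = contradiction q-prime ¬prime[0]
lemma2p9 (suc ℓ′)      (suc zero)    _       _ q-prime _   _ _ _       = contradiction q-prime ¬prime[1]
lemma2p9 (suc ℓ′)      (suc (suc k)) ℓ-prime _ q-prime q≡1 u _ u-order =
  TraceFormula.trace-formula k q-prime ℓ′ ℓ-prime q≡1 u u-order
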